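{- Let $p$ be a prime, $n$ a positive integer, and let $A=\{a_1,\dots,a_{p^n}\}$ be a set of $p^n$ distinct non-negative integers which tiles $\mathbb{Z}$. For $i\neq j$ let $e_{ij}$ be the exponent of the highest power of $p$ dividing $a_i-a_j$. Then $S_A=\{p^{e_{ij}+1}:1\leq i,j\leq p^n,\ i\neq j\}$.
   Context: A finite set $A\subset\mathbb{Z}$ tiles $\mathbb{Z}$ if there is $C\subset\mathbb{Z}$ such that every integer is uniquely $a+c$ with $a\in A$, $c\in C$. $A(x)=\sum_{a\in A}x^a$, and $S_A$ is the set of prime powers $s=q^\beta$ ($q$ prime, $\beta\geq1$) such that the cyclotomic polynomial $\Phi_s(x)$ divides $A(x)$. -}

module Defs where

open import Data.Nat as ℕ using (ℕ; zero; suc; _^_; _≥_; _∸_)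
open import Data.Nat.Primality using (Prime)
open import Data.Integer as ℤ using (ℤ; +_; 0ℤ; 1ℤ)
open import Data.List using (List; []; _∷_; _++_; replicate; map; foldr; upTo; allFin)
open import Data.Fin using (Fin)

open import Data.Product using (Σ; ∃; _×_)
open import Relation.Binary.PropositionalEquality using (_≡_)
open import Relation.Unary using (Pred; _∈_)
open import Level using (0ℓ)

-- Polynomials with integer coefficients, as coefficient lists
-- (the i-th entry is the coefficient of x^i).

Poly : Set
Poly = List ℤ

coeff : Poly → ℕ → ℤ
coeff []       _       = 0ℤ
coeff (c ∷ _)  zero    = c
coeff (_ ∷ cs) (suc k) = coeff cs k

infixl 6 _+ₚ_
infixl 7 _*ₚ_
infix  4 _≈ₚ_ _∣ₚ_

_+ₚ_ : Poly → Poly → Poly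
[]       +ₚ q        = q
(a ∷ p)  +ₚ []       = a ∷ p
(a ∷ p)  +ₚ (b ∷ q)  = (a ℤ.+ b) ∷ (p +ₚ q)

_*ₚ_ : Poly → Poly → Poly
[]      *ₚ q = []
(a ∷ p) *ₚ q = map (a ℤ.*_) q +ₚ (0ℤ ∷ (p *ₚ q))

_≈ₚ_ : Poly → Poly → Set
p ≈ₚ q = ∀ k → coeff p k ≡ coeff q k

_∣ₚ_ : Poly → Poly → Set
d ∣ₚ f = Σ Poly λ g → (d *ₚ g) ≈ₚ f

mono : ℕ → Poly
mono m = replicate m 0ℤ ++ (1ℤ ∷ [])

sumₚ : List Poly → Poly
sumₚ = foldr _+ₚ_ []

-- Cyclotomic polynomial of a prime power q^β (β ≥ 1):
--   Φ_{q^β}(x) = (x^{q^β} - 1)/(x^{q^{β-1}} - 1) = Σ_{k<q} x^{k q^{β-1}}.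

cyclotomicPP : (q β : ℕ) → Poly
cyclotomicPP q β = sumₚ (map (λ k → mono (k ℕ.* q ^ (β ∸ 1))) (upTo q))

-- A finite set A = {a_0, …, a_{N-1}} ⊂ ℕ given by an injective family.

maskPoly : {N : ℕ} → (Fin N → ℕ) → Poly
maskPoly {N} a = sumₚ (map (λ i → mono (a i)) (allFin N))

Tiles : {N : ℕ} → (Fin N → ℕ) → Set₁
Tiles {N} a =
  Σ (Pred ℤ 0ℓ) λ C →
    (∀ z → Σ (Fin N) λ i → Σ ℤ λ c → c ∈ C × z ≡ (+ a i) ℤ.+ c)
    × (∀ i j c d → c ∈ C → d ∈ C →
         (+ a i) ℤ.+ c ≡ (+ a j) ℤ.+ d → i ≡ j × c ≡ d)

InS : {N : ℕ} → (Fin N → ℕ) → ℕ → Set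
InS a s = Σ ℕ λ q → Σ ℕ λ β →
  Prime q × β ≥ 1 × s ≡ q ^ β × cyclotomicPP q β ∣ₚ maskPoly a

-- Write P = p^(k+1) and D = p^k. Φ_P divides a polynomial f exactly when the class sums
-- s ↦ Σ {f_i : P ∣ s + i} are D-periodic ("f is balanced at level k"), and balance behaves like
-- divisibility by a prime: if f g is balanced at level k, so is f or g (proved by a descent on
-- the p-adic size of difference sequences).
--
-- Let A ⊕ C = ℤ with |A| = p^n. The complement C is eventually periodic, so for a suitable period M
-- the mask C0 of one period satisfies A(x) C0(x) ≡ (x^M - 1)/(x - 1) modulo x^M - 1. This product is
-- balanced at every level below K = v_p(M), hence each such level is a balanced level of A or of C0.
-- Every balanced level of C0 contributes a factor p to C0(1), and |A| C0(1) = M, so C0 has at most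
-- K - n balanced levels and A at least n of them. Refining residue classes level by level, a set
-- with L balanced levels has at least p^L elements, and at least 2 p^L if some difference a i - a j
-- has its p-adic valuation e at an unbalanced level. With |A| = p^n every such e is therefore
-- balanced, i.e. Φ_{p^(e+1)} divides A(x).
--
-- Conversely, Φ_{q^β} ∣ A(x) gives q ∣ A(1) = p^n, so q = p, and balance at level β - 1 forces two
-- elements of A in the same class modulo p^(β-1) but in different classes modulo p^β.

module Submission where

open import Defs
open import Data.Nat using (ℕ; suc; _^_; _≥_; ∣_-_∣; s≤s; z≤n)
open import Data.Nat.Divisibility using (_∣_)
open import Data.Nat.Primality using (Prime)
open import Data.Fin using (Fin)
open import Data.Product using (Σ; _×_; _,_)
open import Function.Bundles using (_⇔_; mk⇔)
open import Function.Definitions using (Injective)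
open import Relation.Binary.PropositionalEquality using (_≡_)
open import Relation.Nullary using (¬_)

module Polynomials where

  open import Defs
  open import Data.Integer using (ℤ; 0ℤ; 1ℤ; -_; _+_; _*_)
  import Data.Integer.Properties as ℤP
  open import Data.Integer.Tactic.RingSolver
  open import Data.Nat using (ℕ; zero; suc)
  open import Data.List using ([]; _∷_; map)
  open import Relation.Binary.PropositionalEquality

  -- A record version of _≈ₚ_, so that both polynomials can be inferred from a proof.
  infix 4 _≋_
  record _≋_ (p q : Poly) : Set where
    constructor mk≋
    field get : ∀ k → coeff p k ≡ coeff q k
  open _≋_ public

  ≋→≈ : ∀ {p q} → p ≋ q → p ≈ₚ q
  ≋→≈ e = get e

  ≈→≋ : ∀ {p q} → p ≈ₚ q → p ≋ q
  ≈→≋ e = mk≋ e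

  ≋refl : ∀ {p} → p ≋ p
  ≋refl = mk≋ (λ k → refl)

  ≋sym : ∀ {p q} → p ≋ q → q ≋ p
  ≋sym e = mk≋ (λ k → sym (get e k))

  ≋trans : ∀ {p q r} → p ≋ q → q ≋ r → p ≋ r
  ≋trans e f = mk≋ (λ k → trans (get e k) (get f k))

  infixr 2 _≋⟨_⟩_
  infix 3 _∎≋
  _≋⟨_⟩_ : ∀ p {q r} → p ≋ q → q ≋ r → p ≋ r
  p ≋⟨ e ⟩ f = ≋trans e f
  _∎≋ : ∀ p → p ≋ p
  p ∎≋ = ≋refl

  scale : ℤ → Poly → Poly
  scale a p = map (a *_) p

  neg : Poly → Poly
  neg p = map (-_) p

  infixl 6 _-ₚ_
  _-ₚ_ : Poly → Poly → Poly
  p -ₚ q = p +ₚ neg q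

  shift : Poly → Poly
  shift p = 0ℤ ∷ p

  coeff-+ : ∀ p q k → coeff (p +ₚ q) k ≡ coeff p k + coeff q k
  coeff-+ [] q k = sym (ℤP.+-identityˡ _)
  coeff-+ (a ∷ p) [] k = sym (ℤP.+-identityʳ _)
  coeff-+ (a ∷ p) (b ∷ q) zero = refl
  coeff-+ (a ∷ p) (b ∷ q) (suc k) = coeff-+ p q k

  coeff-scale : ∀ a p k → coeff (scale a p) k ≡ a * coeff p k
  coeff-scale a [] k = sym (ℤP.*-zeroʳ a)
  coeff-scale a (b ∷ p) zero = refl
  coeff-scale a (b ∷ p) (suc k) = coeff-scale a p k

  coeff-neg : ∀ p k → coeff (neg p) k ≡ - coeff p k
  coeff-neg [] k = refl
  coeff-neg (b ∷ p) zero = refl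
  coeff-neg (b ∷ p) (suc k) = coeff-neg p k

  cons-cong : ∀ {a b p q} → a ≡ b → p ≋ q → (a ∷ p) ≋ (b ∷ q)
  cons-cong e f = mk≋ λ { zero → e ; (suc k) → get f k }

  +-cong : ∀ {p p' q q'} → p ≋ p' → q ≋ q' → (p +ₚ q) ≋ (p' +ₚ q')
  +-cong {p} {p'} {q} {q'} e f = mk≋ λ k → trans (coeff-+ p q k) (trans (cong₂ _+_ (get e k) (get f k)) (sym (coeff-+ p' q' k)))

  +-congˡ : ∀ {p q q'} → q ≋ q' → (p +ₚ q) ≋ (p +ₚ q')
  +-congˡ e = +-cong ≋refl e

  +-congʳ : ∀ {p p' q} → p ≋ p' → (p +ₚ q) ≋ (p' +ₚ q)
  +-congʳ e = +-cong e ≋refl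

  scale-cong : ∀ {a p q} → p ≋ q → scale a p ≋ scale a q
  scale-cong {a} {p} {q} e = mk≋ λ k → trans (coeff-scale a p k) (trans (cong (a *_) (get e k)) (sym (coeff-scale a q k)))

  neg-cong : ∀ {p q} → p ≋ q → neg p ≋ neg q
  neg-cong {p} {q} e = mk≋ λ k → trans (coeff-neg p k) (trans (cong -_ (get e k)) (sym (coeff-neg q k)))

  +-comm : ∀ p q → (p +ₚ q) ≋ (q +ₚ p)
  +-comm p q = mk≋ λ k → trans (coeff-+ p q k) (trans (ℤP.+-comm (coeff p k) (coeff q k)) (sym (coeff-+ q p k)))

  +-assoc : ∀ p q r → ((p +ₚ q) +ₚ r) ≋ (p +ₚ (q +ₚ r))
  +-assoc p q r = mk≋ λ k → begin
    coeff ((p +ₚ q) +ₚ r) k ≡⟨ coeff-+ (p +ₚ q) r k ⟩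
    coeff (p +ₚ q) k + coeff r k ≡⟨ cong (λ x → x + coeff r k) (coeff-+ p q k) ⟩
    coeff p k + coeff q k + coeff r k ≡⟨ ℤP.+-assoc (coeff p k) (coeff q k) (coeff r k) ⟩
    coeff p k + (coeff q k + coeff r k) ≡⟨ cong (λ x → coeff p k + x) (sym (coeff-+ q r k)) ⟩
    coeff p k + coeff (q +ₚ r) k ≡⟨ sym (coeff-+ p (q +ₚ r) k) ⟩
    coeff (p +ₚ (q +ₚ r)) k ∎
    where open ≡-Reasoning

  +-idʳ : ∀ p → (p +ₚ []) ≋ p
  +-idʳ [] = ≋refl
  +-idʳ (a ∷ p) = ≋refl

  +-idˡ : ∀ p → ([] +ₚ p) ≋ p
  +-idˡ p = ≋refl

  IsZeroₚ : Poly → Set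
  IsZeroₚ p = p ≋ []

  shift-+ : ∀ p q → (shift p +ₚ shift q) ≋ shift (p +ₚ q)
  shift-+ p q = mk≋ λ { zero → refl ; (suc k) → refl }

  mul-cons : ∀ a p r k → coeff ((a ∷ p) *ₚ r) k ≡ a * coeff r k + coeff (shift (p *ₚ r)) k
  mul-cons a p r k = trans (coeff-+ (scale a r) (shift (p *ₚ r)) k) (cong (λ x → x + coeff (shift (p *ₚ r)) k) (coeff-scale a r k))

  shift-cong : ∀ {p q} → p ≋ q → shift p ≋ shift q
  shift-cong e = cons-cong refl e

  *-congʳ : ∀ p {q q'} → q ≋ q' → (p *ₚ q) ≋ (p *ₚ q')
  *-congʳ [] e = ≋refl
  *-congʳ (a ∷ p) {q} {q'} e = mk≋ λ k → trans (mul-cons a p q k) (trans (cong₂ _+_ (cong (a *_) (get e k)) (get (shift-cong (*-congʳ p e)) k)) (sym (mul-cons a p q' k)))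

  mul-zero : ∀ p r → IsZeroₚ p → IsZeroₚ (p *ₚ r)
  mul-zero [] r z = ≋refl
  mul-zero (a ∷ p) r z = mk≋ λ k → trans (mul-cons a p r k) (trans (cong₂ _+_ (cong (_* coeff r k) (get z zero)) (get (shift-cong (mul-zero p r (mk≋ λ k → get z (suc k)))) k)) (lem k))
    where
    lem : ∀ k → 0ℤ * coeff r k + coeff (shift []) k ≡ 0ℤ
    lem zero = refl
    lem (suc k) = refl

  *-congˡ : ∀ {p p'} r → p ≋ p' → (p *ₚ r) ≋ (p' *ₚ r)
  *-congˡ {[]} {[]} r e = ≋refl
  *-congˡ {[]} {b ∷ p'} r e = ≋sym (mul-zero (b ∷ p') r (≋sym e))
  *-congˡ {a ∷ p} {[]} r e = mul-zero (a ∷ p) r e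
  *-congˡ {a ∷ p} {b ∷ p'} r e = mk≋ λ k → trans (mul-cons a p r k) (trans (cong₂ _+_ (cong (_* coeff r k) (get e zero)) (get (shift-cong (*-congˡ {p} {p'} r (mk≋ λ k → get e (suc k)))) k)) (sym (mul-cons b p' r k)))

  *-cong : ∀ {p p' q q'} → p ≋ p' → q ≋ q' → (p *ₚ q) ≋ (p' *ₚ q')
  *-cong {p} {p'} {q} {q'} e f = ≋trans (*-congˡ q e) (*-congʳ p' f)

  scale-mul : ∀ a q r → (scale a q *ₚ r) ≋ scale a (q *ₚ r)
  scale-mul a [] r = ≋refl
  scale-mul a (b ∷ q) r = mk≋ λ k → begin
    coeff (scale a (b ∷ q) *ₚ r) k ≡⟨ mul-cons (a * b) (scale a q) r k ⟩
    a * b * coeff r k + coeff (shift (scale a q *ₚ r)) k ≡⟨ cong (λ x → a * b * coeff r k + x) (get (shift-cong (scale-mul a q r)) k) ⟩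
    a * b * coeff r k + coeff (shift (scale a (q *ₚ r))) k ≡⟨ lem k ⟩
    a * (b * coeff r k + coeff (shift (q *ₚ r)) k) ≡⟨ cong (a *_) (sym (mul-cons b q r k)) ⟩
    a * coeff ((b ∷ q) *ₚ r) k ≡⟨ sym (coeff-scale a ((b ∷ q) *ₚ r) k) ⟩
    coeff (scale a ((b ∷ q) *ₚ r)) k ∎
    where
    open ≡-Reasoning
    alg : ∀ a b c d → a * b * c + a * d ≡ a * (b * c + d)
    alg = solve-∀
    alg0 : ∀ a b c → a * b * c + 0ℤ ≡ a * (b * c + 0ℤ)
    alg0 = solve-∀
    lem : ∀ k → a * b * coeff r k + coeff (shift (scale a (q *ₚ r))) k ≡ a * (b * coeff r k + coeff (shift (q *ₚ r)) k)
    lem zero = alg0 a b (coeff r zero)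
    lem (suc k) = trans (cong (λ x → a * b * coeff r (suc k) + x) (coeff-scale a (q *ₚ r) k)) (alg a b (coeff r (suc k)) (coeff (q *ₚ r) k))

  shift-mul : ∀ q r → (shift q *ₚ r) ≋ shift (q *ₚ r)
  shift-mul q r = mk≋ λ k → trans (mul-cons 0ℤ q r k) (trans (cong (λ x → x + coeff (shift (q *ₚ r)) k) (ℤP.*-zeroˡ (coeff r k))) (ℤP.+-identityˡ _))

  distribʳ : ∀ p q r → ((p +ₚ q) *ₚ r) ≋ ((p *ₚ r) +ₚ (q *ₚ r))
  distribʳ [] q r = ≋refl
  distribʳ (a ∷ p) [] r = ≋sym (+-idʳ _)
  distribʳ (a ∷ p) (b ∷ q) r = mk≋ λ k → begin
    coeff (((a + b) ∷ (p +ₚ q)) *ₚ r) k ≡⟨ mul-cons (a + b) (p +ₚ q) r k ⟩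
    (a + b) * coeff r k + coeff (shift ((p +ₚ q) *ₚ r)) k ≡⟨ cong (λ x → (a + b) * coeff r k + x) (get (shift-cong (distribʳ p q r)) k) ⟩
    (a + b) * coeff r k + coeff (shift ((p *ₚ r) +ₚ (q *ₚ r))) k ≡⟨ cong (λ x → (a + b) * coeff r k + x) (sym (get (shift-+ (p *ₚ r) (q *ₚ r)) k)) ⟩
    (a + b) * coeff r k + coeff (shift (p *ₚ r) +ₚ shift (q *ₚ r)) k ≡⟨ cong (λ x → (a + b) * coeff r k + x) (coeff-+ (shift (p *ₚ r)) (shift (q *ₚ r)) k) ⟩
    (a + b) * coeff r k + (coeff (shift (p *ₚ r)) k + coeff (shift (q *ₚ r)) k) ≡⟨ alg a b (coeff r k) (coeff (shift (p *ₚ r)) k) (coeff (shift (q *ₚ r)) k) ⟩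
    (a * coeff r k + coeff (shift (p *ₚ r)) k) + (b * coeff r k + coeff (shift (q *ₚ r)) k) ≡⟨ cong₂ _+_ (sym (mul-cons a p r k)) (sym (mul-cons b q r k)) ⟩
    coeff ((a ∷ p) *ₚ r) k + coeff ((b ∷ q) *ₚ r) k ≡⟨ sym (coeff-+ ((a ∷ p) *ₚ r) ((b ∷ q) *ₚ r) k) ⟩
    coeff (((a ∷ p) *ₚ r) +ₚ ((b ∷ q) *ₚ r)) k ∎
    where
    open ≡-Reasoning
    alg : ∀ a b c d e → (a + b) * c + (d + e) ≡ (a * c + d) + (b * c + e)
    alg = solve-∀

  *-assoc : ∀ p q r → ((p *ₚ q) *ₚ r) ≋ (p *ₚ (q *ₚ r))
  *-assoc [] q r = ≋refl
  *-assoc (a ∷ p) q r =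
    ((scale a q +ₚ shift (p *ₚ q)) *ₚ r) ≋⟨ distribʳ (scale a q) (shift (p *ₚ q)) r ⟩
    ((scale a q *ₚ r) +ₚ (shift (p *ₚ q) *ₚ r)) ≋⟨ +-cong (scale-mul a q r) (shift-mul (p *ₚ q) r) ⟩
    (scale a (q *ₚ r) +ₚ shift ((p *ₚ q) *ₚ r)) ≋⟨ +-congˡ (shift-cong (*-assoc p q r)) ⟩
    (scale a (q *ₚ r) +ₚ shift (p *ₚ (q *ₚ r))) ∎≋

  *-identityˡ : ∀ q → ((1ℤ ∷ []) *ₚ q) ≋ q
  *-identityˡ q = mk≋ λ k → trans (mul-cons 1ℤ [] q k) (trans (cong (λ x → x + coeff (shift []) k) (ℤP.*-identityˡ (coeff q k))) (lem k))
    where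
    lem : ∀ k → coeff q k + coeff (shift []) k ≡ coeff q k
    lem zero = ℤP.+-identityʳ _
    lem (suc k) = ℤP.+-identityʳ _

  mul-[] : ∀ p → IsZeroₚ (p *ₚ [])
  mul-[] [] = ≋refl
  mul-[] (a ∷ p) = mk≋ λ { zero → refl ; (suc k) → get (mul-[] p) k }

  mul-rcons : ∀ q a p → (q *ₚ (a ∷ p)) ≋ (scale a q +ₚ shift (q *ₚ p))
  mul-rcons [] a p = mk≋ λ { zero → refl ; (suc k) → refl }
  mul-rcons (b ∷ q) a p = mk≋ λ { zero → cong (_+ 0ℤ) (ℤP.*-comm b a) ; (suc k) → lem k }
    where
    open ≡-Reasoning
    alg : ∀ x y z → x + (y + z) ≡ y + (x + z)
    alg = solve-∀
    lem : ∀ k → coeff (scale b p +ₚ (q *ₚ (a ∷ p))) k ≡ coeff (scale a q +ₚ (scale b p +ₚ shift (q *ₚ p))) k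
    lem k = begin
      coeff (scale b p +ₚ (q *ₚ (a ∷ p))) k ≡⟨ coeff-+ (scale b p) (q *ₚ (a ∷ p)) k ⟩
      coeff (scale b p) k + coeff (q *ₚ (a ∷ p)) k ≡⟨ cong (λ x → coeff (scale b p) k + x) (get (mul-rcons q a p) k) ⟩
      coeff (scale b p) k + coeff (scale a q +ₚ shift (q *ₚ p)) k ≡⟨ cong (λ x → coeff (scale b p) k + x) (coeff-+ (scale a q) (shift (q *ₚ p)) k) ⟩
      coeff (scale b p) k + (coeff (scale a q) k + coeff (shift (q *ₚ p)) k) ≡⟨ alg (coeff (scale b p) k) (coeff (scale a q) k) (coeff (shift (q *ₚ p)) k) ⟩
      coeff (scale a q) k + (coeff (scale b p) k + coeff (shift (q *ₚ p)) k) ≡⟨ cong (λ x → coeff (scale a q) k + x) (sym (coeff-+ (scale b p) (shift (q *ₚ p)) k)) ⟩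
      coeff (scale a q) k + coeff (scale b p +ₚ shift (q *ₚ p)) k ≡⟨ sym (coeff-+ (scale a q) (scale b p +ₚ shift (q *ₚ p)) k) ⟩
      coeff (scale a q +ₚ (scale b p +ₚ shift (q *ₚ p))) k ∎

  *-comm : ∀ p q → (p *ₚ q) ≋ (q *ₚ p)
  *-comm [] q = ≋sym (mul-[] q)
  *-comm (a ∷ p) q =
    (scale a q +ₚ shift (p *ₚ q)) ≋⟨ +-congˡ (shift-cong (*-comm p q)) ⟩
    (scale a q +ₚ shift (q *ₚ p)) ≋⟨ ≋sym (mul-rcons q a p) ⟩
    (q *ₚ (a ∷ p)) ∎≋

  distribˡ : ∀ p q r → (p *ₚ (q +ₚ r)) ≋ ((p *ₚ q) +ₚ (p *ₚ r))
  distribˡ p q r =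
    (p *ₚ (q +ₚ r)) ≋⟨ *-comm p (q +ₚ r) ⟩
    ((q +ₚ r) *ₚ p) ≋⟨ distribʳ q r p ⟩
    ((q *ₚ p) +ₚ (r *ₚ p)) ≋⟨ +-cong (*-comm q p) (*-comm r p) ⟩
    ((p *ₚ q) +ₚ (p *ₚ r)) ∎≋

  *-identityʳ : ∀ q → (q *ₚ (1ℤ ∷ [])) ≋ q
  *-identityʳ q = ≋trans (*-comm q (1ℤ ∷ [])) (*-identityˡ q)

  scale-mulʳ : ∀ a q r → (q *ₚ scale a r) ≋ scale a (q *ₚ r)
  scale-mulʳ a q r = ≋trans (*-comm q (scale a r)) (≋trans (scale-mul a r q) (scale-cong {a} (*-comm r q)))

  shiftN : ℕ → Poly → Poly
  shiftN zero q = q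
  shiftN (suc m) q = shift (shiftN m q)

  mono-mul : ∀ m q → (mono m *ₚ q) ≋ shiftN m q
  mono-mul zero q = *-identityˡ q
  mono-mul (suc m) q = ≋trans (shift-mul (mono m) q) (shift-cong (mono-mul m q))

  sub-self : ∀ p → IsZeroₚ (p -ₚ p)
  sub-self p = mk≋ λ k → trans (coeff-+ p (neg p) k) (trans (cong (coeff p k +_) (coeff-neg p k)) (ℤP.+-inverseʳ (coeff p k)))

module FiniteSums where

  open import Data.Nat as ℕ using (ℕ; zero; suc; _≤_; _<_; z≤n; s≤s; _∸_)
  import Data.Nat.Properties as ℕP
  open import Data.Nat.Divisibility using (_∣?_)
  open import Data.Integer using (ℤ; 0ℤ; 1ℤ; _+_; _*_; -_; _-_) renaming (+_ to pos)
  import Data.Integer.Properties as ℤP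
  open import Algebra.Properties.CommutativeSemigroup ℕP.+-commutativeSemigroup using () renaming (interchange to ℕ+-interchange)
  open import Algebra.Properties.CommutativeSemigroup ℤP.+-commutativeSemigroup using () renaming (interchange to ℤ+-interchange)
  open import Algebra.Properties.AbelianGroup ℤP.+-0-abelianGroup public using () renaming (∙-cancelˡ to +-cancelˡ; ∙-cancelʳ to +-cancelʳ)
  open import Data.Integer.Tactic.RingSolver
  open import Data.Product using (Σ; _×_; _,_)
  open import Data.Empty using (⊥-elim)
  open import Relation.Nullary using (Dec; yes; no; ¬_)
  open import Relation.Binary.PropositionalEquality
  open import Function using (_∘_)

  ι : ∀ {P : Set} → Dec P → ℕ
  ι (yes _) = 1
  ι (no _) = 0

  ι-yes : ∀ {P : Set} (d : Dec P) → P → ι d ≡ 1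
  ι-yes (yes _) _ = refl
  ι-yes (no ¬p) p = ⊥-elim (¬p p)

  ι-no : ∀ {P : Set} (d : Dec P) → ¬ P → ι d ≡ 0
  ι-no (yes p) ¬p = ⊥-elim (¬p p)
  ι-no (no _) _ = refl

  ι-pos : ∀ {P : Set} (d : Dec P) → 0 < ι d → P
  ι-pos (yes p) _ = p
  ι-pos (no _) ()

  divInd : ℕ → ℕ → ℕ
  divInd M t = ι (M ∣? t)

  sumℕ : ℕ → (ℕ → ℕ) → ℕ
  sumℕ zero f = 0
  sumℕ (suc n) f = f 0 ℕ.+ sumℕ n (λ i → f (suc i))

  sumℕ-cong : ∀ n {f g} → (∀ i → i < n → f i ≡ g i) → sumℕ n f ≡ sumℕ n g
  sumℕ-cong zero e = refl
  sumℕ-cong (suc n) e = cong₂ ℕ._+_ (e 0 (s≤s z≤n)) (sumℕ-cong n (λ i i<n → e (suc i) (s≤s i<n)))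

  sumℕ-zero : ∀ n {f} → (∀ i → i < n → f i ≡ 0) → sumℕ n f ≡ 0
  sumℕ-zero zero e = refl
  sumℕ-zero (suc n) e = cong₂ ℕ._+_ (e 0 (s≤s z≤n)) (sumℕ-zero n (λ i i<n → e (suc i) (s≤s i<n)))

  sumℕ-+ : ∀ n f g → sumℕ n (λ i → f i ℕ.+ g i) ≡ sumℕ n f ℕ.+ sumℕ n g
  sumℕ-+ zero f g = refl
  sumℕ-+ (suc n) f g = trans (cong (λ x → f 0 ℕ.+ g 0 ℕ.+ x) (sumℕ-+ n (f ∘ suc) (g ∘ suc))) (ℕ+-interchange (f 0) (g 0) (sumℕ n (f ∘ suc)) (sumℕ n (g ∘ suc)))

  sumℕ-const : ∀ n c → sumℕ n (λ _ → c) ≡ n ℕ.* c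
  sumℕ-const zero c = refl
  sumℕ-const (suc n) c = cong (c ℕ.+_) (sumℕ-const n c)

  sumℕ-split : ∀ m n f → sumℕ (m ℕ.+ n) f ≡ sumℕ m f ℕ.+ sumℕ n (λ i → f (m ℕ.+ i))
  sumℕ-split zero n f = refl
  sumℕ-split (suc m) n f = trans (cong (f 0 ℕ.+_) (sumℕ-split m n (f ∘ suc))) (sym (ℕP.+-assoc (f 0) _ _))

  sumℕ-last : ∀ n f → sumℕ (suc n) f ≡ sumℕ n f ℕ.+ f n
  sumℕ-last n f = (trans (subst (λ k → sumℕ k f ≡ sumℕ n f ℕ.+ sumℕ 1 (λ i → f (n ℕ.+ i))) (ℕP.+-comm n 1) (sumℕ-split n 1 f)) (cong (sumℕ n f ℕ.+_) (trans (ℕP.+-identityʳ _) (cong f (ℕP.+-identityʳ n)))))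

  sumℕ-rot : ∀ n f → sumℕ n (λ i → f (suc i)) ℕ.+ f 0 ≡ sumℕ n f ℕ.+ f n
  sumℕ-rot n f = trans (ℕP.+-comm _ (f 0)) (sumℕ-last n f)

  sumℕ-≥ : ∀ n f j → j < n → f j ≤ sumℕ n f
  sumℕ-≥ (suc n) f zero _ = ℕP.m≤m+n (f 0) _
  sumℕ-≥ (suc n) f (suc j) (s≤s j<n) = ℕP.≤-trans (sumℕ-≥ n (f ∘ suc) j j<n) (ℕP.m≤n+m _ (f 0))

  sumℕ-≥2 : ∀ n f j k → j < n → k < n → j ≢ k → f j ℕ.+ f k ≤ sumℕ n f
  sumℕ-≥2 (suc n) f zero zero _ _ ne = ⊥-elim (ne refl)
  sumℕ-≥2 (suc n) f zero (suc k) _ (s≤s k<n) _ = ℕP.+-monoʳ-≤ (f 0) (sumℕ-≥ n (f ∘ suc) k k<n)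
  sumℕ-≥2 (suc n) f (suc j) zero (s≤s j<n) _ _ = ℕP.≤-trans (ℕP.≤-reflexive (ℕP.+-comm (f (suc j)) (f 0))) (ℕP.+-monoʳ-≤ (f 0) (sumℕ-≥ n (f ∘ suc) j j<n))
  sumℕ-≥2 (suc n) f (suc j) (suc k) (s≤s j<n) (s≤s k<n) ne = ℕP.≤-trans (sumℕ-≥2 n (f ∘ suc) j k j<n k<n (λ e → ne (cong suc e))) (ℕP.m≤n+m _ (f 0))

  sumℕ-mono : ∀ n f g → (∀ i → i < n → f i ≤ g i) → sumℕ n f ≤ sumℕ n g
  sumℕ-mono zero f g h = z≤n
  sumℕ-mono (suc n) f g h = ℕP.+-mono-≤ (h 0 (s≤s z≤n)) (sumℕ-mono n (f ∘ suc) (g ∘ suc) (λ i i<n → h (suc i) (s≤s i<n)))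

  sumℕ-pos : ∀ n f → 0 < sumℕ n f → Σ ℕ λ i → i < n × 0 < f i
  sumℕ-pos zero f ()
  sumℕ-pos (suc n) f ps with f 0 ℕ.≟ 0
  ... | no f0≢0 = 0 , s≤s z≤n , ℕP.n≢0⇒n>0 f0≢0
  ... | yes f0≡0 with sumℕ-pos n (f ∘ suc) (subst (0 <_) (cong (ℕ._+ sumℕ n (f ∘ suc)) f0≡0) ps)
  ... | i , i<n , fi = suc i , s≤s i<n , fi

  sumℤ : ℕ → (ℕ → ℤ) → ℤ
  sumℤ zero f = 0ℤ
  sumℤ (suc n) f = f 0 + sumℤ n (λ i → f (suc i))

  sumℤ-cong : ∀ n {f g} → (∀ i → i < n → f i ≡ g i) → sumℤ n f ≡ sumℤ n g
  sumℤ-cong zero e = refl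
  sumℤ-cong (suc n) e = cong₂ _+_ (e 0 (s≤s z≤n)) (sumℤ-cong n (λ i i<n → e (suc i) (s≤s i<n)))

  sumℤ-zero : ∀ n {f} → (∀ i → i < n → f i ≡ 0ℤ) → sumℤ n f ≡ 0ℤ
  sumℤ-zero zero e = refl
  sumℤ-zero (suc n) e = trans (cong₂ _+_ (e 0 (s≤s z≤n)) (sumℤ-zero n (λ i i<n → e (suc i) (s≤s i<n)))) refl

  sumℤ-+ : ∀ n f g → sumℤ n (λ i → f i + g i) ≡ sumℤ n f + sumℤ n g
  sumℤ-+ zero f g = refl
  sumℤ-+ (suc n) f g = trans (cong (λ x → f 0 + g 0 + x) (sumℤ-+ n (f ∘ suc) (g ∘ suc))) (ℤ+-interchange (f 0) (g 0) (sumℤ n (f ∘ suc)) (sumℤ n (g ∘ suc)))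

  sumℤ-neg : ∀ n f → sumℤ n (λ i → - f i) ≡ - sumℤ n f
  sumℤ-neg zero f = refl
  sumℤ-neg (suc n) f = trans (cong (- f 0 +_) (sumℤ-neg n (f ∘ suc))) (sym (ℤP.neg-distrib-+ (f 0) _))

  sumℤ-- : ∀ n f g → sumℤ n (λ i → f i - g i) ≡ sumℤ n f - sumℤ n g
  sumℤ-- n f g = trans (sumℤ-+ n f (λ i → - g i)) (cong (sumℤ n f +_) (sumℤ-neg n g))

  sumℤ-*ˡ : ∀ n c f → sumℤ n (λ i → c * f i) ≡ c * sumℤ n f
  sumℤ-*ˡ zero c f = sym (ℤP.*-zeroʳ c)
  sumℤ-*ˡ (suc n) c f = trans (cong (c * f 0 +_) (sumℤ-*ˡ n c (f ∘ suc))) (sym (ℤP.*-distribˡ-+ c (f 0) (sumℤ n (f ∘ suc))))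

  sumℤ-split : ∀ m n f → sumℤ (m ℕ.+ n) f ≡ sumℤ m f + sumℤ n (λ i → f (m ℕ.+ i))
  sumℤ-split zero n f = sym (ℤP.+-identityˡ _)
  sumℤ-split (suc m) n f = trans (cong (f 0 +_) (sumℤ-split m n (f ∘ suc))) (sym (ℤP.+-assoc (f 0) _ _))

  sumℤ-last : ∀ n f → sumℤ (suc n) f ≡ sumℤ n f + f n
  sumℤ-last n f = trans (subst (λ k → sumℤ k f ≡ sumℤ n f + sumℤ 1 (λ i → f (n ℕ.+ i))) (ℕP.+-comm n 1) (sumℤ-split n 1 f)) (cong (sumℤ n f +_) (trans (ℤP.+-identityʳ _) (cong f (ℕP.+-identityʳ n))))

  sumℤ-rot : ∀ n f → sumℤ n (λ i → f (suc i)) + f 0 ≡ sumℤ n f + f n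
  sumℤ-rot n f = trans (ℤP.+-comm _ (f 0)) (sumℤ-last n f)

  sumℤ-rev : ∀ n (f : ℕ → ℤ) → sumℤ n (λ r → f (n ∸ r)) ≡ sumℤ n (λ r → f (suc r))
  sumℤ-rev zero f = refl
  sumℤ-rev (suc n) f = trans (cong (f (suc n) +_) (sumℤ-rev n f)) (trans (ℤP.+-comm (f (suc n)) (sumℤ n (λ r → f (suc r)))) (sym (sumℤ-last n (λ r → f (suc r)))))

  -‿exchange : ∀ a b c d → a - b ≡ c - d → a - c ≡ b - d
  -‿exchange a b c d e = trans (alg a b c) (trans (cong (_+ (b - c)) e) (alg2 c d b))
    where
    alg : ∀ a b c → a - c ≡ (a - b) + (b - c)
    alg = solve-∀
    alg2 : ∀ c d b → (c - d) + (b - c) ≡ b - d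
    alg2 = solve-∀

  sumℤ-shift1 : ∀ n f → f n ≡ f 0 → sumℤ n (λ i → f (suc i)) ≡ sumℤ n f
  sumℤ-shift1 n f per = +-cancelʳ (f 0) _ _ (trans (sumℤ-rot n f) (cong (sumℤ n f +_) per))

  sumℤ-shift : ∀ n f → (∀ t → f (t ℕ.+ n) ≡ f t) → ∀ c → sumℤ n (λ i → f (c ℕ.+ i)) ≡ sumℤ n f
  sumℤ-shift n f per zero = refl
  sumℤ-shift n f per (suc c) = trans (sumℤ-cong n (λ i _ → cong f (sym (ℕP.+-suc c i)))) (trans (sumℤ-shift1 n (λ i → f (c ℕ.+ i)) (trans (per c) (cong f (sym (ℕP.+-identityʳ c))))) (sumℤ-shift n f per c))

  sumℤ-single : ∀ n f j → j < n → (∀ i → i < n → i ≢ j → f i ≡ 0ℤ) → sumℤ n f ≡ f j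
  sumℤ-single (suc n) f zero _ z = trans (cong (f 0 +_) (sumℤ-zero n (λ i i<n → z (suc i) (s≤s i<n) (λ ())))) (ℤP.+-identityʳ _)
  sumℤ-single (suc n) f (suc j) (s≤s j<n) z = trans (cong (_+ sumℤ n (f ∘ suc)) (z 0 (s≤s z≤n) (λ ()))) (trans (ℤP.+-identityˡ _) (sumℤ-single n (f ∘ suc) j j<n (λ i i<n ne → z (suc i) (s≤s i<n) (λ e → ne (ℕP.suc-injective e)))))

  sumℤ-const : ∀ n c → sumℤ n (λ _ → c) ≡ pos n * c
  sumℤ-const zero c = sym (ℤP.*-zeroˡ c)
  sumℤ-const (suc n) c = trans (cong (c +_) (sumℤ-const n c)) (trans (cong (λ x → x + pos n * c) (sym (ℤP.*-identityˡ c))) (sym (ℤP.*-distribʳ-+ c 1ℤ (pos n))))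

  sumℤ-+ℕ : ∀ n f → sumℤ n (λ i → pos (f i)) ≡ pos (sumℕ n f)
  sumℤ-+ℕ zero f = refl
  sumℤ-+ℕ (suc n) f = trans (cong (pos (f 0) +_) (sumℤ-+ℕ n (f ∘ suc))) (sym (ℤP.pos-+ (f 0) _))

module ClassSums where

  open import Defs
  open Polynomials
  open FiniteSums
  open import Data.Nat as ℕ using (ℕ; zero; suc; _≤_; _<_; s≤s; NonZero)
  import Data.Nat.Properties as ℕP
  open import Data.Nat.Divisibility using (_∣_; divides; _∣?_; ∣m+n∣m⇒∣n; ∣m∣n⇒∣m+n; ∣⇒≤; *-cancelʳ-∣; *-monoˡ-∣; n∣m*n; m*n∣⇒n∣; ∣-refl)
  open import Data.Integer using (ℤ; 0ℤ; _+_; _*_; -_; _-_) renaming (+_ to pos)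
  import Data.Integer.Properties as ℤP
  open import Data.Integer.Tactic.RingSolver
  open import Data.List using (List; []; _∷_; map)
  open import Data.List.Relation.Unary.Any using (here; there)
  open import Data.List.Membership.Propositional using (_∈_)
  open import Data.Product using (Σ; _×_; _,_)
  open import Data.Empty using (⊥-elim)
  open import Relation.Nullary using (Dec; yes; no)
  open import Relation.Binary.PropositionalEquality
  open import Function using (_∘_)

  ι-iff : ∀ {P Q : Set} (d1 : Dec P) (d2 : Dec Q) → (P → Q) → (Q → P) → ι d1 ≡ ι d2
  ι-iff (yes p) (yes q) f g = refl
  ι-iff (yes p) (no ¬q) f g = ⊥-elim (¬q (f p))
  ι-iff (no ¬p) (yes q) f g = ⊥-elim (¬p (g q))
  ι-iff (no ¬p) (no ¬q) f g = refl

  ∣n+m∣m⇒∣n : ∀ M t → M ∣ t ℕ.+ M → M ∣ t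
  ∣n+m∣m⇒∣n M t d = ∣m+n∣m⇒∣n (subst (M ∣_) (ℕP.+-comm t M) d) ∣-refl

  divInd-periodic : ∀ M t → divInd M (t ℕ.+ M) ≡ divInd M t
  divInd-periodic M t = ι-iff (M ∣? (t ℕ.+ M)) (M ∣? t) (∣n+m∣m⇒∣n M t) (λ d → ∣m∣n⇒∣m+n d ∣-refl)

  divInd-window-sum : ∀ q .{{_ : NonZero q}} w → sumℕ q (λ j → divInd q (w ℕ.+ j)) ≡ 1
  divInd-window-sum (suc q) zero = cong₂ ℕ._+_ (ι-yes (suc q ∣? 0) (divides 0 refl)) (sumℕ-zero q (λ i i<q → ι-no (suc q ∣? suc i) (λ d → ℕP.<⇒≱ (s≤s i<q) (∣⇒≤ d))))
  divInd-window-sum q@(suc _) (suc w) = begin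
    sumℕ q (λ j → divInd q (suc w ℕ.+ j)) ≡⟨ sumℕ-cong q (λ j _ → cong (divInd q) (sym (ℕP.+-suc w j))) ⟩
    sumℕ q (λ j → f (suc j)) ≡⟨ ℕP.+-cancelʳ-≡ _ _ _ (trans (sumℕ-rot q f) (cong (sumℕ q f ℕ.+_) f-periodic)) ⟩
    sumℕ q f ≡⟨ divInd-window-sum q w ⟩
    1 ∎
    where
    open ≡-Reasoning
    f : ℕ → ℕ
    f j = divInd q (w ℕ.+ j)
    f-periodic : f q ≡ f 0
    f-periodic = trans (divInd-periodic q w) (cong (divInd q) (sym (ℕP.+-identityʳ w)))

  divInd-refine : ∀ D q .{{_ : NonZero D}} .{{_ : NonZero q}} y → divInd D y ≡ sumℕ q (λ j → divInd (q ℕ.* D) (y ℕ.+ j ℕ.* D))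
  divInd-refine D q y with D ∣? y
  ... | yes (divides w refl) = sym (trans (sumℕ-cong q (λ j _ → trans (cong (divInd (q ℕ.* D)) (sym (ℕP.*-distribʳ-+ D w j))) (ι-iff ((q ℕ.* D) ∣? ((w ℕ.+ j) ℕ.* D)) (q ∣? (w ℕ.+ j)) (*-cancelʳ-∣ D) (*-monoˡ-∣ D)))) (divInd-window-sum q w))
  ... | no ¬d = sym (sumℕ-zero q (λ j _ → ι-no ((q ℕ.* D) ∣? (y ℕ.+ j ℕ.* D)) (λ d → ¬d (∣m+n∣m⇒∣n (subst (D ∣_) (ℕP.+-comm y (j ℕ.* D)) (m*n∣⇒n∣ q D d)) (n∣m*n j)))))

  -- Λ F u s = Σ_i u_i F (s + i); with F = [M ∣ _] it sums the coefficients u_i with i ≡ -s (mod M).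
  Λ : (ℕ → ℤ) → Poly → ℕ → ℤ
  Λ F [] s = 0ℤ
  Λ F (c ∷ u) s = c * F s + Λ F u (suc s)

  Λ-Fcong : ∀ {F G} → (∀ t → F t ≡ G t) → ∀ u s → Λ F u s ≡ Λ G u s
  Λ-Fcong e [] s = refl
  Λ-Fcong e (c ∷ u) s = cong₂ _+_ (cong (c *_) (e s)) (Λ-Fcong e u (suc s))

  Λ-+ : ∀ F u v s → Λ F (u +ₚ v) s ≡ Λ F u s + Λ F v s
  Λ-+ F [] v s = sym (ℤP.+-identityˡ _)
  Λ-+ F (a ∷ u) [] s = sym (ℤP.+-identityʳ _)
  Λ-+ F (a ∷ u) (b ∷ v) s = trans (cong ((a + b) * F s +_) (Λ-+ F u v (suc s))) (alg a b (F s) (Λ F u (suc s)) (Λ F v (suc s)))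
    where
    alg : ∀ a b x y z → (a + b) * x + (y + z) ≡ (a * x + y) + (b * x + z)
    alg = solve-∀

  Λ-sc : ∀ F a u s → Λ F (scale a u) s ≡ a * Λ F u s
  Λ-sc F a [] s = sym (ℤP.*-zeroʳ a)
  Λ-sc F a (c ∷ u) s = trans (cong (a * c * F s +_) (Λ-sc F a u (suc s))) (alg a c (F s) (Λ F u (suc s)))
    where
    alg : ∀ a c x y → a * c * x + a * y ≡ a * (c * x + y)
    alg = solve-∀

  Λ-≋ : ∀ F {u v} → u ≋ v → ∀ s → Λ F u s ≡ Λ F v s
  Λ-≋ F {[]} {[]} e s = refl
  Λ-≋ F {[]} {b ∷ v} e s = trans (Λ-≋ F {[]} {v} (mk≋ λ k → get e (suc k)) (suc s)) (sym (trans (cong (λ x → x * F s + Λ F v (suc s)) (sym (get e zero))) (ℤP.+-identityˡ _)))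
  Λ-≋ F {a ∷ u} {[]} e s = trans (cong (λ x → x * F s + Λ F u (suc s)) (get e zero)) (trans (ℤP.+-identityˡ _) (Λ-≋ F {u} {[]} (mk≋ λ k → get e (suc k)) (suc s)))
  Λ-≋ F {a ∷ u} {b ∷ v} e s = cong₂ _+_ (cong (_* F s) (get e zero)) (Λ-≋ F {u} {v} (mk≋ λ k → get e (suc k)) (suc s))

  Λ-shift : ∀ F u s → Λ F (shift u) s ≡ Λ F u (suc s)
  Λ-shift F u s = trans (cong (_+ Λ F u (suc s)) (ℤP.*-zeroˡ (F s))) (ℤP.+-identityˡ _)

  Λ-mono : ∀ F m s → Λ F (mono m) s ≡ F (m ℕ.+ s)
  Λ-mono F zero s = trans (ℤP.+-identityʳ _) (ℤP.*-identityˡ _)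
  Λ-mono F (suc m) s = trans (Λ-shift F (mono m) s) (trans (Λ-mono F m (suc s)) (cong F (ℕP.+-suc m s)))

  Λ-mul : ∀ F u g s → Λ F (u *ₚ g) s ≡ Λ (λ t → Λ F g t) u s
  Λ-mul F [] g s = refl
  Λ-mul F (c ∷ u) g s = trans (Λ-+ F (scale c g) (shift (u *ₚ g)) s) (cong₂ _+_ (Λ-sc F c g s) (trans (Λ-shift F (u *ₚ g) s) (Λ-mul F u g (suc s))))

  Λ-F+ : ∀ F G u s → Λ (λ t → F t + G t) u s ≡ Λ F u s + Λ G u s
  Λ-F+ F G [] s = refl
  Λ-F+ F G (c ∷ u) s = trans (cong (c * (F s + G s) +_) (Λ-F+ F G u (suc s))) (alg c (F s) (G s) (Λ F u (suc s)) (Λ G u (suc s)))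
    where
    alg : ∀ c a b x y → c * (a + b) + (x + y) ≡ (c * a + x) + (c * b + y)
    alg = solve-∀

  Λ-Fsc : ∀ a F u s → Λ (λ t → a * F t) u s ≡ a * Λ F u s
  Λ-Fsc a F [] s = sym (ℤP.*-zeroʳ a)
  Λ-Fsc a F (c ∷ u) s = trans (cong (c * (a * F s) +_) (Λ-Fsc a F u (suc s))) (alg a c (F s) (Λ F u (suc s)))
    where
    alg : ∀ a c x y → c * (a * x) + a * y ≡ a * (c * x + y)
    alg = solve-∀

  Λ-Fneg : ∀ F u s → Λ (λ t → - F t) u s ≡ - Λ F u s
  Λ-Fneg F [] s = refl
  Λ-Fneg F (c ∷ u) s = trans (cong (c * - F s +_) (Λ-Fneg F u (suc s))) (alg c (F s) (Λ F u (suc s)))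
    where
    alg : ∀ c x y → c * - x + - y ≡ - (c * x + y)
    alg = solve-∀

  Λ-Fsum : ∀ q (H : ℕ → ℕ → ℤ) u s → Λ (λ t → sumℤ q (λ j → H j t)) u s ≡ sumℤ q (λ j → Λ (H j) u s)
  Λ-Fsum zero H [] s = refl
  Λ-Fsum zero H (c ∷ u) s = trans (cong₂ _+_ (ℤP.*-zeroʳ c) (Λ-Fsum zero H u (suc s))) refl
  Λ-Fsum (suc q) H u s = trans (Λ-F+ (H 0) (λ t → sumℤ q (λ j → H (suc j) t)) u s) (cong (Λ (H 0) u s +_) (Λ-Fsum q (λ j → H (suc j)) u s))

  Λ-off : ∀ F u c s → Λ F u (c ℕ.+ s) ≡ Λ (λ t → F (c ℕ.+ t)) u s
  Λ-off F [] c s = refl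
  Λ-off F (a ∷ u) c s = cong (a * F (c ℕ.+ s) +_) (trans (cong (Λ F u) (sym (ℕP.+-suc c s))) (Λ-off F u c (suc s)))

  maskL : List ℕ → Poly
  maskL l = sumₚ (map mono l)

  lsum : List ℕ → (ℕ → ℤ) → ℤ
  lsum [] h = 0ℤ
  lsum (x ∷ l) h = h x + lsum l h

  lsumℕ : List ℕ → (ℕ → ℕ) → ℕ
  lsumℕ [] h = 0
  lsumℕ (x ∷ l) h = h x ℕ.+ lsumℕ l h

  lsum-pos : ∀ l h → lsum l (λ x → pos (h x)) ≡ pos (lsumℕ l h)
  lsum-pos [] h = refl
  lsum-pos (x ∷ l) h = trans (cong (pos (h x) +_) (lsum-pos l h)) (sym (ℤP.pos-+ (h x) _))

  Λ-mask : ∀ F l s → Λ F (maskL l) s ≡ lsum l (λ x → F (x ℕ.+ s))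
  Λ-mask F [] s = refl
  Λ-mask F (x ∷ l) s = trans (Λ-+ F (mono x) (maskL l) s) (cong₂ _+_ (Λ-mono F x s) (Λ-mask F l s))

  fromCoeffs : ℕ → (ℕ → ℤ) → Poly
  fromCoeffs zero c = []
  fromCoeffs (suc n) c = c 0 ∷ fromCoeffs n (c ∘ suc)

  Λ-fromCoeffs : ∀ F n c s → Λ F (fromCoeffs n c) s ≡ sumℤ n (λ r → c r * F (r ℕ.+ s))
  Λ-fromCoeffs F zero c s = refl
  Λ-fromCoeffs F (suc n) c s = cong (c 0 * F s +_) (trans (Λ-fromCoeffs F n (c ∘ suc) (suc s)) (sumℤ-cong n (λ r _ → cong (λ x → c (suc r) * F x) (ℕP.+-suc r s))))

  divIndℤ : ℕ → ℕ → ℤ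
  divIndℤ M t = pos (divInd M t)

  classSum : ℕ → ℕ → Poly → ℤ
  classSum M s u = Λ (divIndℤ M) u s

  classCount : ℕ → ℕ → List ℕ → ℕ
  classCount M s l = lsumℕ l (λ x → divInd M (x ℕ.+ s))

  classSum-mask : ∀ M s l → classSum M s (maskL l) ≡ pos (classCount M s l)
  classSum-mask M s l = trans (Λ-mask (divIndℤ M) l s) (lsum-pos l (λ x → divInd M (x ℕ.+ s)))

  classSum-periodic : ∀ M s u → classSum M (M ℕ.+ s) u ≡ classSum M s u
  classSum-periodic M s u = trans (Λ-off (divIndℤ M) u M s) (Λ-Fcong (λ t → cong pos (trans (cong (divInd M) (ℕP.+-comm M t)) (divInd-periodic M t))) u s)

  classSum-refine : ∀ D q .{{_ : NonZero D}} .{{_ : NonZero q}} s u → classSum D s u ≡ sumℤ q (λ j → classSum (q ℕ.* D) (j ℕ.* D ℕ.+ s) u)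
  classSum-refine D q s u = begin
    Λ (divIndℤ D) u s
      ≡⟨ Λ-Fcong (λ t → trans (cong pos (divInd-refine D q t)) (sym (sumℤ-+ℕ q (λ j → divInd (q ℕ.* D) (t ℕ.+ j ℕ.* D))))) u s ⟩
    Λ (λ t → sumℤ q (λ j → divIndℤ (q ℕ.* D) (t ℕ.+ j ℕ.* D))) u s
      ≡⟨ Λ-Fsum q (λ j t → divIndℤ (q ℕ.* D) (t ℕ.+ j ℕ.* D)) u s ⟩
    sumℤ q (λ j → Λ (λ t → divIndℤ (q ℕ.* D) (t ℕ.+ j ℕ.* D)) u s)
      ≡⟨ sumℤ-cong q (λ j _ → sym (trans (Λ-off (divIndℤ (q ℕ.* D)) u (j ℕ.* D) s) (Λ-Fcong (λ t → cong (divIndℤ (q ℕ.* D)) (ℕP.+-comm (j ℕ.* D) t)) u s))) ⟩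
    sumℤ q (λ j → classSum (q ℕ.* D) (j ℕ.* D ℕ.+ s) u) ∎
    where open ≡-Reasoning

  classCount-refine : ∀ D q .{{_ : NonZero D}} .{{_ : NonZero q}} s l → classCount D s l ≡ sumℕ q (λ j → classCount (q ℕ.* D) (j ℕ.* D ℕ.+ s) l)
  classCount-refine D q s l = ℤP.+-injective (trans (sym (classSum-mask D s l)) (trans (classSum-refine D q s (maskL l)) (trans (sumℤ-cong q (λ j _ → classSum-mask (q ℕ.* D) (j ℕ.* D ℕ.+ s) l)) (sumℤ-+ℕ q _))))

  divInd≤classCount : ∀ {M s x} A → x ∈ A → divInd M (x ℕ.+ s) ≤ classCount M s A
  divInd≤classCount {M} {s} (y ∷ A) (here refl) = ℕP.m≤m+n _ _
  divInd≤classCount {M} {s} (y ∷ A) (there m) = ℕP.≤-trans (divInd≤classCount A m) (ℕP.m≤n+m _ _)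

  classCount>0⇒∈ : ∀ M s l → 0 < classCount M s l → Σ ℕ λ x → x ∈ l × M ∣ x ℕ.+ s
  classCount>0⇒∈ M s [] ()
  classCount>0⇒∈ M s (y ∷ l) ps with M ∣? (y ℕ.+ s)
  ... | yes d = y , here refl , d
  ... | no _ with classCount>0⇒∈ M s l ps
  ...   | x , m , d = x , there m , d

module Sequences where

  open FiniteSums
  open import Data.Nat as ℕ using (ℕ; zero; suc; _<_; z≤n; s≤s)
  import Data.Nat.Properties as ℕP
  open import Data.Integer using (ℤ; 0ℤ; 1ℤ; _+_; _*_; -_; _-_)
  import Data.Integer.Properties as ℤP
  open import Data.Integer.Tactic.RingSolver
  open import Data.Product using (_,_)
  open import Relation.Binary.PropositionalEquality
  open import Function using (_∘_)

  Seq : Set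
  Seq = ℕ → ℤ

  infix 4 _≐_
  record _≐_ (X Y : Seq) : Set where
    constructor pw
    field at : ∀ s → X s ≡ Y s
  open _≐_ public

  ≐refl : ∀ {X} → X ≐ X
  ≐refl = pw λ s → refl

  ≐trans : ∀ {X Y Z} → X ≐ Y → Y ≐ Z → X ≐ Z
  ≐trans e f = pw λ s → trans (at e s) (at f s)

  -- Divisibility in ℤ with an explicit integer quotient (Data.Integer.Divisibility goes through absolute values).
  infix 4 _∣z_
  record _∣z_ (m x : ℤ) : Set where
    constructor _,_
    field
      wit : ℤ
      eqn : x ≡ m * wit
  open _∣z_ public

  ∣z-0 : ∀ m → m ∣z 0ℤ
  ∣z-0 m = 0ℤ , sym (ℤP.*-zeroʳ m)

  ∣z-refl : ∀ m → m ∣z m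
  ∣z-refl m = 1ℤ , sym (ℤP.*-identityʳ m)

  ∣z-+ : ∀ {m x y} → m ∣z x → m ∣z y → m ∣z (x + y)
  ∣z-+ {m} (a , refl) (b , refl) = a + b , sym (ℤP.*-distribˡ-+ m a b)

  ∣z-neg : ∀ {m x} → m ∣z x → m ∣z (- x)
  ∣z-neg {m} (a , refl) = - a , ℤP.neg-distribʳ-* m a

  ∣z-- : ∀ {m x y} → m ∣z x → m ∣z y → m ∣z (x - y)
  ∣z-- d e = ∣z-+ d (∣z-neg e)

  ∣z-*ˡ : ∀ {m} c {x} → m ∣z x → m ∣z (c * x)
  ∣z-*ˡ {m} c (a , refl) = c * a , alg c m a
    where
    alg : ∀ c m a → c * (m * a) ≡ m * (c * a)
    alg = solve-∀

  ∣z-*ʳ : ∀ {m} c {x} → m ∣z x → m ∣z (x * c)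
  ∣z-*ʳ {m} c {x} d = subst (m ∣z_) (ℤP.*-comm c x) (∣z-*ˡ c d)

  ∣z-mul : ∀ {m n x y} → m ∣z x → n ∣z y → (m * n) ∣z (x * y)
  ∣z-mul {m} {n} (a , refl) (b , refl) = a * b , alg m a n b
    where
    alg : ∀ m a n b → m * a * (n * b) ≡ m * n * (a * b)
    alg = solve-∀

  ∣z-eq : ∀ {m x y} → x ≡ y → m ∣z x → m ∣z y
  ∣z-eq refl d = d

  ∣z-meq : ∀ {m m' x} → m ≡ m' → m ∣z x → m' ∣z x
  ∣z-meq refl d = d

  ∣z-sum : ∀ {m} n f → (∀ i → i < n → m ∣z f i) → m ∣z sumℤ n f
  ∣z-sum {m} zero f d = ∣z-0 m
  ∣z-sum (suc n) f d = ∣z-+ (d 0 (s≤s z≤n)) (∣z-sum n (f ∘ suc) (λ i i<n → d (suc i) (s≤s i<n)))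

  Δ : ℕ → Seq → Seq
  Δ m X s = X (m ℕ.+ s) - X s

  ∇ : Seq → Seq
  ∇ X s = X (suc s) - X s

  iterate : ℕ → (Seq → Seq) → Seq → Seq
  iterate zero S X = X
  iterate (suc n) S X = S (iterate n S X)

  Respects≐ : (Seq → Seq) → Set
  Respects≐ S = ∀ {X Y} → X ≐ Y → S X ≐ S Y

  ∇-resp : Respects≐ ∇
  ∇-resp e = pw λ s → cong₂ _-_ (at e (suc s)) (at e s)

  iterate-resp : ∀ n S → Respects≐ S → Respects≐ (iterate n S)
  iterate-resp zero S r e = e
  iterate-resp (suc n) S r e = r (iterate-resp n S r e)

  iterate-+ : ∀ a b S X → iterate (a ℕ.+ b) S X ≡ iterate a S (iterate b S X)
  iterate-+ zero b S X = refl
  iterate-+ (suc a) b S X = cong S (iterate-+ a b S X)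

  iterate-* : ∀ a b S → Respects≐ S → ∀ X → iterate (a ℕ.* b) S X ≐ iterate a (iterate b S) X
  iterate-* zero b S r X = ≐refl
  iterate-* (suc a) b S r X = pw λ s → trans (cong (λ Z → Z s) (iterate-+ b (a ℕ.* b) S X)) (at (iterate-resp b S r (iterate-* a b S r X)) s)

  record CongMod (m : ℤ) (X Y : Seq) : Set where
    constructor cm
    field getMod : ∀ s → m ∣z (X s - Y s)
  open CongMod public

  PreservesMod : ℤ → (Seq → Seq) → Set
  PreservesMod m S = ∀ {X Y} → CongMod m X Y → CongMod m (S X) (S Y)

  ∇-preservesMod : ∀ m → PreservesMod m ∇
  ∇-preservesMod m {X} {Y} c = cm λ s → ∣z-eq (alg (X (suc s)) (Y (suc s)) (X s) (Y s)) (∣z-- (getMod c (suc s)) (getMod c s))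
    where
    alg : ∀ a b c d → (a - b) - (c - d) ≡ (a - c) - (b - d)
    alg = solve-∀

  iterate-preservesMod : ∀ m n S → PreservesMod m S → PreservesMod m (iterate n S)
  iterate-preservesMod m zero S pr c = c
  iterate-preservesMod m (suc n) S pr c = pr (iterate-preservesMod m n S pr c)

  CongMod-trans : ∀ {m X Y Z} → CongMod m X Y → CongMod m Y Z → CongMod m X Z
  CongMod-trans {m} {X} {Y} {Z} c d = cm λ s → ∣z-eq (alg (X s) (Y s) (Z s)) (∣z-+ (getMod c s) (getMod d s))
    where
    alg : ∀ a b c → (a - b) + (b - c) ≡ a - c
    alg = solve-∀

  ≐⇒CongMod : ∀ {m X Y} → X ≐ Y → CongMod m X Y
  ≐⇒CongMod {m} {X} {Y} e = cm λ s → ∣z-eq (sym (trans (cong (_- Y s) (at e s)) (ℤP.+-inverseʳ (Y s)))) (∣z-0 m)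

  iterate-CongMod : ∀ m n S S' → PreservesMod m S → (∀ X → CongMod m (S X) (S' X)) → ∀ X → CongMod m (iterate n S X) (iterate n S' X)
  iterate-CongMod m zero S S' pr h X = ≐⇒CongMod ≐refl
  iterate-CongMod m (suc n) S S' pr h X = CongMod-trans (pr (iterate-CongMod m n S S' pr h X)) (h (iterate n S' X))

  ∇ⁿ : ℕ → Seq → Seq
  ∇ⁿ n = iterate n ∇

  ∇ⁿ-+ : ∀ n X Y → ∇ⁿ n (λ s → X s + Y s) ≐ (λ s → ∇ⁿ n X s + ∇ⁿ n Y s)
  ∇ⁿ-+ zero X Y = ≐refl
  ∇ⁿ-+ (suc n) X Y = pw λ s → trans (at (∇-resp (∇ⁿ-+ n X Y)) s) (alg (∇ⁿ n X (suc s)) (∇ⁿ n Y (suc s)) (∇ⁿ n X s) (∇ⁿ n Y s))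
    where
    alg : ∀ a b c d → (a + b) - (c + d) ≡ (a - c) + (b - d)
    alg = solve-∀

  ∇ⁿ-sc : ∀ n c X → ∇ⁿ n (λ s → c * X s) ≐ (λ s → c * ∇ⁿ n X s)
  ∇ⁿ-sc zero c X = ≐refl
  ∇ⁿ-sc (suc n) c X = pw λ s → trans (at (∇-resp (∇ⁿ-sc n c X)) s) (alg c (∇ⁿ n X (suc s)) (∇ⁿ n X s))
    where
    alg : ∀ c a b → c * a - c * b ≡ c * (a - b)
    alg = solve-∀

  Per : ℕ → Seq → Set
  Per P X = ∀ s → X (P ℕ.+ s) ≡ X s

  Per-multiple : ∀ {P X} → Per P X → ∀ k s → X (k ℕ.* P ℕ.+ s) ≡ X s
  Per-multiple per zero s = refl
  Per-multiple {P} {X} per (suc k) s = trans (cong X (ℕP.+-assoc P (k ℕ.* P) s)) (trans (per _) (Per-multiple per k s))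

  ∇-Per : ∀ {P X} → Per P X → Per P (∇ X)
  ∇-Per {P} {X} per s = cong₂ _-_ (trans (cong X (sym (ℕP.+-suc P s))) (per (suc s))) (per s)

  ∇ⁿ-Per : ∀ n {P X} → Per P X → Per P (∇ⁿ n X)
  ∇ⁿ-Per zero per = per
  ∇ⁿ-Per (suc n) per = ∇-Per (∇ⁿ-Per n per)

module FrobeniusDifferences where

  open FiniteSums
  open Sequences
  open import Data.Nat as ℕ using (ℕ; zero; suc; _<_; z≤n; s≤s; NonZero; _^_)
  import Data.Nat.Properties as ℕP
  import Data.Nat.Tactic.RingSolver as NS
  open import Data.Nat.Divisibility using (_∣_; divides; _∣?_; ∣⇒≤)
  open import Data.Nat.Primality using (Prime; euclidsLemma; prime⇒irreducible)
  open import Data.Integer using (ℤ; 0ℤ; 1ℤ; _+_; _*_; -_; _-_) renaming (+_ to pos)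
  import Data.Integer.Properties as ℤP
  open import Data.Integer.Tactic.RingSolver
  open import Data.Product using (_,_)
  open import Data.Sum using (inj₁; inj₂)
  open import Data.Empty using (⊥-elim)
  open import Relation.Nullary using (yes; no; ¬_)
  open import Relation.Binary.PropositionalEquality

  binomial : ℕ → ℕ → ℕ
  binomial n zero = 1
  binomial zero (suc k) = 0
  binomial (suc n) (suc k) = binomial n k ℕ.+ binomial n (suc k)

  binomial-1 : ∀ n → binomial n 1 ≡ n
  binomial-1 zero = refl
  binomial-1 (suc n) = cong suc (binomial-1 n)

  binomial-absorb : ∀ n k → suc k ℕ.* binomial (suc n) (suc k) ≡ suc n ℕ.* binomial n k
  binomial-absorb zero zero = refl
  binomial-absorb zero (suc k) = ℕP.*-zeroʳ (suc (suc k))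
  binomial-absorb (suc n) zero = trans (ℕP.+-identityʳ _) (trans (binomial-1 (suc (suc n))) (sym (ℕP.*-identityʳ (suc (suc n)))))
  binomial-absorb (suc n) (suc k) = begin
    suc (suc k) ℕ.* (A ℕ.+ B) ≡⟨ alg k A B ⟩
    A ℕ.+ (suc k ℕ.* A ℕ.+ suc (suc k) ℕ.* B) ≡⟨ cong (λ x → A ℕ.+ (x ℕ.+ suc (suc k) ℕ.* B)) (binomial-absorb n k) ⟩
    A ℕ.+ (suc n ℕ.* binomial n k ℕ.+ suc (suc k) ℕ.* B) ≡⟨ cong (λ x → A ℕ.+ (suc n ℕ.* binomial n k ℕ.+ x)) (binomial-absorb n (suc k)) ⟩
    A ℕ.+ (suc n ℕ.* binomial n k ℕ.+ suc n ℕ.* binomial n (suc k)) ≡⟨ cong (A ℕ.+_) (sym (ℕP.*-distribˡ-+ (suc n) (binomial n k) (binomial n (suc k)))) ⟩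
    A ℕ.+ suc n ℕ.* A ∎
    where
    open ≡-Reasoning
    A = binomial (suc n) (suc k)
    B = binomial (suc n) (suc (suc k))
    alg : ∀ k A B → suc (suc k) ℕ.* (A ℕ.+ B) ≡ A ℕ.+ (suc k ℕ.* A ℕ.+ suc (suc k) ℕ.* B)
    alg = NS.solve-∀

  prime∣binomial : ∀ p → Prime p → ∀ i → 0 < i → i < p → p ∣ binomial p i
  prime∣binomial (suc p') pp (suc i') _ i<p with euclidsLemma (suc i') (binomial (suc p') (suc i')) pp (divides (binomial p' i') (trans (binomial-absorb p' i') (ℕP.*-comm (suc p') (binomial p' i'))))
  ... | inj₁ d = ⊥-elim (ℕP.<⇒≱ i<p (∣⇒≤ d))
  ... | inj₂ d = d

  diffCoeff : ℕ → ℕ → ℤ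
  diffCoeff zero zero = 1ℤ
  diffCoeff zero (suc i) = 0ℤ
  diffCoeff (suc n) zero = - diffCoeff n zero
  diffCoeff (suc n) (suc i) = diffCoeff n i - diffCoeff n (suc i)

  diffCoeff-beyond : ∀ n i → n < i → diffCoeff n i ≡ 0ℤ
  diffCoeff-beyond zero (suc i) _ = refl
  diffCoeff-beyond (suc n) (suc i) (s≤s n<i) = trans (cong₂ _-_ (diffCoeff-beyond n i n<i) (diffCoeff-beyond n (suc i) (ℕP.m<n⇒m<1+n n<i))) refl

  diffCoeff-diag : ∀ n → diffCoeff n n ≡ 1ℤ
  diffCoeff-diag zero = refl
  diffCoeff-diag (suc n) = trans (cong₂ _-_ (diffCoeff-diag n) (diffCoeff-beyond n (suc n) (ℕP.n<1+n n))) refl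

  sign : ℕ → ℤ
  sign zero = 1ℤ
  sign (suc k) = - sign k

  diffCoeff-0 : ∀ n → diffCoeff n 0 ≡ sign n
  diffCoeff-0 zero = refl
  diffCoeff-0 (suc n) = cong -_ (diffCoeff-0 n)

  diffCoeff≡sign*binomial : ∀ n i → diffCoeff n i ≡ sign (n ℕ.+ i) * pos (binomial n i)
  diffCoeff≡sign*binomial zero zero = refl
  diffCoeff≡sign*binomial zero (suc i) = sym (ℤP.*-zeroʳ (sign (suc i)))
  diffCoeff≡sign*binomial (suc n) zero = trans (cong -_ (trans (diffCoeff≡sign*binomial n 0) (ℤP.*-identityʳ (sign (n ℕ.+ 0))))) (sym (ℤP.*-identityʳ (- sign (n ℕ.+ 0))))
  diffCoeff≡sign*binomial (suc n) (suc i) = begin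
    diffCoeff n i - diffCoeff n (suc i) ≡⟨ cong₂ _-_ (diffCoeff≡sign*binomial n i) (diffCoeff≡sign*binomial n (suc i)) ⟩
    sign (n ℕ.+ i) * pos (binomial n i) - sign (n ℕ.+ suc i) * pos (binomial n (suc i)) ≡⟨ cong (λ k → sign (n ℕ.+ i) * pos (binomial n i) - sign k * pos (binomial n (suc i))) (ℕP.+-suc n i) ⟩
    sign (n ℕ.+ i) * pos (binomial n i) - - sign (n ℕ.+ i) * pos (binomial n (suc i)) ≡⟨ alg (sign (n ℕ.+ i)) (pos (binomial n i)) (pos (binomial n (suc i))) ⟩
    sign (n ℕ.+ i) * (pos (binomial n i) + pos (binomial n (suc i))) ≡⟨ cong (sign (n ℕ.+ i) *_) (sym (ℤP.pos-+ (binomial n i) (binomial n (suc i)))) ⟩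
    sign (n ℕ.+ i) * pos (binomial (suc n) (suc i)) ≡⟨ cong (_* pos (binomial (suc n) (suc i))) (sym (trans (cong (λ k → - sign k) (ℕP.+-suc n i)) (ℤP.neg-involutive (sign (n ℕ.+ i))))) ⟩
    sign (suc n ℕ.+ suc i) * pos (binomial (suc n) (suc i)) ∎
    where
    open ≡-Reasoning
    alg : ∀ a b c → a * b - - a * c ≡ a * (b + c)
    alg = solve-∀

  iterateΔ-expand : ∀ m n Y s → iterate n (Δ m) Y s ≡ sumℤ (suc n) (λ i → diffCoeff n i * Y (i ℕ.* m ℕ.+ s))
  iterateΔ-expand m zero Y s = sym (trans (ℤP.+-identityʳ _) (ℤP.*-identityˡ _))
  iterateΔ-expand m (suc n) Y s = begin
    iterate n (Δ m) Y (m ℕ.+ s) - iterate n (Δ m) Y s ≡⟨ cong₂ _-_ (trans (iterateΔ-expand m n Y (m ℕ.+ s)) (sumℤ-cong (suc n) (λ i _ → cong (λ k → diffCoeff n i * Y k) (ar i)))) (iterateΔ-expand m n Y s) ⟩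
    sumℤ (suc n) G - (diffCoeff n 0 * Y s + sumℤ n H) ≡⟨ sym (trans (cong (λ x → sumℤ (suc n) G - (diffCoeff n 0 * Y s + sumℤ n H) - x) Hn0) (ℤP.+-identityʳ _)) ⟩
    sumℤ (suc n) G - (diffCoeff n 0 * Y s + sumℤ n H) - H n ≡⟨ alg (sumℤ (suc n) G) (diffCoeff n 0) (Y s) (sumℤ n H) (H n) ⟩
    - diffCoeff n 0 * Y s + (sumℤ (suc n) G - (sumℤ n H + H n)) ≡⟨ cong (λ x → - diffCoeff n 0 * Y s + (sumℤ (suc n) G - x)) (sym (sumℤ-last n H)) ⟩
    - diffCoeff n 0 * Y s + (sumℤ (suc n) G - sumℤ (suc n) H) ≡⟨ cong (- diffCoeff n 0 * Y s +_) (sym (sumℤ-- (suc n) G H)) ⟩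
    - diffCoeff n 0 * Y s + sumℤ (suc n) (λ i → G i - H i) ≡⟨ cong (- diffCoeff n 0 * Y s +_) (sumℤ-cong (suc n) (λ i _ → dist (diffCoeff n i) (diffCoeff n (suc i)) (Y (suc i ℕ.* m ℕ.+ s)))) ⟩
    sumℤ (suc (suc n)) (λ i → diffCoeff (suc n) i * Y (i ℕ.* m ℕ.+ s)) ∎
    where
    open ≡-Reasoning
    G : ℕ → ℤ
    G i = diffCoeff n i * Y (suc i ℕ.* m ℕ.+ s)
    H : ℕ → ℤ
    H i = diffCoeff n (suc i) * Y (suc i ℕ.* m ℕ.+ s)
    ar : ∀ i → i ℕ.* m ℕ.+ (m ℕ.+ s) ≡ suc i ℕ.* m ℕ.+ s
    ar i = trans (sym (ℕP.+-assoc (i ℕ.* m) m s)) (cong (ℕ._+ s) (ℕP.+-comm (i ℕ.* m) m))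
    Hn0 : H n ≡ 0ℤ
    Hn0 = trans (cong (_* Y (suc n ℕ.* m ℕ.+ s)) (diffCoeff-beyond n (suc n) (ℕP.n<1+n n))) (ℤP.*-zeroˡ (Y (suc n ℕ.* m ℕ.+ s)))
    alg : ∀ a c y h z → a - (c * y + h) - z ≡ - c * y + (a - (h + z))
    alg = solve-∀
    dist : ∀ a b y → a * y - b * y ≡ (a - b) * y
    dist = solve-∀

  prime>1 : ∀ {p} → Prime p → 1 < p
  prime>1 {p} pp = ℕ.nonTrivial⇒n>1 p {{Data.Nat.Primality.prime⇒nonTrivial pp}}
    where import Data.Nat.Primality

  sign-odd : ∀ n → ¬ (2 ∣ n) → sign n ≡ - 1ℤ
  sign-odd zero nd = ⊥-elim (nd (divides 0 refl))
  sign-odd (suc zero) nd = refl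
  sign-odd (suc (suc n)) nd = trans (ℤP.neg-involutive (sign n)) (sign-odd n (λ d → nd (∣m∣n⇒∣m+n-2 d)))
    where
    ∣m∣n⇒∣m+n-2 : 2 ∣ n → 2 ∣ suc (suc n)
    ∣m∣n⇒∣m+n-2 (divides q e) = divides (suc q) (cong (λ x → suc (suc x)) e)

  p∣sign-p+1 : ∀ p → Prime p → pos p ∣z (sign p + 1ℤ)
  p∣sign-p+1 p pp with 2 ∣? p
  ... | no nd = ∣z-eq (sym (trans (cong (_+ 1ℤ) (sign-odd p nd)) refl)) (∣z-0 (pos p))
  ... | yes d with prime⇒irreducible pp d
  ...   | inj₁ ()
  ...   | inj₂ refl = ∣z-refl (pos 2)

  iterateΔ-prime≡Δ-mod : ∀ p → Prime p → ∀ m Y → CongMod (pos p) (iterate p (Δ m) Y) (Δ (p ℕ.* m) Y)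
  iterateΔ-prime≡Δ-mod zero pp m Y = ⊥-elim (ℕP.<⇒≱ (prime>1 pp) z≤n)
  iterateΔ-prime≡Δ-mod (suc p') pp m Y = cm λ s → ∣z-eq (sym (eq s)) (∣z-+ (∣z-*ʳ (Y s) (p∣sign-p+1 p pp)) (mid s))
    where
    p = suc p'
    M : ℕ → ℤ
    M s = sumℤ p' (λ i → diffCoeff p (suc i) * Y (suc i ℕ.* m ℕ.+ s))
    mid : ∀ s → pos p ∣z M s
    mid s = ∣z-sum p' _ (λ i i<p' → ∣z-*ʳ (Y (suc i ℕ.* m ℕ.+ s)) (∣z-eq (sym (trans (diffCoeff≡sign*binomial p (suc i)) refl)) (∣z-*ˡ (sign (p ℕ.+ suc i)) (dn (prime∣binomial p pp (suc i) (s≤s z≤n) (s≤s i<p'))))))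
      where
      dn : ∀ {a b} → a ∣ b → pos a ∣z pos b
      dn {a} (divides q refl) = pos q , trans (ℤP.pos-* q a) (ℤP.*-comm (pos q) (pos a))
    eq : ∀ s → iterate p (Δ m) Y s - Δ (p ℕ.* m) Y s ≡ (sign p + 1ℤ) * Y s + M s
    eq s = begin
      iterate p (Δ m) Y s - Δ (p ℕ.* m) Y s ≡⟨ cong (_- Δ (p ℕ.* m) Y s) (iterateΔ-expand m p Y s) ⟩
      diffCoeff p 0 * Y s + sumℤ p (λ i → diffCoeff p (suc i) * Y (suc i ℕ.* m ℕ.+ s)) - Δ (p ℕ.* m) Y s ≡⟨ cong (λ x → diffCoeff p 0 * Y s + x - Δ (p ℕ.* m) Y s) (sumℤ-last p' (λ i → diffCoeff p (suc i) * Y (suc i ℕ.* m ℕ.+ s))) ⟩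
      diffCoeff p 0 * Y s + (M s + diffCoeff p p * Y (p ℕ.* m ℕ.+ s)) - (Y (p ℕ.* m ℕ.+ s) - Y s) ≡⟨ cong₂ (λ a b → a * Y s + (M s + b * Y (p ℕ.* m ℕ.+ s)) - (Y (p ℕ.* m ℕ.+ s) - Y s)) (diffCoeff-0 p) (diffCoeff-diag p) ⟩
      sign p * Y s + (M s + 1ℤ * Y (p ℕ.* m ℕ.+ s)) - (Y (p ℕ.* m ℕ.+ s) - Y s) ≡⟨ alg (sign p) (Y s) (M s) (Y (p ℕ.* m ℕ.+ s)) ⟩
      (sign p + 1ℤ) * Y s + M s ∎
      where
      open ≡-Reasoning
      alg : ∀ a y x z → a * y + (x + 1ℤ * z) - (z - y) ≡ (a + 1ℤ) * y + x
      alg = solve-∀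

  -- (x - 1)^(p^k) ≡ x^(p^k) - 1 (mod p), as difference operators.
  ∇ⁿ-p^k≡Δ-mod : ∀ p → Prime p → ∀ k Y → CongMod (pos p) (∇ⁿ (p ^ k) Y) (Δ (p ^ k) Y)
  ∇ⁿ-p^k≡Δ-mod p pp zero Y = ≐⇒CongMod (pw λ s → refl)
  ∇ⁿ-p^k≡Δ-mod p pp (suc k) Y =
    CongMod-trans (≐⇒CongMod (iterate-* p (p ^ k) ∇ ∇-resp Y))
      (CongMod-trans (iterate-CongMod (pos p) p (iterate (p ^ k) ∇) (Δ (p ^ k)) (iterate-preservesMod (pos p) (p ^ k) ∇ (∇-preservesMod (pos p))) (λ X → ∇ⁿ-p^k≡Δ-mod p pp k X) Y)
        (iterateΔ-prime≡Δ-mod p pp (p ^ k) Y))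

  p∣∇ⁿ-periodic : ∀ p → Prime p → ∀ k Y → Per (p ^ k) Y → ∀ s → pos p ∣z ∇ⁿ (p ^ k) Y s
  p∣∇ⁿ-periodic p pp k Y per s = ∣z-eq (trans (cong (λ x → ∇ⁿ (p ^ k) Y s - x) (trans (cong (_- Y s) (per s)) (ℤP.+-inverseʳ (Y s)))) (ℤP.+-identityʳ _)) (getMod (∇ⁿ-p^k≡Δ-mod p pp k Y) s)

  p^t∣∇ⁿ-periodic : ∀ p → Prime p → ∀ k t Y → Per (p ^ k) Y → ∀ s → pos (p ^ t) ∣z ∇ⁿ (t ℕ.* p ^ k) Y s
  p^t∣∇ⁿ-periodic p pp k zero Y per s = ∣z-eq (ℤP.*-identityˡ (Y s)) (Y s , refl)
  p^t∣∇ⁿ-periodic p pp k (suc t) Y per s = ∣z-eq (sym (trans (cong (λ Z → Z s) (iterate-+ (p ^ k) (t ℕ.* p ^ k) ∇ Y)) (at (iterate-resp (p ^ k) ∇ ∇-resp Zeq) s))) fin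
    where
    P = p ^ k
    Z : Seq
    Z = ∇ⁿ (t ℕ.* P) Y
    W : Seq
    W s = wit (p^t∣∇ⁿ-periodic p pp k t Y per s)
    Zeq : Z ≐ (λ s → pos (p ^ t) * W s)
    Zeq = pw λ s → eqn (p^t∣∇ⁿ-periodic p pp k t Y per s)
    nz : ℕ.NonZero (p ^ t)
    nz = ℕP.m^n≢0 p t {{ℕ.>-nonZero (ℕP.<-trans (s≤s z≤n) (prime>1 pp))}}
    Wper : Per P W
    Wper s = ℤP.*-cancelˡ-≡ (pos (p ^ t)) (W (P ℕ.+ s)) (W s) {{nz}} (trans (sym (at Zeq (P ℕ.+ s))) (trans (∇ⁿ-Per (t ℕ.* P) per s) (at Zeq s)))
    fin : pos (p ^ suc t) ∣z ∇ⁿ P (λ s → pos (p ^ t) * W s) s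
    fin = ∣z-eq (sym (at (∇ⁿ-sc P (pos (p ^ t)) W) s)) (∣z-meq (trans (sym (ℤP.pos-* (p ^ t) p)) (cong pos (ℕP.*-comm (p ^ t) p))) (∣z-mul (∣z-refl (pos (p ^ t))) (p∣∇ⁿ-periodic p pp k W Wper s)))

module Arithmetic where

  open FiniteSums
  open ClassSums
  open Sequences
  open import Data.Nat as ℕ using (ℕ; zero; suc; _≤_; _<_; z≤n; s≤s; NonZero; _^_; _∸_)
  import Data.Nat.Properties as ℕP
  open import Data.Nat.DivMod using (_%_; _/_; m≡m%n+[m/n]*n; m%n<n)
  open import Data.Nat.Divisibility using (_∣_; divides; _∣?_; ∣⇒≤; ∣-trans; ∣m+n∣m⇒∣n; ∣m∣n⇒∣m+n; m∣m*n; ∣1⇒≡1; *-cancelˡ-∣)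
  open import Data.Nat.Primality using (Prime; euclidsLemma; prime⇒irreducible)
  open FrobeniusDifferences using (prime>1)
  open import Data.Integer as ℤ using (ℤ; 0ℤ; _+_; _*_; -_; _-_; -[1+_]) renaming (+_ to pos)
  import Data.Integer.Properties as ℤP
  open import Data.Product using (Σ; _×_; _,_)
  open import Data.Sum using (_⊎_; inj₁; inj₂)
  open import Data.Empty using (⊥-elim)
  open import Relation.Nullary using (Dec; yes; no; ¬_)
  open import Relation.Nullary.Decidable using (map′)
  open import Relation.Binary.PropositionalEquality
  open import Function using (_∘_)

  ∣m∣n⇒∣m∸n : ∀ {d m n} → n ≤ m → d ∣ m → d ∣ n → d ∣ m ∸ n
  ∣m∣n⇒∣m∸n {d} {m} {n} n≤m dm dn = ∣m+n∣m⇒∣n (subst (d ∣_) (sym (trans (ℕP.+-comm n (m ∸ n)) (ℕP.m∸n+n≡m n≤m))) dm) dn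

  residue-unique≤ : ∀ {P s a b} → a ≤ b → b < P → P ∣ s ℕ.+ a → P ∣ s ℕ.+ b → a ≡ b
  residue-unique≤ {P} {s} {a} {b} a≤b b<P da db with b ∸ a ℕ.≟ 0
  ... | yes e = ℕP.≤-antisym a≤b (ℕP.m∸n≡0⇒m≤n e)
  ... | no ne = ⊥-elim (ℕP.<⇒≱ (ℕP.≤-<-trans (ℕP.m∸n≤m b a) b<P) (∣⇒≤ {{ℕ.≢-nonZero ne}} (subst (P ∣_) (ℕP.[m+n]∸[m+o]≡n∸o s b a) (∣m∣n⇒∣m∸n (ℕP.+-monoʳ-≤ s a≤b) db da))))

  residue-unique : ∀ {P s r r'} → r < P → r' < P → P ∣ s ℕ.+ r → P ∣ s ℕ.+ r' → r ≡ r'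
  residue-unique {P} {s} {r} {r'} r<P r'<P d d' with ℕP.≤-total r r'
  ... | inj₁ r≤r' = residue-unique≤ r≤r' r'<P d d'
  ... | inj₂ r'≤r = sym (residue-unique≤ r'≤r r<P d' d)

  residue-exists : ∀ P .{{_ : NonZero P}} s → Σ ℕ λ r → r < P × P ∣ s ℕ.+ r
  residue-exists P s with sumℕ-pos P (λ j → divInd P (s ℕ.+ j)) (subst (0 <_) (sym (divInd-window-sum P s)) (s≤s z≤n))
  ... | r , r<P , pos' = r , r<P , ι-pos (P ∣? (s ℕ.+ r)) pos'

  ^-monoʳ-∣ : ∀ p {a c} → a ≤ c → p ^ a ∣ p ^ c
  ^-monoʳ-∣ p {a} {c} a≤c = subst (p ^ a ∣_) (trans (sym (ℕP.^-distribˡ-+-* p a (c ∸ a))) (cong (p ^_) (ℕP.m+[n∸m]≡n a≤c))) (m∣m*n (p ^ (c ∸ a)))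

  n<p^n : ∀ p → 1 < p → ∀ n → n < p ^ n
  n<p^n p p>1 zero = s≤s z≤n
  n<p^n p p>1 (suc n) = ℕP.<-≤-trans (s≤s (n<p^n p p>1 n)) (lem (p ^ n) (ℕP.≤-trans (s≤s z≤n) (n<p^n p p>1 n)))
    where
    lem : ∀ m → 1 ≤ m → suc m ≤ p ℕ.* m
    lem m 1≤m = ℕP.≤-trans (ℕP.+-monoˡ-≤ m 1≤m) (subst (ℕ._≤ p ℕ.* m) (cong (m ℕ.+_) (ℕP.+-identityʳ m)) (ℕP.*-monoˡ-≤ m p>1))

  prime∣p^n⇒≡ : ∀ {p q} → Prime p → Prime q → ∀ n → q ∣ p ^ n → q ≡ p
  prime∣p^n⇒≡ {p} {q} pp pq zero d = ⊥-elim (ℕP.<⇒≢ (prime>1 pq) (sym (∣1⇒≡1 d)))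
  prime∣p^n⇒≡ {p} {q} pp pq (suc n) d with euclidsLemma p (p ^ n) pq d
  ... | inj₂ d' = prime∣p^n⇒≡ pp pq n d'
  ... | inj₁ d' with prime⇒irreducible pp d'
  ...   | inj₁ q≡1 = ⊥-elim (ℕP.<⇒≢ (prime>1 pq) (sym q≡1))
  ...   | inj₂ q≡p = q≡p

  record Valuation (p M : ℕ) : Set where
    field
      exponent : ℕ
      unit : ℕ
      decomposition : M ≡ p ^ exponent ℕ.* unit
      unit-coprime : ¬ (p ∣ unit)

  valuation : ∀ p → 1 < p → ∀ M → 0 < M → Valuation p M
  valuation p p>1 M M>0 = go M ℕP.≤-refl M>0
    where
    go : ∀ {fuel} M → M ≤ fuel → 0 < M → Valuation p M
    go M M≤ M>0 with p ∣? M
    ... | no p∤M = record { exponent = 0 ; unit = M ; decomposition = sym (ℕP.+-identityʳ M) ; unit-coprime = p∤M }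
    go {zero} M M≤ M>0 | yes _ = ⊥-elim (ℕP.<⇒≱ M>0 M≤)
    go {suc fuel} M M≤ M>0 | yes (divides q refl) = record
      { exponent = suc exponent
      ; unit = unit
      ; decomposition = trans (ℕP.*-comm q p) (trans (cong (p ℕ.*_) decomposition) (sym (ℕP.*-assoc p (p ^ exponent) unit)))
      ; unit-coprime = unit-coprime
      }
      where
      q>0 : 0 < q
      q>0 = ℕP.n≢0⇒n>0 (λ q≡0 → ℕP.<⇒≢ M>0 (sym (cong (ℕ._* p) q≡0)))
      open Valuation (go {fuel} q (ℕP.≤-pred (ℕP.≤-trans (ℕP.m<m*n q p {{ℕ.>-nonZero q>0}} p>1) M≤)) q>0)

  p^a∣p^K*m⇒a≤K : ∀ {p} → Prime p → ∀ a K m → ¬ (p ∣ m) → p ^ a ∣ p ^ K ℕ.* m → a ≤ K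
  p^a∣p^K*m⇒a≤K pp zero K m p∤m d = z≤n
  p^a∣p^K*m⇒a≤K {p} pp (suc a) zero m p∤m d = ⊥-elim (p∤m (∣-trans (m∣m*n (p ^ a)) (subst (p ℕ.* p ^ a ∣_) (ℕP.+-identityʳ m) d)))
  p^a∣p^K*m⇒a≤K {p} pp (suc a) (suc K) m p∤m d = s≤s (p^a∣p^K*m⇒a≤K pp a K m p∤m (*-cancelˡ-∣ p {{ℕ.>-nonZero (ℕP.<-trans (s≤s z≤n) (prime>1 pp))}} (subst (p ℕ.* p ^ a ∣_) (ℕP.*-assoc p (p ^ K) m) d)))

  ∣z⇒∣abs : ∀ {m x} → pos m ∣z x → m ∣ ℤ.∣ x ∣
  ∣z⇒∣abs {m} (w , refl) = divides ℤ.∣ w ∣ (trans (ℤP.abs-* (pos m) w) (ℕP.*-comm m ℤ.∣ w ∣))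

  ∣abs⇒∣z : ∀ {m} x → m ∣ ℤ.∣ x ∣ → pos m ∣z x
  ∣abs⇒∣z {m} (pos n) (divides q e) = pos q , trans (cong pos (trans e (ℕP.*-comm q m))) (ℤP.pos-* m q)
  ∣abs⇒∣z {m} -[1+ n ] (divides q e) = - pos q , trans (cong -_ (trans (cong pos (trans e (ℕP.*-comm q m))) (ℤP.pos-* m q))) (ℤP.neg-distribʳ-* (pos m) (pos q))

  ∣z? : ∀ m x → Dec (pos m ∣z x)
  ∣z? m x = map′ (∣abs⇒∣z x) ∣z⇒∣abs (m ∣? ℤ.∣ x ∣)

  ∣z-small : ∀ {m x} → pos m ∣z x → ℤ.∣ x ∣ < m → x ≡ 0ℤ
  ∣z-small {m} {x} (w , refl) lt with ℤ.∣ w ∣ ℕ.≟ 0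
  ... | yes e = trans (cong (pos m *_) (ℤP.∣i∣≡0⇒i≡0 e)) (ℤP.*-zeroʳ (pos m))
  ... | no ne = ⊥-elim (ℕP.<⇒≱ lt (subst (m ≤_) (sym (ℤP.abs-* (pos m) w)) (ℕP.m≤m*n m ℤ.∣ w ∣ {{ℕ.≢-nonZero ne}})))

  euclidℤ : ∀ {p} → Prime p → ∀ x y → pos p ∣z (x * y) → pos p ∣z x ⊎ pos p ∣z y
  euclidℤ {p} pp x y d with euclidsLemma ℤ.∣ x ∣ ℤ.∣ y ∣ pp (subst (p ∣_) (ℤP.abs-* x y) (∣z⇒∣abs d))
  ... | inj₁ dx = inj₁ (∣abs⇒∣z x dx)
  ... | inj₂ dy = inj₂ (∣abs⇒∣z y dy)

  Per-from-one-period : ∀ {P D X} .{{_ : NonZero P}} → Per P X → (∀ s → s < P → X (D ℕ.+ s) ≡ X s) → Per D X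
  Per-from-one-period {P} {D} {X} per fin s = begin
    X (D ℕ.+ s) ≡⟨ cong (λ x → X (D ℕ.+ x)) e ⟩
    X (D ℕ.+ (s % P ℕ.+ (s / P) ℕ.* P)) ≡⟨ cong X (ar D (s % P) ((s / P) ℕ.* P)) ⟩
    X ((s / P) ℕ.* P ℕ.+ (D ℕ.+ s % P)) ≡⟨ Per-multiple per (s / P) (D ℕ.+ s % P) ⟩
    X (D ℕ.+ s % P) ≡⟨ fin (s % P) (m%n<n s P) ⟩
    X (s % P) ≡⟨ sym (Per-multiple per (s / P) (s % P)) ⟩
    X ((s / P) ℕ.* P ℕ.+ s % P) ≡⟨ cong X (trans (ℕP.+-comm _ (s % P)) (sym e)) ⟩
    X s ∎
    where
    open ≡-Reasoning
    e : s ≡ s % P ℕ.+ (s / P) ℕ.* P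
    e = m≡m%n+[m/n]*n s P
    ar : ∀ a b c → a ℕ.+ (b ℕ.+ c) ≡ c ℕ.+ (a ℕ.+ b)
    ar a b c = trans (sym (ℕP.+-assoc a b c)) (ℕP.+-comm (a ℕ.+ b) c)

  ∀<? : ∀ n (Q : ℕ → Set) → (∀ s → Dec (Q s)) → Dec (∀ s → s < n → Q s)
  ∀<? zero Q d = yes (λ s ())
  ∀<? (suc n) Q d with d 0 | ∀<? n (Q ∘ suc) (d ∘ suc)
  ... | no ¬q | _ = no (λ h → ¬q (h 0 (s≤s z≤n)))
  ... | yes q | no ¬r = no (λ h → ¬r (λ s s<n → h (suc s) (s≤s s<n)))
  ... | yes q | yes r = yes λ { zero _ → q ; (suc s) (s≤s s<n) → r s s<n }

  Per? : ∀ {P D X} .{{_ : NonZero P}} → Per P X → Dec (Per D X)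
  Per? {P} {D} {X} per with ∀<? P (λ s → X (D ℕ.+ s) ≡ X s) (λ s → X (D ℕ.+ s) ℤ.≟ X s)
  ... | yes h = yes (Per-from-one-period per h)
  ... | no ¬h = no (λ i → ¬h (λ s _ → i s))

  ∣shifts⇒∣dist : ∀ {d x y s} → d ∣ x ℕ.+ s → d ∣ y ℕ.+ s → d ∣ ℕ.∣ x - y ∣
  ∣shifts⇒∣dist {d} {x} {y} {s} dx dy with ℕP.≤-total x y
  ... | inj₁ x≤y = subst (d ∣_) (trans (trans (cong₂ _∸_ (ℕP.+-comm y s) (ℕP.+-comm x s)) (ℕP.[m+n]∸[m+o]≡n∸o s y x)) (sym (ℕP.m≤n⇒∣m-n∣≡n∸m x≤y))) (∣m∣n⇒∣m∸n (ℕP.+-monoˡ-≤ s x≤y) dy dx)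
  ... | inj₂ y≤x = subst (d ∣_) (trans (trans (cong₂ _∸_ (ℕP.+-comm x s) (ℕP.+-comm y s)) (ℕP.[m+n]∸[m+o]≡n∸o s x y)) (sym (ℕP.m≤n⇒∣n-m∣≡n∸m y≤x))) (∣m∣n⇒∣m∸n (ℕP.+-monoˡ-≤ s y≤x) dx dy)

  ∣dist⇒∣shift : ∀ {d x y s} → d ∣ ℕ.∣ x - y ∣ → d ∣ x ℕ.+ s → d ∣ y ℕ.+ s
  ∣dist⇒∣shift {d} {x} {y} {s} dxy dx with ℕP.≤-total x y
  ... | inj₁ x≤y = subst (d ∣_) e (∣m∣n⇒∣m+n dx (subst (d ∣_) (ℕP.m≤n⇒∣m-n∣≡n∸m x≤y) dxy))
    where
    e : x ℕ.+ s ℕ.+ (y ∸ x) ≡ y ℕ.+ s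
    e = trans (ℕP.+-assoc x s (y ∸ x)) (trans (cong (x ℕ.+_) (ℕP.+-comm s (y ∸ x))) (trans (sym (ℕP.+-assoc x (y ∸ x) s)) (cong (ℕ._+ s) (ℕP.m+[n∸m]≡n x≤y))))
  ... | inj₂ y≤x = ∣m+n∣m⇒∣n (subst (d ∣_) e dx) (subst (d ∣_) (ℕP.m≤n⇒∣n-m∣≡n∸m y≤x) dxy)
    where
    e : x ℕ.+ s ≡ (x ∸ y) ℕ.+ (y ℕ.+ s)
    e = trans (cong (ℕ._+ s) (sym (ℕP.m∸n+n≡m y≤x))) (ℕP.+-assoc (x ∸ y) y s)

module PolynomialSums where

  open import Defs
  open Polynomials
  open FiniteSums
  open import Data.Nat as ℕ using (ℕ; zero; suc; _<_; z≤n; s≤s)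
  import Data.Nat.Properties as ℕP
  open import Data.Integer using () renaming (_+_ to _+ℤ_)
  open import Data.List using ([]; map; applyUpTo)
  open import Relation.Binary.PropositionalEquality

  sumℤ-block : ∀ q E f → sumℤ (q ℕ.* E) f ≡ sumℤ q (λ j → sumℤ E (λ t → f (j ℕ.* E ℕ.+ t)))
  sumℤ-block zero E f = refl
  sumℤ-block (suc q) E f = trans (sumℤ-split E (q ℕ.* E) f) (cong (sumℤ E f +ℤ_) (trans (sumℤ-block q E (λ i → f (E ℕ.+ i))) (sumℤ-cong q (λ j _ → sumℤ-cong E (λ t _ → cong f (sym (ℕP.+-assoc E (j ℕ.* E) t)))))))

  ≡→≋ : ∀ {u v} → u ≡ v → u ≋ v
  ≡→≋ refl = ≋refl

  shiftN-mono : ∀ a b → shiftN a (mono b) ≡ mono (a ℕ.+ b)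
  shiftN-mono zero b = refl
  shiftN-mono (suc a) b = cong shift (shiftN-mono a b)

  mono-add : ∀ a b → mono (a ℕ.+ b) ≋ (mono a *ₚ mono b)
  mono-add a b = ≋sym (≋trans (mono-mul a (mono b)) (≡→≋ (shiftN-mono a b)))

  psum : ℕ → (ℕ → Poly) → Poly
  psum zero h = []
  psum (suc n) h = h 0 +ₚ psum n (λ r → h (suc r))

  coeff-psum : ∀ n h k → coeff (psum n h) k ≡ sumℤ n (λ r → coeff (h r) k)
  coeff-psum zero h k = refl
  coeff-psum (suc n) h k = trans (coeff-+ (h 0) (psum n (λ r → h (suc r))) k) (cong (coeff (h 0) k +ℤ_) (coeff-psum n (λ r → h (suc r)) k))

  psum-cong : ∀ n {h h'} → (∀ r → r < n → h r ≋ h' r) → psum n h ≋ psum n h'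
  psum-cong zero e = ≋refl
  psum-cong (suc n) e = +-cong (e 0 (s≤s z≤n)) (psum-cong n (λ r r<n → e (suc r) (s≤s r<n)))

  psum-mulˡ : ∀ n u h → psum n (λ r → u *ₚ h r) ≋ (u *ₚ psum n h)
  psum-mulˡ zero u h = ≋sym (mul-[] u)
  psum-mulˡ (suc n) u h = ≋trans (+-cong ≋refl (psum-mulˡ n u (λ r → h (suc r)))) (≋sym (distribˡ u (h 0) (psum n (λ r → h (suc r)))))

  psum-mulʳ : ∀ n u h → psum n (λ r → h r *ₚ u) ≋ (psum n h *ₚ u)
  psum-mulʳ n u h = ≋trans (psum-cong n (λ r _ → *-comm (h r) u)) (≋trans (psum-mulˡ n u h) (*-comm u (psum n h)))

  psum-block : ∀ q E h → psum (q ℕ.* E) h ≋ psum q (λ j → psum E (λ t → h (j ℕ.* E ℕ.+ t)))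
  psum-block q E h = mk≋ λ m → trans (coeff-psum (q ℕ.* E) h m) (trans (sumℤ-block q E (λ r → coeff (h r) m)) (sym (trans (coeff-psum q _ m) (sumℤ-cong q (λ j _ → coeff-psum E _ m)))))

  sumₚ-applyUpTo : ∀ (h : ℕ → Poly) f n → sumₚ (map h (applyUpTo f n)) ≡ psum n (λ r → h (f r))
  sumₚ-applyUpTo h f zero = refl
  sumₚ-applyUpTo h f (suc n) = cong (h (f 0) +ₚ_) (sumₚ-applyUpTo h (λ r → f (suc r)) n)

  open ClassSums using (Λ; Λ-+)

  Λ-psum : ∀ F n h s → Λ F (psum n h) s ≡ sumℤ n (λ r → Λ F (h r) s)
  Λ-psum F zero h s = refl
  Λ-psum F (suc n) h s = trans (Λ-+ F (h 0) (psum n (λ r → h (suc r))) s) (cong (Λ F (h 0) s +ℤ_) (Λ-psum F n (λ r → h (suc r)) s))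

module PolynomialRingSolver where

  open import Defs
  open Polynomials
  open import Data.Integer as ℤ using (ℤ; 0ℤ; 1ℤ; _+_)
  import Data.Integer.Properties as ℤP
  open import Data.List using ([]; _∷_)
  open import Data.Product using (_,_)
  open import Data.Maybe using (Maybe; nothing; just)
  open import Data.Nat using (zero; suc)
  open import Relation.Nullary using (yes)
  open import Relation.Binary.PropositionalEquality
  open import Algebra.Bundles using (CommutativeRing)
  open import Algebra.Structures
  open import Tactic.RingSolver.Core.AlmostCommutativeRing using (AlmostCommutativeRing; fromCommutativeRing)
  open import Level using (0ℓ)

  neg-invˡ : ∀ x → (neg x +ₚ x) ≋ []
  neg-invˡ x = mk≋ λ k → trans (coeff-+ (neg x) x k) (trans (cong (_+ coeff x k) (coeff-neg x k)) (ℤP.+-inverseˡ (coeff x k)))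

  neg-invʳ : ∀ x → (x +ₚ neg x) ≋ []
  neg-invʳ x = mk≋ λ k → trans (coeff-+ x (neg x) k) (trans (cong (coeff x k +_) (coeff-neg x k)) (ℤP.+-inverseʳ (coeff x k)))

  isZeroP : (x : Poly) → Maybe ([] ≋ x)
  isZeroP [] = just ≋refl
  isZeroP (c ∷ x) with c ℤ.≟ 0ℤ | isZeroP x
  ... | yes e | just z = just (mk≋ λ { zero → sym e ; (suc k) → get z k })
  ... | _ | _ = nothing

  polyIsCR : IsCommutativeRing _≋_ _+ₚ_ _*ₚ_ neg [] (1ℤ ∷ [])
  polyIsCR = record
    { isRing = record
      { +-isAbelianGroup = record
        { isGroup = record
          { isMonoid = record
            { isSemigroup = record
              { isMagma = record
                { isEquivalence = record { refl = ≋refl ; sym = ≋sym ; trans = ≋trans }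
                ; ∙-cong = +-cong }
              ; assoc = +-assoc }
            ; identity = +-idˡ , +-idʳ }
          ; inverse = neg-invˡ , neg-invʳ
          ; ⁻¹-cong = neg-cong }
        ; comm = +-comm }
      ; *-cong = *-cong
      ; *-assoc = *-assoc
      ; *-identity = *-identityˡ , *-identityʳ
      ; distrib = distribˡ , (λ x y z → distribʳ y z x) }
    ; *-comm = *-comm }

  polyCR : CommutativeRing 0ℓ 0ℓ
  polyCR = record { isCommutativeRing = polyIsCR }

  polyACR : AlmostCommutativeRing 0ℓ 0ℓ
  polyACR = fromCommutativeRing polyCR isZeroP

  open import Tactic.RingSolver.NonReflective polyACR public using (solve; _⊜_; _⊕_; _⊗_; ⊝_; Κ)


module CyclotomicPrimality (p : ℕ) (pp : Prime p) (k : ℕ) where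
  open import Data.Nat as ℕ using (ℕ; zero; suc; _<_; z≤n; s≤s; NonZero; _^_; _∸_)
  open import Data.Nat.Primality using (Prime)

  open import Defs
  open Polynomials
  open FiniteSums
  open ClassSums
  open Sequences
  open FrobeniusDifferences
  open Arithmetic
  open PolynomialSums using (sumℤ-block)
  import Data.Nat.Properties as ℕP
  open import Data.Nat.Divisibility using (_∣_; divides; _∣?_)
  open import Data.Integer as ℤ using (ℤ; 0ℤ; 1ℤ; _+_; _*_; -_; _-_) renaming (+_ to pos)
  import Data.Integer.Properties as ℤP
  open import Data.Integer.Tactic.RingSolver
  open import Data.Product using (Σ; _×_; _,_)
  open import Data.Sum using (_⊎_; inj₁; inj₂)
  open import Data.Empty using (⊥; ⊥-elim)
  open import Relation.Nullary using (yes; no; ¬_)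
  open import Relation.Binary.PropositionalEquality

  D : ℕ
  D = p ^ k

  P : ℕ
  P = p ^ suc k

  p>0 : 0 < p
  p>0 = ℕP.<-trans (s≤s z≤n) (prime>1 pp)

  instance
    nzp : NonZero p
    nzp = ℕ.>-nonZero p>0
    nzD : NonZero D
    nzD = ℕP.m^n≢0 p k
    nzP : NonZero P
    nzP = ℕP.m^n≢0 p (suc k)

  -- Applied to X s = classSum P s f, this says that Φ_P divides f (see CyclotomicDivisibility).
  Balanced : Seq → Set
  Balanced = Per D

  Balanced⇒Per : ∀ {X} → Balanced X → Per P X
  Balanced⇒Per i s = Per-multiple i p s

  -- If ∇ X is D-periodic, then X (D + s) - X s is a constant c, and P-periodicity forces p c = 0.
  ∇-reflects-Balanced : ∀ X → Per P X → Balanced (∇ X) → Balanced X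
  ∇-reflects-Balanced X per i s = trans (at jump-eq s) fin
    where
    jump : ℕ → ℤ
    jump s = X (D ℕ.+ s) - X s
    jump-eq : (λ s → X (D ℕ.+ s)) ≐ (λ s → X s + jump s)
    jump-eq = pw λ s → alg (X (D ℕ.+ s)) (X s)
      where
      alg : ∀ a b → a ≡ b + (a - b)
      alg = solve-∀
    jump-suc : ∀ s → jump (suc s) ≡ jump s
    jump-suc s = trans (cong (λ x → X x - X (suc s)) (ℕP.+-suc D s)) (-‿exchange (X (suc (D ℕ.+ s))) (X (D ℕ.+ s)) (X (suc s)) (X s) (i s))
    jump-const : ∀ s → jump s ≡ jump 0
    jump-const zero = refl
    jump-const (suc s) = trans (jump-suc s) (jump-const s)
    lin : ∀ j s → X (j ℕ.* D ℕ.+ s) ≡ X s + pos j * jump 0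
    lin zero s = sym (trans (cong (X s +_) (ℤP.*-zeroˡ (jump 0))) (ℤP.+-identityʳ (X s)))
    lin (suc j) s = begin
      X (D ℕ.+ j ℕ.* D ℕ.+ s) ≡⟨ cong X (ℕP.+-assoc D (j ℕ.* D) s) ⟩
      X (D ℕ.+ (j ℕ.* D ℕ.+ s)) ≡⟨ at jump-eq (j ℕ.* D ℕ.+ s) ⟩
      X (j ℕ.* D ℕ.+ s) + jump (j ℕ.* D ℕ.+ s) ≡⟨ cong₂ _+_ (lin j s) (jump-const _) ⟩
      X s + pos j * jump 0 + jump 0 ≡⟨ alg (X s) (pos j) (jump 0) ⟩
      X s + (1ℤ + pos j) * jump 0 ≡⟨ cong (λ x → X s + x * jump 0) (ℤP.pos-+ 1 j) ⟩
      X s + pos (suc j) * jump 0 ∎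
      where
      open ≡-Reasoning
      alg : ∀ x j d → x + j * d + d ≡ x + (1ℤ + j) * d
      alg = solve-∀
    jump0 : jump 0 ≡ 0ℤ
    jump0 = ℤP.*-cancelˡ-≡ (pos p) (jump 0) 0ℤ (trans (+-cancelˡ (X 0) (pos p * jump 0) 0ℤ (trans (sym (lin p 0)) (trans (per 0) (sym (ℤP.+-identityʳ (X 0)))))) (sym (ℤP.*-zeroʳ (pos p))))
    fin : X s + jump s ≡ X s
    fin = trans (cong (X s +_) (trans (jump-const s) jump0)) (ℤP.+-identityʳ (X s))

  Balanced⇒p∣sum : ∀ Z → Balanced Z → pos p ∣z sumℤ P Z
  Balanced⇒p∣sum Z i = ∣z-eq (sym (trans (sumℤ-block p D Z) (trans (sumℤ-cong p (λ j _ → sumℤ-cong D (λ t _ → Per-multiple i j t))) (sumℤ-const p (sumℤ D Z))))) (∣z-*ʳ (sumℤ D Z) (∣z-refl (pos p)))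

  sum-divIndℤ : sumℤ P (divIndℤ D) ≡ pos p
  sum-divIndℤ = trans (sumℤ-block p D (divIndℤ D)) (trans (sumℤ-cong p (λ j _ → trans (sumℤ-+ℕ D (λ t → divInd D (j ℕ.* D ℕ.+ t))) (cong pos (divInd-window-sum D (j ℕ.* D))))) (trans (sumℤ-const p 1ℤ) (ℤP.*-identityʳ (pos p))))

  divIndℤ-Balanced : Balanced (divIndℤ D)
  divIndℤ-Balanced s = cong pos (trans (cong (divInd D) (ℕP.+-comm D s)) (divInd-periodic D s))

  record Decomposition (X : Seq) : Set where
    field
      X1 : Seq
      I : Seq
      perX1 : Per P X1
      invI : Balanced I
      dec : X ≐ (λ s → ∇ X1 s + I s)

  -- With ΣX = p c, the sequence X - c [D ∣ _] sums to zero over a period, so its running sum X1 is P-periodic.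
  decompose : ∀ X → Per P X → pos p ∣z sumℤ P X → Decomposition X
  decompose X per (c , Σeq) = record { X1 = X1 ; I = I ; perX1 = perX1 ; invI = invI ; dec = dec }
    where
    I : Seq
    I s = c * divIndℤ D s
    invI : Balanced I
    invI s = cong (c *_) (divIndℤ-Balanced s)
    g : Seq
    g t = X t - I t
    X1 : Seq
    X1 s = sumℤ s g
    dec : X ≐ (λ s → ∇ X1 s + I s)
    dec = pw λ s → sym (trans (cong (λ x → x - sumℤ s g + I s) (sumℤ-last s g)) (alg (sumℤ s g) (X s) (I s)))
      where
      alg : ∀ a x i → a + (x - i) - a + i ≡ x
      alg = solve-∀
    gper : ∀ t → g (t ℕ.+ P) ≡ g t
    gper t = cong₂ _-_ (trans (cong X (ℕP.+-comm t P)) (per t)) (trans (cong I (ℕP.+-comm t P)) (Balanced⇒Per invI t))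
    gsum : sumℤ P g ≡ 0ℤ
    gsum = begin
      sumℤ P g ≡⟨ sumℤ-- P X I ⟩
      sumℤ P X - sumℤ P I ≡⟨ cong₂ _-_ Σeq (trans (sumℤ-*ˡ P c (divIndℤ D)) (cong (c *_) sum-divIndℤ)) ⟩
      pos p * c - c * pos p ≡⟨ alg (pos p) c ⟩
      0ℤ ∎
      where
      open ≡-Reasoning
      alg : ∀ a c → a * c - c * a ≡ 0ℤ
      alg = solve-∀
    perX1 : Per P X1
    perX1 s = trans (sumℤ-split P s g) (trans (cong₂ _+_ gsum (sumℤ-cong s (λ i _ → trans (cong g (ℕP.+-comm P i)) (gper i)))) (ℤP.+-identityˡ _))

  conv : Poly → Seq → Seq
  conv g X s = Λ X g s

  conv-resp : ∀ g {X Y} → X ≐ Y → conv g X ≐ conv g Y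
  conv-resp g e = pw λ s → Λ-Fcong (at e) g s

  conv-+ : ∀ g X Y → conv g (λ s → X s + Y s) ≐ (λ s → conv g X s + conv g Y s)
  conv-+ g X Y = pw λ s → Λ-F+ X Y g s

  conv-∇ : ∀ g X → conv g (∇ X) ≐ ∇ (conv g X)
  conv-∇ g X = pw λ s → trans (Λ-F+ (λ t → X (suc t)) (λ t → - X t) g s) (cong₂ _+_ (sym (Λ-off X g 1 s)) (Λ-Fneg X g s))

  conv-Per : ∀ g M X → Per M X → Per M (conv g X)
  conv-Per g M X per s = trans (Λ-off X g M s) (Λ-Fcong per g s)

  Balanced-+ : ∀ {X Y} → Balanced X → Balanced Y → Balanced (λ s → X s + Y s)
  Balanced-+ i j s = cong₂ _+_ (i s) (j s)

  Balanced-- : ∀ {X Y} → Balanced X → Balanced Y → Balanced (λ s → X s - Y s)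
  Balanced-- i j s = cong₂ _-_ (i s) (j s)

  Balanced-≐ : ∀ {X Y} → X ≐ Y → Balanced X → Balanced Y
  Balanced-≐ {X} {Y} e i s = trans (sym (at e (D ℕ.+ s))) (trans (i s) (at e s))

  Balanced-∇ⁿ : ∀ n {X} → Balanced X → Balanced (∇ⁿ n X)
  Balanced-∇ⁿ n i = ∇ⁿ-Per n i

  ∇ⁿ-comm : ∀ n X → ∇ⁿ n (∇ X) ≐ ∇ (∇ⁿ n X)
  ∇ⁿ-comm zero X = ≐refl
  ∇ⁿ-comm (suc n) X = ∇-resp (∇ⁿ-comm n X)

  -- While p divides the period sum, peel X = ∇ X1 + (balanced), keeping X0 - ∇ⁿ X and conv g X balanced.
  -- After N = B P steps, ∇ⁿ X ≡ 0 mod p^B, so the jumps X0 (D + s) - X0 s, bounded by B < p^B, vanish.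
  module Descent (g : Poly) (X0 : Seq) (perX0 : Per P X0) (nX0 : ¬ Balanced X0)
    (base : ∀ X → Per P X → ¬ (pos p ∣z sumℤ P X) → Balanced (conv g X) → ⊥) where

    u : Seq
    u s = X0 (D ℕ.+ s) - X0 s

    B : ℕ
    B = sumℕ P (λ s → ℤ.∣ u s ∣)

    N : ℕ
    N = B ℕ.* P

    finish : ∀ X → Per P X → Balanced (λ s → X0 s - ∇ⁿ N X s) → ⊥
    finish X perX J = nX0 (Per-from-one-period perX0 (λ s s<P → ℤP.i-j≡0⇒i≡j _ _ (zero-u s s<P)))
      where
      dv : ∀ s → pos (p ^ B) ∣z ∇ⁿ N X s
      dv s = p^t∣∇ⁿ-periodic p pp (suc k) B X perX s
      ueq : ∀ s → u s ≡ ∇ⁿ N X (D ℕ.+ s) - ∇ⁿ N X s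
      ueq s = -‿exchange (X0 (D ℕ.+ s)) (∇ⁿ N X (D ℕ.+ s)) (X0 s) (∇ⁿ N X s) (J s)
      zero-u : ∀ s → s < P → u s ≡ 0ℤ
      zero-u s s<P = ∣z-small (∣z-eq (sym (ueq s)) (∣z-- (dv (D ℕ.+ s)) (dv s))) (ℕP.≤-<-trans (sumℕ-≥ P (λ s → ℤ.∣ u s ∣) s s<P) (n<p^n p (prime>1 pp) B))

    ∇ⁿ-resp : ∀ n {X Y} → X ≐ Y → ∇ⁿ n X ≐ ∇ⁿ n Y
    ∇ⁿ-resp n = iterate-resp n ∇ ∇-resp

    loop : ∀ r n → n ℕ.+ r ≡ N → ∀ X → Per P X → Balanced (λ s → X0 s - ∇ⁿ n X s) → Balanced (conv g X) → ⊥
    loop zero n e X perX J iT = finish X perX (subst (λ m → Balanced (λ s → X0 s - ∇ⁿ m X s)) (trans (sym (ℕP.+-identityʳ n)) e) J)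
    loop (suc r) n e X perX J iT with ∣z? p (sumℤ P X)
    ... | no nd = base X perX nd iT
    ... | yes d = loop r (suc n) (trans (sym (ℕP.+-suc n r)) e) X1 perX1 J' iT1
      where
      open Decomposition (decompose X perX d)
      TX : conv g X ≐ (λ s → ∇ (conv g X1) s + conv g I s)
      TX = ≐trans (conv-resp g dec) (≐trans (conv-+ g (∇ X1) I) (pw λ s → cong (_+ conv g I s) (at (conv-∇ g X1) s)))
      i∇ : Balanced (∇ (conv g X1))
      i∇ = Balanced-≐ (pw λ s → alg (∇ (conv g X1) s) (conv g I s) (conv g X s) (at TX s)) (Balanced-- iT (conv-Per g D I invI))
        where
        alg : ∀ a b c → c ≡ a + b → c - b ≡ a
        alg a b c e = trans (cong (_- b) e) (alg' a b)
          where
          alg' : ∀ a b → a + b - b ≡ a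
          alg' = solve-∀
      iT1 : Balanced (conv g X1)
      iT1 = ∇-reflects-Balanced (conv g X1) (conv-Per g P X1 perX1) i∇
      NX : ∇ⁿ n X ≐ (λ s → ∇ⁿ (suc n) X1 s + ∇ⁿ n I s)
      NX = ≐trans (∇ⁿ-resp n dec) (≐trans (∇ⁿ-+ n (∇ X1) I) (pw λ s → cong (_+ ∇ⁿ n I s) (at (∇ⁿ-comm n X1) s)))
      J' : Balanced (λ s → X0 s - ∇ⁿ (suc n) X1 s)
      J' = Balanced-≐ (pw λ s → alg (X0 s) (∇ⁿ n X s) (∇ⁿ (suc n) X1 s) (∇ⁿ n I s) (at NX s)) (Balanced-+ J (Balanced-∇ⁿ n invI))
        where
        alg : ∀ x a b c → a ≡ b + c → x - a + c ≡ x - b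
        alg x a b c e = trans (cong (λ y → x - y + c) e) (alg' x b c)
          where
          alg' : ∀ x b c → x - (b + c) + c ≡ x - b
          alg' = solve-∀

    result : Balanced (conv g X0) → ⊥
    result iT = loop N 0 refl X0 perX0 (λ s → trans (ℤP.+-inverseʳ (X0 (D ℕ.+ s))) (sym (ℤP.+-inverseʳ (X0 s)))) iT

  classSum-realize : ∀ X → Per P X → Σ Poly λ x → (∀ s → classSum P s x ≡ X s) × (Λ (λ _ → 1ℤ) x 0 ≡ sumℤ P X)
  classSum-realize X per = fromCoeffs P c , rx , ev
    where
    c : ℕ → ℤ
    c r = X (P ∸ r)
    rx : ∀ s → classSum P s (fromCoeffs P c) ≡ X s
    rx s with residue-exists P s
    ... | r0 , r0<P , d0 = trans (Λ-fromCoeffs (divIndℤ P) P c s) (trans (sumℤ-single P _ r0 r0<P others) (trans (cong (c r0 *_) (cong pos (ι-yes (P ∣? (r0 ℕ.+ s)) (subst (P ∣_) (ℕP.+-comm s r0) d0)))) (trans (ℤP.*-identityʳ (c r0)) val)))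
      where
      others : ∀ r → r < P → r ≢ r0 → c r * divIndℤ P (r ℕ.+ s) ≡ 0ℤ
      others r r<P ne = trans (cong (c r *_) (cong pos (ι-no (P ∣? (r ℕ.+ s)) (λ d → ne (residue-unique r<P r0<P (subst (P ∣_) (ℕP.+-comm r s) d) d0))))) (ℤP.*-zeroʳ (c r))
      val : X (P ∸ r0) ≡ X s
      val = valh d0
        where
        valh : P ∣ s ℕ.+ r0 → X (P ∸ r0) ≡ X s
        valh (divides q e) = trans (sym (Per-multiple per q (P ∸ r0))) (trans (cong X (trans (cong (ℕ._+ (P ∸ r0)) (sym e)) (trans (ℕP.+-assoc s r0 (P ∸ r0)) (trans (cong (s ℕ.+_) (ℕP.m+[n∸m]≡n (ℕP.<⇒≤ r0<P))) (ℕP.+-comm s P))))) (per s))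
    ev : Λ (λ _ → 1ℤ) (fromCoeffs P c) 0 ≡ sumℤ P X
    ev = trans (Λ-fromCoeffs (λ _ → 1ℤ) P c 0) (trans (sumℤ-cong P (λ r _ → ℤP.*-identityʳ (c r))) (trans (sumℤ-rev P X) (sumℤ-shift1 P X (trans (cong X (sym (ℕP.+-identityʳ P))) (per 0)))))

  conv-sum : ∀ u Y → Per P Y → sumℤ P (λ s → conv u Y s) ≡ sumℤ P Y * Λ (λ _ → 1ℤ) u 0
  conv-sum u Y per = begin
    sumℤ P (λ s → Λ Y u s) ≡⟨ sumℤ-cong P (λ s _ → trans (cong (Λ Y u) (sym (ℕP.+-identityʳ s))) (Λ-off Y u s 0)) ⟩
    sumℤ P (λ s → Λ (λ t → Y (s ℕ.+ t)) u 0) ≡⟨ sym (Λ-Fsum P (λ s t → Y (s ℕ.+ t)) u 0) ⟩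
    Λ (λ t → sumℤ P (λ s → Y (s ℕ.+ t))) u 0 ≡⟨ Λ-Fcong (λ t → trans (sumℤ-cong P (λ s _ → cong Y (ℕP.+-comm s t))) (trans (sumℤ-shift P Y (λ t → trans (cong Y (ℕP.+-comm t P)) (per t)) t) (sym (ℤP.*-identityʳ (sumℤ P Y))))) u 0 ⟩
    Λ (λ t → sumℤ P Y * 1ℤ) u 0 ≡⟨ Λ-Fsc (sumℤ P Y) (λ _ → 1ℤ) u 0 ⟩
    sumℤ P Y * Λ (λ _ → 1ℤ) u 0 ∎
    where open ≡-Reasoning

  classSums : Poly → Seq
  classSums f s = classSum P s f

  -- Descend from f, then from g with the roles of the factors exchanged; the two base cases
  -- meet at p ∣ (ΣX) (ΣY) with p ∤ ΣX and p ∤ ΣY.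
  Balanced-product : ∀ f g → Balanced (classSums (f *ₚ g)) → Balanced (classSums f) ⊎ Balanced (classSums g)
  Balanced-product f g ifg with Per? {P} {D} (perF f)
    where
    perF : ∀ h → Per P (classSums h)
    perF h s = classSum-periodic P s h
  ... | yes iF = inj₁ iF
  ... | no nF with Per? {P} {D} (λ s → classSum-periodic P s g)
  ...   | yes iG = inj₂ iG
  ...   | no nG = ⊥-elim (Descent.result g (classSums f) (λ s → classSum-periodic P s f) nF base1 iT1)
    where
    G : Seq
    G = classSums g
    perG : Per P G
    perG s = classSum-periodic P s g
    iT1 : Balanced (conv g (classSums f))
    iT1 = Balanced-≐ (pw λ s → trans (Λ-≋ (divIndℤ P) (*-comm f g) s) (Λ-mul (divIndℤ P) g f s)) ifg
    base1 : ∀ X → Per P X → ¬ (pos p ∣z sumℤ P X) → Balanced (conv g X) → ⊥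
    base1 X perX ndX iTgX with classSum-realize X perX
    ... | x , rx , ev = Descent.result x G perG nG base2 (Balanced-≐ eqT iTgX)
      where
      eqT : conv g X ≐ conv x G
      eqT = pw λ s → trans (Λ-Fcong (λ t → sym (rx t)) g s) (trans (sym (Λ-mul (divIndℤ P) g x s)) (trans (Λ-≋ (divIndℤ P) (*-comm g x) s) (Λ-mul (divIndℤ P) x g s)))
      base2 : ∀ Y → Per P Y → ¬ (pos p ∣z sumℤ P Y) → Balanced (conv x Y) → ⊥
      base2 Y perY ndY iY with euclidℤ pp (sumℤ P Y) (sumℤ P X) (∣z-eq (trans (conv-sum x Y perY) (cong (sumℤ P Y *_) ev)) (Balanced⇒p∣sum (conv x Y) iY))
      ... | inj₁ dY = ndY dY
      ... | inj₂ dX = ndX dX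

module CyclotomicDivisibility (p : ℕ) (pp : Prime p) (k : ℕ) where
  open import Data.Nat as ℕ using (ℕ; zero; suc; _≤_; _<_; _∸_)
  open import Data.Nat.Primality using (Prime)

  open import Defs
  open Polynomials
  open PolynomialRingSolver
  open FiniteSums
  open ClassSums
  open Sequences
  open Arithmetic
  open CyclotomicPrimality p pp k
  open PolynomialSums
  open FrobeniusDifferences using (prime>1)
  import Data.Nat.Properties as ℕP
  open import Algebra.Properties.CommutativeSemigroup ℕP.+-commutativeSemigroup using (x∙yz≈y∙xz; x∙yz≈xz∙y; xy∙z≈y∙zx)
  open import Data.Nat.DivMod using (_%_; _/_; m≡m%n+[m/n]*n; m%n<n)
  open import Data.Nat.Divisibility using (_∣_; divides; _∣?_; ∣⇒≤; ∣-refl; ∣-trans; ∣m+n∣m⇒∣n; ∣m∣n⇒∣m+n)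
  open import Data.List.Membership.Propositional using (_∈_)
  open import Data.Integer using (ℤ; 0ℤ; -_) renaming (+_ to pos; _+_ to _+ℤ_; _*_ to _*ℤ_)
  import Data.Integer.Properties as ℤP
  open import Data.List using (List; []; _∷_; map)
  open import Data.Product using (Σ; _×_; _,_; proj₁; proj₂)
  open import Relation.Nullary using (yes; no; ¬_)
  open import Relation.Binary.PropositionalEquality
  open import Function using (id)

  Φ : Poly
  Φ = psum p (λ j → mono (j ℕ.* D))

  Φ-def : cyclotomicPP p (suc k) ≡ Φ
  Φ-def = sumₚ-applyUpTo (λ j → mono (j ℕ.* D)) id p

  telescope : ∀ m q → ((mono m -ₚ mono 0) *ₚ psum q (λ j → mono (j ℕ.* m))) ≋ (mono (q ℕ.* m) -ₚ mono 0)
  telescope m zero = ≋trans (mul-[] (mono m -ₚ mono 0)) (≋sym (sub-self (mono 0)))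
  telescope m (suc q) =
    (E *ₚ (mono 0 +ₚ psum q (λ j → mono (suc j ℕ.* m)))) ≋⟨ *-congʳ E (+-congˡ {mono 0} (≋trans (psum-cong q (λ j _ → mono-add m (j ℕ.* m))) (psum-mulˡ q (mono m) (λ j → mono (j ℕ.* m))))) ⟩
    (E *ₚ (mono 0 +ₚ (mono m *ₚ S))) ≋⟨ alg1 (mono m) S ⟩
    (E +ₚ (mono m *ₚ (E *ₚ S))) ≋⟨ +-congˡ {E} (*-congʳ (mono m) (telescope m q)) ⟩
    (E +ₚ (mono m *ₚ (mono (q ℕ.* m) -ₚ mono 0))) ≋⟨ alg2 (mono m) (mono (q ℕ.* m)) ⟩
    ((mono m *ₚ mono (q ℕ.* m)) -ₚ mono 0) ≋⟨ +-congʳ (≋sym (mono-add m (q ℕ.* m))) ⟩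
    (mono (suc q ℕ.* m) -ₚ mono 0) ∎≋
    where
    E = mono m -ₚ mono 0
    S = psum q (λ j → mono (j ℕ.* m))
    alg1 : ∀ M S → ((M -ₚ mono 0) *ₚ (mono 0 +ₚ (M *ₚ S))) ≋ ((M -ₚ mono 0) +ₚ (M *ₚ ((M -ₚ mono 0) *ₚ S)))
    alg1 = solve 2 (λ M S → ((M ⊕ (⊝ Κ (mono 0))) ⊗ (Κ (mono 0) ⊕ (M ⊗ S))) ⊜ ((M ⊕ (⊝ Κ (mono 0))) ⊕ (M ⊗ ((M ⊕ (⊝ Κ (mono 0))) ⊗ S)))) ≋refl
    alg2 : ∀ M Q → ((M -ₚ mono 0) +ₚ (M *ₚ (Q -ₚ mono 0))) ≋ ((M *ₚ Q) -ₚ mono 0)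
    alg2 = solve 2 (λ M Q → ((M ⊕ (⊝ Κ (mono 0))) ⊕ (M ⊗ (Q ⊕ (⊝ Κ (mono 0))))) ⊜ ((M ⊗ Q) ⊕ (⊝ Κ (mono 0)))) ≋refl

  R : ℕ → Poly
  R x = mono (x % P) *ₚ ((mono D -ₚ mono 0) *ₚ psum (x / P) (λ j → mono (j ℕ.* P)))

  -- mono x ≡ mono (x % P) modulo Φ, because Φ divides x^P - 1 = (x^D - 1) Φ.
  mono-reduce : ∀ x → mono x ≋ (mono (x % P) +ₚ (Φ *ₚ R x))
  mono-reduce x =
    mono x ≋⟨ ≡→≋ (cong mono (trans (m≡m%n+[m/n]*n x P) refl)) ⟩
    mono (r ℕ.+ q ℕ.* P) ≋⟨ mono-add r (q ℕ.* P) ⟩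
    (mono r *ₚ mono (q ℕ.* P)) ≋⟨ *-congʳ (mono r) (alg0 (mono (q ℕ.* P))) ⟩
    (mono r *ₚ (mono 0 +ₚ (mono (q ℕ.* P) -ₚ mono 0))) ≋⟨ *-congʳ (mono r) (+-congˡ {mono 0} (≋sym (telescope P q))) ⟩
    (mono r *ₚ (mono 0 +ₚ ((mono P -ₚ mono 0) *ₚ S))) ≋⟨ *-congʳ (mono r) (+-congˡ {mono 0} (*-congˡ S (≋sym (telescope D p)))) ⟩
    (mono r *ₚ (mono 0 +ₚ ((ED *ₚ Φ) *ₚ S))) ≋⟨ alg (mono r) ED Φ S ⟩
    (mono r +ₚ (Φ *ₚ (mono r *ₚ (ED *ₚ S)))) ∎≋
    where
    r = x % P
    q = x / P
    S = psum q (λ j → mono (j ℕ.* P))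
    ED = mono D -ₚ mono 0
    alg0 : ∀ Z → Z ≋ (mono 0 +ₚ (Z -ₚ mono 0))
    alg0 = solve 1 (λ Z → Z ⊜ (Κ (mono 0) ⊕ (Z ⊕ (⊝ Κ (mono 0))))) ≋refl
    alg : ∀ A E F S → (A *ₚ (mono 0 +ₚ ((E *ₚ F) *ₚ S))) ≋ (A +ₚ (F *ₚ (A *ₚ (E *ₚ S))))
    alg = solve 4 (λ A E F S → (A ⊗ (Κ (mono 0) ⊕ ((E ⊗ F) ⊗ S))) ⊜ (A ⊕ (F ⊗ (A ⊗ (E ⊗ S))))) ≋refl

  reduced : List ℕ → Poly
  reduced l = sumₚ (map (λ x → mono (x % P)) l)

  quotients : List ℕ → Poly
  quotients l = sumₚ (map R l)

  mask-reduce : ∀ l → maskL l ≋ (reduced l +ₚ (Φ *ₚ quotients l))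
  mask-reduce [] = ≋sym (≋trans (+-idˡ (Φ *ₚ [])) (mul-[] Φ))
  mask-reduce (x ∷ l) = ≋trans (+-cong (mono-reduce x) (mask-reduce l)) (alg (mono (x % P)) (R x) (reduced l) (quotients l) Φ)
    where
    alg : ∀ a b c d F → ((a +ₚ (F *ₚ b)) +ₚ (c +ₚ (F *ₚ d))) ≋ ((a +ₚ c) +ₚ (F *ₚ (b +ₚ d)))
    alg = solve 5 (λ a b c d F → ((a ⊕ (F ⊗ b)) ⊕ (c ⊕ (F ⊗ d))) ⊜ ((a ⊕ c) ⊕ (F ⊗ (b ⊕ d)))) ≋refl

  coeff-mono : ∀ r m → coeff (mono r) m ≡ pos (ι (r ℕ.≟ m))
  coeff-mono zero zero = refl
  coeff-mono zero (suc m) = refl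
  coeff-mono (suc r) zero = refl
  coeff-mono (suc r) (suc m) = trans (coeff-mono r m) (cong pos (ι-iff (r ℕ.≟ m) (suc r ℕ.≟ suc m) (cong suc) ℕP.suc-injective))

  coeff-red : ∀ l m → coeff (reduced l) m ≡ pos (lsumℕ l (λ x → ι ((x % P) ℕ.≟ m)))
  coeff-red [] m = refl
  coeff-red (x ∷ l) m = trans (coeff-+ (mono (x % P)) (reduced l) m) (trans (cong₂ _+ℤ_ (coeff-mono (x % P) m) (coeff-red l m)) (sym (ℤP.pos-+ (ι ((x % P) ℕ.≟ m)) (lsumℕ l (λ y → ι ((y % P) ℕ.≟ m))))))

  ν : List ℕ → ℕ → ℕ
  ν l r = classCount P (P ∸ r) l

  %≡⇒∣+∸ : ∀ x r → r < P → (x % P ≡ r) → P ∣ x ℕ.+ (P ∸ r)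
  %≡⇒∣+∸ x r r<P e = divides (suc (x / P)) (begin
    x ℕ.+ (P ∸ r) ≡⟨ cong (ℕ._+ (P ∸ r)) (m≡m%n+[m/n]*n x P) ⟩
    x % P ℕ.+ x / P ℕ.* P ℕ.+ (P ∸ r) ≡⟨ cong (λ y → y ℕ.+ x / P ℕ.* P ℕ.+ (P ∸ r)) e ⟩
    r ℕ.+ x / P ℕ.* P ℕ.+ (P ∸ r) ≡⟨ ar r (x / P ℕ.* P) (P ∸ r) ⟩
    (r ℕ.+ (P ∸ r)) ℕ.+ x / P ℕ.* P ≡⟨ cong (ℕ._+ x / P ℕ.* P) (ℕP.m+[n∸m]≡n (ℕP.<⇒≤ r<P)) ⟩
    P ℕ.+ x / P ℕ.* P ∎)
    where
    open ≡-Reasoning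
    ar : ∀ a b c → a ℕ.+ b ℕ.+ c ≡ (a ℕ.+ c) ℕ.+ b
    ar a b c = trans (ℕP.+-assoc a b c) (trans (cong (a ℕ.+_) (ℕP.+-comm b c)) (sym (ℕP.+-assoc a c b)))

  ∣+∸⇒%≡ : ∀ x r → r < P → P ∣ x ℕ.+ (P ∸ r) → x % P ≡ r
  ∣+∸⇒%≡ x r r<P d = residue-unique {P} {P ∸ r} (m%n<n x P) r<P d1 d2
    where
    d2 : P ∣ (P ∸ r) ℕ.+ r
    d2 = divides 1 (trans (ℕP.m∸n+n≡m (ℕP.<⇒≤ r<P)) (sym (ℕP.*-identityˡ P)))
    d1 : P ∣ (P ∸ r) ℕ.+ x % P
    d1 = ∣m+n∣m⇒∣n (subst (P ∣_) eq d) (divides (x / P) refl)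
      where
      eq : x ℕ.+ (P ∸ r) ≡ x / P ℕ.* P ℕ.+ ((P ∸ r) ℕ.+ x % P)
      eq = trans (cong (ℕ._+ (P ∸ r)) (m≡m%n+[m/n]*n x P)) (xy∙z≈y∙zx (x % P) (x / P ℕ.* P) (P ∸ r))

  reduced≡psum : ∀ l → reduced l ≋ psum P (λ r → scale (pos (ν l r)) (mono r))
  reduced≡psum l = mk≋ λ m → trans (coeff-red l m) (sym (trans (coeff-psum P _ m) (coeff-sum m)))
    where
    term : ℕ → ℕ → ℤ
    term m r = coeff (scale (pos (ν l r)) (mono r)) m
    count : ℕ → ℕ
    count m = lsumℕ l (λ x → ι ((x % P) ℕ.≟ m))
    term-off : ∀ m r → r ≢ m → term m r ≡ 0ℤ
    term-off m r r≢m = trans (coeff-scale (pos (ν l r)) (mono r) m) (trans (cong (pos (ν l r) *ℤ_) (trans (coeff-mono r m) (cong pos (ι-no (r ℕ.≟ m) r≢m)))) (ℤP.*-zeroʳ (pos (ν l r))))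
    term-diag : ∀ m → term m m ≡ pos (ν l m)
    term-diag m = trans (coeff-scale (pos (ν l m)) (mono m) m) (trans (cong (pos (ν l m) *ℤ_) (trans (coeff-mono m m) (cong pos (ι-yes (m ℕ.≟ m) refl)))) (ℤP.*-identityʳ (pos (ν l m))))
    ν≡count : ∀ m → m < P → ∀ l → ν l m ≡ lsumℕ l (λ x → ι ((x % P) ℕ.≟ m))
    ν≡count m m<P [] = refl
    ν≡count m m<P (x ∷ l) = cong₂ ℕ._+_ (ι-iff (P ∣? (x ℕ.+ (P ∸ m))) ((x % P) ℕ.≟ m) (∣+∸⇒%≡ x m m<P) (%≡⇒∣+∸ x m m<P)) (ν≡count m m<P l)
    count≡0 : ∀ m → ¬ m < P → ∀ l → lsumℕ l (λ x → ι ((x % P) ℕ.≟ m)) ≡ 0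
    count≡0 m m≮P [] = refl
    count≡0 m m≮P (x ∷ l) = cong₂ ℕ._+_ (ι-no ((x % P) ℕ.≟ m) (λ e → m≮P (subst (_< P) e (m%n<n x P)))) (count≡0 m m≮P l)
    coeff-sum : ∀ m → sumℤ P (term m) ≡ pos (count m)
    coeff-sum m with m ℕ.<? P
    ... | yes m<P = trans (sumℤ-single P (term m) m m<P (λ r _ → term-off m r)) (trans (term-diag m) (cong pos (ν≡count m m<P l)))
    ... | no m≮P = trans (sumℤ-zero P (λ r r<P → term-off m r (λ r≡m → m≮P (subst (_< P) r≡m r<P)))) (sym (cong pos (count≡0 m m≮P l)))

  balancedPart : List ℕ → Poly
  balancedPart l = psum D (λ t → scale (pos (ν l t)) (mono t))

  module _ (l : List ℕ) (inv : Balanced (classSums (maskL l))) where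

    classCount-balanced : ∀ s → classCount P (D ℕ.+ s) l ≡ classCount P s l
    classCount-balanced s = ℤP.+-injective (trans (sym (classSum-mask P (D ℕ.+ s) l)) (trans (inv s) (classSum-mask P s l)))

    classCount-balanced-multiple : ∀ j s → classCount P (j ℕ.* D ℕ.+ s) l ≡ classCount P s l
    classCount-balanced-multiple zero s = refl
    classCount-balanced-multiple (suc j) s = trans (cong (λ x → classCount P x l) (ℕP.+-assoc D (j ℕ.* D) s)) (trans (classCount-balanced _) (classCount-balanced-multiple j s))

    νeq : ∀ j t → j < p → t < D → ν l (j ℕ.* D ℕ.+ t) ≡ ν l t
    νeq j t j<p t<D = sym (trans (cong (λ s → classCount P s l) e) (classCount-balanced-multiple j (P ∸ (j ℕ.* D ℕ.+ t))))
      where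
      lt : j ℕ.* D ℕ.+ t ≤ P
      lt = ℕP.<⇒≤ (ℕP.<-≤-trans (ℕP.+-monoʳ-< (j ℕ.* D) t<D) (subst (_≤ P) (ℕP.+-comm D (j ℕ.* D)) (ℕP.*-monoˡ-≤ D j<p)))
      w = P ∸ (j ℕ.* D ℕ.+ t)
      e : P ∸ t ≡ j ℕ.* D ℕ.+ w
      e = trans (cong (_∸ t) (sym (ℕP.m∸n+n≡m lt))) (trans (cong (_∸ t) (sym (ℕP.+-assoc w (j ℕ.* D) t))) (trans (ℕP.m+n∸n≡m (w ℕ.+ j ℕ.* D) t) (ℕP.+-comm w (j ℕ.* D))))

    psum-factor : psum P (λ r → scale (pos (ν l r)) (mono r)) ≋ (Φ *ₚ balancedPart l)
    psum-factor =
      psum P (λ r → scale (pos (ν l r)) (mono r)) ≋⟨ psum-block p D (λ r → scale (pos (ν l r)) (mono r)) ⟩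
      psum p (λ j → psum D (λ t → scale (pos (ν l (j ℕ.* D ℕ.+ t))) (mono (j ℕ.* D ℕ.+ t)))) ≋⟨ psum-cong p (λ j j<p → psum-cong D (λ t t<D → inner j t j<p t<D)) ⟩
      psum p (λ j → psum D (λ t → mono (j ℕ.* D) *ₚ scale (pos (ν l t)) (mono t))) ≋⟨ psum-cong p (λ j _ → psum-mulˡ D (mono (j ℕ.* D)) (λ t → scale (pos (ν l t)) (mono t))) ⟩
      psum p (λ j → mono (j ℕ.* D) *ₚ balancedPart l) ≋⟨ psum-mulʳ p (balancedPart l) (λ j → mono (j ℕ.* D)) ⟩
      (Φ *ₚ balancedPart l) ∎≋
      where
      inner : ∀ j t → j < p → t < D → scale (pos (ν l (j ℕ.* D ℕ.+ t))) (mono (j ℕ.* D ℕ.+ t)) ≋ (mono (j ℕ.* D) *ₚ scale (pos (ν l t)) (mono t))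
      inner j t j<p t<D = ≋trans (≡→≋ (cong (λ c → scale (pos c) (mono (j ℕ.* D ℕ.+ t))) (νeq j t j<p t<D))) (≋trans (scale-cong {pos (ν l t)} (mono-add (j ℕ.* D) t)) (≋sym (scale-mulʳ (pos (ν l t)) (mono (j ℕ.* D)) (mono t))))

    -- Modulo Φ the mask reduces to Σ_{r<P} ν l r x^r, where ν l r counts the x ∈ l with x ≡ r (mod P);
    -- balance makes ν l D-periodic, so this sum is Φ times balancedPart l.
    Balanced⇒cyclotomic∣ : cyclotomicPP p (suc k) ∣ₚ maskL l
    Balanced⇒cyclotomic∣ = (balancedPart l +ₚ quotients l) , subst (λ F → (F *ₚ (balancedPart l +ₚ quotients l)) ≈ₚ maskL l) (sym Φ-def) (≋→≈ (≋sym chain))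
      where
      chain : maskL l ≋ (Φ *ₚ (balancedPart l +ₚ quotients l))
      chain = ≋trans (mask-reduce l) (≋trans (+-congʳ (≋trans (reduced≡psum l) psum-factor)) (≋sym (distribˡ Φ (balancedPart l) (quotients l))))

    balanced⇒difference-exponent : ∀ {x} → x ∈ l → Σ ℕ λ z → z ∈ l × D ∣ ℕ.∣ z - x ∣ × ¬ (P ∣ ℕ.∣ z - x ∣)
    balanced⇒difference-exponent {x} x∈l = z , z∈l , D∣z-x , P∤z-x
      where
      s : ℕ
      s = (P ∸ 1) ℕ.* x
      P∣x+s : P ∣ x ℕ.+ s
      P∣x+s = divides x (begin
        x ℕ.+ (P ∸ 1) ℕ.* x ≡⟨ cong (ℕ._+ (P ∸ 1) ℕ.* x) (sym (ℕP.*-identityˡ x)) ⟩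
        1 ℕ.* x ℕ.+ (P ∸ 1) ℕ.* x ≡⟨ sym (ℕP.*-distribʳ-+ x 1 (P ∸ 1)) ⟩
        (1 ℕ.+ (P ∸ 1)) ℕ.* x ≡⟨ cong (ℕ._* x) (ℕP.m+[n∸m]≡n (ℕ.>-nonZero⁻¹ P)) ⟩
        P ℕ.* x ≡⟨ ℕP.*-comm P x ⟩
        x ℕ.* P ∎)
        where open ≡-Reasoning
      shifted-count-pos : 0 < classCount P (D ℕ.+ s) l
      shifted-count-pos = subst (0 <_) (sym (classCount-balanced s)) (ℕP.≤-trans (ℕP.≤-reflexive (sym (ι-yes (P ∣? (x ℕ.+ s)) P∣x+s))) (divInd≤classCount l x∈l))
      found = classCount>0⇒∈ P (D ℕ.+ s) l shifted-count-pos
      z = proj₁ found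
      z∈l = proj₁ (proj₂ found)
      P∣z+D+s : P ∣ z ℕ.+ (D ℕ.+ s)
      P∣z+D+s = proj₂ (proj₂ found)
      D∣P : D ∣ P
      D∣P = ^-monoʳ-∣ p (ℕP.n≤1+n k)
      D∣z-x : D ∣ ℕ.∣ z - x ∣
      D∣z-x = ∣shifts⇒∣dist {D} {z} {x} {D ℕ.+ s} (∣-trans D∣P P∣z+D+s) (subst (D ∣_) (x∙yz≈y∙xz D x s) (∣m∣n⇒∣m+n (∣-refl {D}) (∣-trans D∣P P∣x+s)))
      P∤z-x : ¬ (P ∣ ℕ.∣ z - x ∣)
      P∤z-x P∣z-x = ℕP.<⇒≱ D<P (∣⇒≤ {{ℕP.m^n≢0 p k}} P∣D)
        where
        P∣z+s : P ∣ z ℕ.+ s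
        P∣z+s = ∣dist⇒∣shift {P} {x} {z} {s} (subst (P ∣_) (ℕP.∣-∣-comm z x) P∣z-x) P∣x+s
        P∣D : P ∣ D
        P∣D = ∣m+n∣m⇒∣n (subst (P ∣_) (x∙yz≈xz∙y z D s) P∣z+D+s) P∣z+s
        D<P : D < P
        D<P = subst (_< P) (ℕP.*-identityˡ D) (ℕP.*-monoˡ-< D {{ℕP.m^n≢0 p k}} (prime>1 pp))

  cyclotomic∣⇒Balanced : ∀ f → cyclotomicPP p (suc k) ∣ₚ f → Balanced (classSums f)
  cyclotomic∣⇒Balanced f (g , e) s = trans (form (D ℕ.+ s)) (trans shifted (sym (form s)))
    where
    G : ℕ → ℤ
    G t = classSum P t g
    e' : (Φ *ₚ g) ≋ f
    e' = ≈→≋ (subst (λ F → (F *ₚ g) ≈ₚ f) Φ-def e)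
    form : ∀ t → classSums f t ≡ sumℤ p (λ j → G (j ℕ.* D ℕ.+ t))
    form t = trans (Λ-≋ (divIndℤ P) (≋sym e') t) (trans (Λ-mul (divIndℤ P) Φ g t) (trans (Λ-psum (λ u → G u) p (λ j → mono (j ℕ.* D)) t) (sumℤ-cong p (λ j _ → Λ-mono (λ u → G u) (j ℕ.* D) t))))
    shifted : sumℤ p (λ j → G (j ℕ.* D ℕ.+ (D ℕ.+ s))) ≡ sumℤ p (λ j → G (j ℕ.* D ℕ.+ s))
    shifted = trans (sumℤ-cong p (λ j _ → cong G (trans (sym (ℕP.+-assoc (j ℕ.* D) D s)) (cong (ℕ._+ s) (ℕP.+-comm (j ℕ.* D) D))))) (sumℤ-shift1 p (λ j → G (j ℕ.* D ℕ.+ s)) (classSum-periodic P s g))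

module LevelCounting (p : ℕ) (pp : Prime p) where
  open import Data.Nat as ℕ using (ℕ; zero; suc; _≤_; _<_; z≤n; s≤s; NonZero; _^_)
  open import Data.Nat.Primality using (Prime)
  open import Data.Bool using (Bool; true; false)

  open import Defs
  open Polynomials
  open FiniteSums
  open ClassSums
  open Sequences
  open Arithmetic
  open FrobeniusDifferences using (prime>1)
  import Data.Nat.Properties as ℕP
  open import Algebra.Properties.CommutativeSemigroup ℕP.*-commutativeSemigroup using (x∙yz≈y∙xz)
  open import Data.Nat.Divisibility using (_∣_; divides; _∣?_; *-monoˡ-∣; ∣-trans)
  open import Data.Integer using (_*_) renaming (+_ to pos)
  import Data.Integer.Properties as ℤP
  open import Data.List using (List)
  open import Data.List.Membership.Propositional using (_∈_)
  open import Data.Product using (Σ; _×_; _,_)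
  open import Data.Empty using (⊥-elim)
  open import Relation.Nullary using (Dec; yes; no; ¬_; does)
  open import Relation.Nullary.Decidable using (dec-true; dec-false)
  open import Relation.Binary.PropositionalEquality

  instance
    nzp : NonZero p
    nzp = ℕ.>-nonZero (ℕP.<-trans (s≤s z≤n) (prime>1 pp))

  nzpow : ∀ k → NonZero (p ^ k)
  nzpow k = ℕP.m^n≢0 p k

  BalancedAt : ℕ → Poly → Set
  BalancedAt l u = Per (p ^ l) (λ s → classSum (p ^ suc l) s u)

  balanced? : ∀ l u → Dec (BalancedAt l u)
  balanced? l u = Per? {p ^ suc l} {p ^ l} {{nzpow (suc l)}} (λ s → classSum-periodic (p ^ suc l) s u)

  bit : Bool → ℕ
  bit true = 1
  bit false = 0

  child : ℕ → ℕ → ℕ → ℕ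
  child k s j = j ℕ.* p ^ k ℕ.+ s

  child-residue : ∀ k s x → p ^ k ∣ x ℕ.+ s → Σ ℕ λ j → j < p × p ^ suc k ∣ x ℕ.+ child k s j
  child-residue k s x (divides w x+s≡w*p^k) with residue-exists p w
  ... | j , j<p , p∣w+j = j , j<p , subst (p ^ suc k ∣_) eq (*-monoˡ-∣ (p ^ k) p∣w+j)
    where
    eq : (w ℕ.+ j) ℕ.* p ^ k ≡ x ℕ.+ child k s j
    eq = begin
      (w ℕ.+ j) ℕ.* p ^ k ≡⟨ ℕP.*-distribʳ-+ (p ^ k) w j ⟩
      w ℕ.* p ^ k ℕ.+ j ℕ.* p ^ k ≡⟨ cong (ℕ._+ j ℕ.* p ^ k) (sym x+s≡w*p^k) ⟩
      x ℕ.+ s ℕ.+ j ℕ.* p ^ k ≡⟨ ℕP.+-assoc x s _ ⟩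
      x ℕ.+ (s ℕ.+ j ℕ.* p ^ k) ≡⟨ cong (x ℕ.+_) (ℕP.+-comm s _) ⟩
      x ℕ.+ child k s j ∎
      where open ≡-Reasoning

  module _ (u : Poly) where

    levels : ℕ → ℕ → ℕ
    levels k r = sumℕ r (λ i → bit (does (balanced? (k ℕ.+ i) u)))

    levels-suc : ∀ k r → levels k (suc r) ≡ bit (does (balanced? k u)) ℕ.+ levels (suc k) r
    levels-suc k r = cong₂ ℕ._+_ (cong (λ x → bit (does (balanced? x u))) (ℕP.+-identityʳ k)) (sumℕ-cong r (λ i _ → cong (λ x → bit (does (balanced? x u))) (ℕP.+-suc k i)))

    p^levels-balanced : ∀ k r → BalancedAt k u → p ^ levels k (suc r) ≡ p ℕ.* p ^ levels (suc k) r
    p^levels-balanced k r bal = cong (p ^_) (trans (levels-suc k r) (cong (λ c → bit c ℕ.+ levels (suc k) r) (dec-true (balanced? k u) bal)))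

    p^levels-unbalanced : ∀ k r → ¬ BalancedAt k u → p ^ levels k (suc r) ≡ p ^ levels (suc k) r
    p^levels-unbalanced k r unbal = cong (p ^_) (trans (levels-suc k r) (cong (λ c → bit c ℕ.+ levels (suc k) r) (dec-false (balanced? k u) unbal)))

    classSum-split : ∀ k s → classSum (p ^ k) s u ≡ sumℤ p (λ j → classSum (p ^ suc k) (child k s j) u)
    classSum-split k s = classSum-refine (p ^ k) p {{nzpow k}} s u

    classSum-balanced-split : ∀ k s → BalancedAt k u → classSum (p ^ k) s u ≡ pos p * classSum (p ^ suc k) s u
    classSum-balanced-split k s bal = trans (classSum-split k s) (trans (sumℤ-cong p (λ j _ → Per-multiple bal j s)) (sumℤ-const p _))

    p^levels∣classSum : ∀ r k s → pos (p ^ levels k r) ∣z classSum (p ^ k) s u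
    p^levels∣classSum zero k s = classSum (p ^ k) s u , sym (ℤP.*-identityˡ _)
    p^levels∣classSum (suc r) k s with balanced? k u
    ... | yes bal = ∣z-meq (trans (sym (ℤP.pos-* p _)) (cong pos (sym (p^levels-balanced k r bal))))
                      (∣z-eq (sym (classSum-balanced-split k s bal)) (∣z-mul (∣z-refl (pos p)) (p^levels∣classSum r (suc k) s)))
    ... | no unbal = ∣z-meq (cong pos (sym (p^levels-unbalanced k r unbal)))
                      (∣z-eq (sym (classSum-split k s)) (∣z-sum p _ (λ j _ → p^levels∣classSum r (suc k) (child k s j))))

  module LowerBound (A : List ℕ) where

    count : ℕ → ℕ → ℕ
    count k s = classCount (p ^ k) s A

    count-split : ∀ k s → count k s ≡ sumℕ p (λ j → count (suc k) (child k s j))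
    count-split k s = classCount-refine (p ^ k) p {{nzpow k}} s A

    count-child≤ : ∀ k s j → j < p → count (suc k) (child k s j) ≤ count k s
    count-child≤ k s j j<p = ℕP.≤-trans (sumℕ-≥ p (λ j → count (suc k) (child k s j)) j j<p) (ℕP.≤-reflexive (sym (count-split k s)))

    count-balanced : ∀ k s j → BalancedAt k (maskL A) → count k s ≡ p ℕ.* count (suc k) (child k s j)
    count-balanced k s j bal = ℤP.+-injective (begin
      pos (count k s) ≡⟨ sym (classSum-mask (p ^ k) s A) ⟩
      classSum (p ^ k) s (maskL A) ≡⟨ classSum-balanced-split (maskL A) k s bal ⟩
      pos p * classSum (p ^ suc k) s (maskL A) ≡⟨ cong (pos p *_) (sym (Per-multiple bal j s)) ⟩
      pos p * classSum (p ^ suc k) (child k s j) (maskL A) ≡⟨ cong (pos p *_) (classSum-mask (p ^ suc k) (child k s j) A) ⟩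
      pos p * pos (count (suc k) (child k s j)) ≡⟨ sym (ℤP.pos-* p _) ⟩
      pos (p ℕ.* count (suc k) (child k s j)) ∎)
      where open ≡-Reasoning

    -- A bound c p^L on one child class lifts to its parent: at a balanced level all p children are equal.
    lift-bound : ∀ c r k s j → j < p → c ℕ.* p ^ levels (maskL A) (suc k) r ≤ count (suc k) (child k s j) → c ℕ.* p ^ levels (maskL A) k (suc r) ≤ count k s
    lift-bound c r k s j j<p bound with balanced? k (maskL A)
    ... | yes bal = begin
      c ℕ.* p ^ levels (maskL A) k (suc r) ≡⟨ cong (c ℕ.*_) (p^levels-balanced (maskL A) k r bal) ⟩
      c ℕ.* (p ℕ.* p ^ levels (maskL A) (suc k) r) ≡⟨ x∙yz≈y∙xz c p _ ⟩
      p ℕ.* (c ℕ.* p ^ levels (maskL A) (suc k) r) ≤⟨ ℕP.*-monoʳ-≤ p bound ⟩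
      p ℕ.* count (suc k) (child k s j) ≡⟨ sym (count-balanced k s j bal) ⟩
      count k s ∎
      where open ℕP.≤-Reasoning
    ... | no unbal = begin
      c ℕ.* p ^ levels (maskL A) k (suc r) ≡⟨ cong (c ℕ.*_) (p^levels-unbalanced (maskL A) k r unbal) ⟩
      c ℕ.* p ^ levels (maskL A) (suc k) r ≤⟨ bound ⟩
      count (suc k) (child k s j) ≤⟨ count-child≤ k s j j<p ⟩
      count k s ∎
      where open ℕP.≤-Reasoning

    p^levels≤count : ∀ r k s x → x ∈ A → p ^ k ∣ x ℕ.+ s → p ^ levels (maskL A) k r ≤ count k s
    p^levels≤count zero k s x x∈A d = ℕP.≤-trans (ℕP.≤-reflexive (sym (ι-yes ((p ^ k) ∣? (x ℕ.+ s)) d))) (divInd≤classCount A x∈A)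
    p^levels≤count (suc r) k s x x∈A d with child-residue k s x d
    ... | j , j<p , dj = ℕP.≤-trans (ℕP.≤-reflexive (sym (ℕP.*-identityˡ _)))
      (lift-bound 1 r k s j j<p (ℕP.≤-trans (ℕP.≤-reflexive (ℕP.*-identityˡ _)) (p^levels≤count r (suc k) (child k s j) x x∈A dj)))

    -- Two elements whose difference has valuation e at an unbalanced level e split into two different children there.
    2p^levels≤count : ∀ r k e → k ≤ e → e < k ℕ.+ r → ¬ BalancedAt e (maskL A) → ∀ s x y → x ∈ A → y ∈ A →
      p ^ k ∣ x ℕ.+ s → p ^ k ∣ y ℕ.+ s → p ^ e ∣ ℕ.∣ x - y ∣ → ¬ (p ^ suc e ∣ ℕ.∣ x - y ∣) → 2 ℕ.* p ^ levels (maskL A) k r ≤ count k s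
    2p^levels≤count zero k e k≤e e<k+0 _ _ _ _ _ _ _ _ _ _ = ⊥-elim (ℕP.<⇒≱ e<k+0 (ℕP.≤-trans (ℕP.≤-reflexive (ℕP.+-identityʳ k)) k≤e))
    2p^levels≤count (suc r) k e k≤e e<k+r+1 unbal s x y x∈A y∈A dx dy de nde with child-residue k s x dx | k ℕ.≟ e
    ... | j , j<p , djx | no k≢e = lift-bound 2 r k s j j<p
      (2p^levels≤count r (suc k) e (ℕP.≤∧≢⇒< k≤e k≢e) (subst (e <_) (ℕP.+-suc k r) e<k+r+1) unbal (child k s j) x y x∈A y∈A djx djy de nde)
      where
      djy : p ^ suc k ∣ y ℕ.+ child k s j
      djy = ∣dist⇒∣shift {p ^ suc k} {x} {y} {child k s j} (∣-trans (^-monoʳ-∣ p (ℕP.≤∧≢⇒< k≤e k≢e)) de) djx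
    ... | j , j<p , djx | yes refl with child-residue k s y dy
    ...   | j' , j'<p , djy = begin
      2 ℕ.* p ^ levels (maskL A) k (suc r) ≡⟨ cong (2 ℕ.*_) (p^levels-unbalanced (maskL A) k r unbal) ⟩
      L ℕ.+ (L ℕ.+ 0) ≤⟨ ℕP.+-mono-≤ (bound j x x∈A djx) (ℕP.≤-trans (ℕP.≤-reflexive (ℕP.+-identityʳ L)) (bound j' y y∈A djy)) ⟩
      count (suc k) (child k s j) ℕ.+ count (suc k) (child k s j') ≤⟨ sumℕ-≥2 p (λ j → count (suc k) (child k s j)) j j' j<p j'<p j≢j' ⟩
      sumℕ p (λ j → count (suc k) (child k s j)) ≡⟨ sym (count-split k s) ⟩
      count k s ∎
      where
      open ℕP.≤-Reasoning
      L = p ^ levels (maskL A) (suc k) r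
      bound : ∀ j z → z ∈ A → p ^ suc k ∣ z ℕ.+ child k s j → L ≤ count (suc k) (child k s j)
      bound j z z∈A dz = p^levels≤count r (suc k) (child k s j) z z∈A dz
      j≢j' : j ≢ j'
      j≢j' refl = nde (∣shifts⇒∣dist {p ^ suc k} {x} {y} {child k s j} djx djy)

module TilingPeriodicity (N : ℕ) (a : Fin N → ℕ) (til : Tiles a) where
  open import Data.Nat as ℕ using (ℕ; zero; suc; _≤_; _<_; z≤n; s≤s; NonZero; _^_; _∸_)
  open import Data.Fin as Fin using (Fin; zero; suc; toℕ)
  open import Defs

  open FiniteSums
  open Arithmetic
  import Data.Nat.Properties as ℕP
  import Data.Fin.Properties as FinP
  open import Data.Integer as ℤ using (ℤ; 0ℤ; 1ℤ) renaming (+_ to pos; _+_ to _+ℤ_)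
  import Data.Integer.Properties as ℤP
  open import Data.Product using (Σ; _×_; _,_; proj₁; proj₂)
  open import Data.Empty using (⊥-elim)
  open import Data.Bool using (Bool; true; false)
  open import Relation.Nullary using (Dec; yes; no; ¬_; does)
  open import Relation.Binary.PropositionalEquality
  open import Function using (_∘_)

  C : ℤ → Set
  C = proj₁ til

  cover : ∀ z → Σ (Fin N) λ i → Σ ℤ λ c → C c × z ≡ pos (a i) +ℤ c
  cover = proj₁ (proj₂ til)

  uniq : ∀ i j c d → C c → C d → pos (a i) +ℤ c ≡ pos (a j) +ℤ d → i ≡ j × c ≡ d
  uniq = proj₂ (proj₂ til)

  i* : Fin N
  i* = proj₁ (cover 0ℤ)

  C? : ∀ z → Dec (C z)
  C? z with cover (pos (a i*) +ℤ z)
  ... | i , c , c∈C , e with i FinP.≟ i*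
  ...   | yes refl = yes (subst C (sym (+-cancelˡ (pos (a i)) z c e)) c∈C)
  ...   | no ne = no (λ z∈C → ne (sym (proj₁ (uniq i* i z c z∈C c∈C e))))

  sumFℕ : ∀ n → (Fin n → ℕ) → ℕ
  sumFℕ zero f = 0
  sumFℕ (suc n) f = f zero ℕ.+ sumFℕ n (f ∘ suc)

  sumFℕ-≥ : ∀ n f i → f i ≤ sumFℕ n f
  sumFℕ-≥ (suc n) f zero = ℕP.m≤m+n _ _
  sumFℕ-≥ (suc n) f (suc i) = ℕP.≤-trans (sumFℕ-≥ n (f ∘ suc) i) (ℕP.m≤n+m _ _)

  W : ℕ
  W = suc (sumFℕ N a)

  a<W : ∀ i → a i < W
  a<W i = s≤s (sumFℕ-≥ N a i)

  argmin : ∀ {n} → Fin n → (f : Fin n → ℕ) → Σ (Fin n) λ i → ∀ j → f i ≤ f j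
  argmin {suc zero} _ f = zero , λ { zero → ℕP.≤-refl }
  argmin {suc (suc n)} _ f with argmin {suc n} zero (f ∘ suc)
  ... | i , h with f zero ℕ.≤? f (suc i)
  ...   | yes le = zero , λ { zero → ℕP.≤-refl ; (suc j) → ℕP.≤-trans le (h j) }
  ...   | no gt = suc i , λ { zero → ℕP.<⇒≤ (ℕP.≰⇒> gt) ; (suc j) → h j }

  imin : Fin N
  imin = proj₁ (argmin i* a)

  amin : ℕ
  amin = a imin

  amin≤ : ∀ i → amin ≤ a i
  amin≤ = proj₂ (argmin i* a)

  pos+ : ∀ m n → pos m +ℤ pos n ≡ pos (m ℕ.+ n)
  pos+ m n = sym (ℤP.pos-+ m n)

  -- Whether x + W ∈ C is determined by C on the window [x, x + W): the point x + W + amin is covered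
  -- by exactly one a i + c, and that c either lies in the window or equals x + W.
  C-next⇒ : ∀ x → C (pos (x ℕ.+ W)) → ∀ t i → t < W → C (pos (x ℕ.+ t)) → t ℕ.+ a i ≢ W ℕ.+ amin
  C-next⇒ x cW t i t<W ct e = ℕP.<⇒≢ t<W (ℕP.+-cancelˡ-≡ x t W (ℤP.+-injective (proj₂ (uniq i imin (pos (x ℕ.+ t)) (pos (x ℕ.+ W)) ct cW eq'))))
    where
    arith : a i ℕ.+ (x ℕ.+ t) ≡ amin ℕ.+ (x ℕ.+ W)
    arith = trans (ℕP.+-comm (a i) (x ℕ.+ t)) (trans (ℕP.+-assoc x t (a i)) (trans (cong (x ℕ.+_) (trans e (ℕP.+-comm W amin))) (trans (sym (ℕP.+-assoc x amin W)) (trans (cong (ℕ._+ W) (ℕP.+-comm x amin)) (ℕP.+-assoc amin x W)))))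
    eq' : pos (a i) +ℤ pos (x ℕ.+ t) ≡ pos amin +ℤ pos (x ℕ.+ W)
    eq' = trans (pos+ (a i) (x ℕ.+ t)) (trans (cong pos arith) (sym (pos+ amin (x ℕ.+ W))))

  C-next⇐ : ∀ x → (∀ t i → t < W → C (pos (x ℕ.+ t)) → t ℕ.+ a i ≢ W ℕ.+ amin) → C (pos (x ℕ.+ W))
  C-next⇐ x h with cover (pos (x ℕ.+ (W ℕ.+ amin)))
  ... | i , c , c∈C , e = res
    where
    ai≤ : a i ≤ W ℕ.+ amin
    ai≤ = ℕP.≤-trans (ℕP.<⇒≤ (a<W i)) (ℕP.m≤m+n W amin)
    u : ℕ
    u = W ℕ.+ amin ∸ a i
    ueq : u ℕ.+ a i ≡ W ℕ.+ amin
    ueq = ℕP.m∸n+n≡m ai≤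
    c≡ : c ≡ pos (x ℕ.+ u)
    c≡ = sym (+-cancelˡ (pos (a i)) (pos (x ℕ.+ u)) c (trans (pos+ (a i) (x ℕ.+ u)) (trans (cong pos ar) e)))
      where
      ar : a i ℕ.+ (x ℕ.+ u) ≡ x ℕ.+ (W ℕ.+ amin)
      ar = trans (ℕP.+-comm (a i) _) (trans (ℕP.+-assoc x u (a i)) (cong (x ℕ.+_) ueq))
    u≤W : u ≤ W
    u≤W = ℕP.≤-trans (ℕP.∸-monoʳ-≤ (W ℕ.+ amin) (amin≤ i)) (ℕP.≤-reflexive (ℕP.m+n∸n≡m W amin))
    res : C (pos (x ℕ.+ W))
    res with u ℕ.≟ W
    ... | yes uW = subst (λ v → C (pos (x ℕ.+ v))) uW (subst C c≡ c∈C)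
    ... | no uW = ⊥-elim (h u i (ℕP.≤∧≢⇒< u≤W uW) (subst C c≡ c∈C) ueq)

  SameWindow : ℕ → ℕ → Set
  SameWindow x y = ∀ t → t < W → (C (pos (x ℕ.+ t)) → C (pos (y ℕ.+ t))) × (C (pos (y ℕ.+ t)) → C (pos (x ℕ.+ t)))

  SameWindow-next : ∀ x y → SameWindow x y → C (pos (x ℕ.+ W)) → C (pos (y ℕ.+ W))
  SameWindow-next x y wa cxW = C-next⇐ y (λ t i t<W cyt e → C-next⇒ x cxW t i t<W (proj₂ (wa t t<W) cyt) e)

  SameWindow-sym : ∀ {x y} → SameWindow x y → SameWindow y x
  SameWindow-sym wa t t<W = proj₂ (wa t t<W) , proj₁ (wa t t<W)

  SameWindow-suc : ∀ x y → SameWindow x y → SameWindow (suc x) (suc y)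
  SameWindow-suc x y wa t t<W with suc t ℕ.<? W
  ... | yes st<W = subst (λ v → (C (pos v) → C (pos (suc y ℕ.+ t)))) (ℕP.+-suc x t) (subst (λ v → C (pos (x ℕ.+ suc t)) → C (pos v)) (ℕP.+-suc y t) (proj₁ (wa (suc t) st<W)))
                 , subst (λ v → (C (pos v) → C (pos (suc x ℕ.+ t)))) (ℕP.+-suc y t) (subst (λ v → C (pos (y ℕ.+ suc t)) → C (pos v)) (ℕP.+-suc x t) (proj₂ (wa (suc t) st<W)))
  ... | no st≮W = f1 , f2
    where
    tW : suc t ≡ W
    tW = ℕP.≤-antisym t<W (ℕP.≮⇒≥ st≮W)
    ex : ∀ z → suc z ℕ.+ t ≡ z ℕ.+ W
    ex z = trans (sym (ℕP.+-suc z t)) (cong (z ℕ.+_) tW)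
    f1 : C (pos (suc x ℕ.+ t)) → C (pos (suc y ℕ.+ t))
    f1 cx = subst (λ v → C (pos v)) (sym (ex y)) (SameWindow-next x y wa (subst (λ v → C (pos v)) (ex x) cx))
    f2 : C (pos (suc y ℕ.+ t)) → C (pos (suc x ℕ.+ t))
    f2 cy = subst (λ v → C (pos v)) (sym (ex x)) (SameWindow-next y x (SameWindow-sym wa) (subst (λ v → C (pos v)) (ex y) cy))

  SameWindow-+ : ∀ x y → SameWindow x y → ∀ m → SameWindow (m ℕ.+ x) (m ℕ.+ y)
  SameWindow-+ x y wa zero = wa
  SameWindow-+ x y wa (suc m) = SameWindow-suc (m ℕ.+ x) (m ℕ.+ y) (SameWindow-+ x y wa m)

  bool→Fin2 : Bool → Fin 2
  bool→Fin2 false = zero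
  bool→Fin2 true = suc zero

  bool→Fin2-injective : ∀ {x y} → bool→Fin2 x ≡ bool→Fin2 y → x ≡ y
  bool→Fin2-injective {false} {false} _ = refl
  bool→Fin2-injective {true} {true} _ = refl
  bool→Fin2-injective {false} {true} ()
  bool→Fin2-injective {true} {false} ()

  encode : (ℕ → Bool) → ∀ n → Fin (2 ^ n)
  encode f zero = zero
  encode f (suc n) = Fin.combine (bool→Fin2 (f 0)) (encode (f ∘ suc) n)

  encode-injective : ∀ n f g → encode f n ≡ encode g n → ∀ t → t < n → f t ≡ g t
  encode-injective (suc n) f g e t t<n = go t t<n
    where
    pr : (bool→Fin2 (f 0) , encode (f ∘ suc) n) ≡ (bool→Fin2 (g 0) , encode (g ∘ suc) n)
    pr = trans (sym (FinP.remQuot-combine (bool→Fin2 (f 0)) (encode (f ∘ suc) n))) (trans (cong (Fin.remQuot (2 ^ n)) e) (FinP.remQuot-combine (bool→Fin2 (g 0)) (encode (g ∘ suc) n)))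
    go : ∀ t → t < suc n → f t ≡ g t
    go zero _ = bool→Fin2-injective (cong proj₁ pr)
    go (suc t) (s≤s t<n) = encode-injective n (f ∘ suc) (g ∘ suc) (cong proj₂ pr) t t<n

  does-iff : ∀ {P Q : Set} (d1 : Dec P) (d2 : Dec Q) → does d1 ≡ does d2 → (P → Q) × (Q → P)
  does-iff (yes p) (yes q) _ = (λ _ → q) , (λ _ → p)
  does-iff (no ¬p) (no ¬q) _ = (λ p → ⊥-elim (¬p p)) , (λ q → ⊥-elim (¬q q))
  does-iff (yes p) (no ¬q) ()
  does-iff (no ¬p) (yes q) ()

  window : ℕ → ℕ → Bool
  window x t = does (C? (pos (x ℕ.+ t)))

  windowCode : ℕ → Fin (2 ^ W)
  windowCode x = encode (window x) W

  record Periodic : Set where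
    field
      x1 : ℕ
      M0 : ℕ
      M0pos : 0 < M0
      per : ∀ d → (C (pos (x1 ℕ.+ d)) → C (pos (x1 ℕ.+ (d ℕ.+ M0)))) × (C (pos (x1 ℕ.+ (d ℕ.+ M0))) → C (pos (x1 ℕ.+ d)))

  -- Two of the first 2^W + 1 windows coincide, and equal windows have equal successors.
  C-eventually-periodic : Periodic
  C-eventually-periodic with FinP.pigeonhole (ℕP.n<1+n (2 ^ W)) (λ i → windowCode (toℕ i))
  ... | i , j , i<j , e = record { x1 = x1 ; M0 = x2 ∸ x1 ; M0pos = ℕP.m<n⇒0<n∸m i<j ; per = per }
    where
    x1 = toℕ i
    x2 = toℕ j
    wa0 : SameWindow x1 x2
    wa0 t t<W = does-iff (C? (pos (x1 ℕ.+ t))) (C? (pos (x2 ℕ.+ t))) (encode-injective W (window x1) (window x2) e t t<W)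
    ar1 : ∀ d → d ℕ.+ x1 ℕ.+ 0 ≡ x1 ℕ.+ d
    ar1 d = trans (ℕP.+-identityʳ _) (ℕP.+-comm d x1)
    ar2 : ∀ d → d ℕ.+ x2 ℕ.+ 0 ≡ x1 ℕ.+ (d ℕ.+ (x2 ∸ x1))
    ar2 d = trans (ℕP.+-identityʳ _) (trans (cong (d ℕ.+_) (sym (ℕP.m+[n∸m]≡n (ℕP.<⇒≤ i<j)))) (trans (sym (ℕP.+-assoc d x1 _)) (trans (cong (ℕ._+ (x2 ∸ x1)) (ℕP.+-comm d x1)) (ℕP.+-assoc x1 d _))))
    per : ∀ d → (C (pos (x1 ℕ.+ d)) → C (pos (x1 ℕ.+ (d ℕ.+ (x2 ∸ x1))))) × (C (pos (x1 ℕ.+ (d ℕ.+ (x2 ∸ x1)))) → C (pos (x1 ℕ.+ d)))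
    per d = (λ c → subst (λ v → C (pos v)) (ar2 d) (proj₁ (SameWindow-+ x1 x2 wa0 d 0 (s≤s z≤n)) (subst (λ v → C (pos v)) (sym (ar1 d)) c)))
          , (λ c → subst (λ v → C (pos v)) (ar1 d) (proj₂ (SameWindow-+ x1 x2 wa0 d 0 (s≤s z≤n)) (subst (λ v → C (pos v)) (sym (ar2 d)) c)))

  open Periodic C-eventually-periodic public

  mem : ℕ → Set
  mem d = C (pos (x1 ℕ.+ d))

  mem-periodic : ∀ q d → (mem d → mem (q ℕ.* M0 ℕ.+ d)) × (mem (q ℕ.* M0 ℕ.+ d) → mem d)
  mem-periodic zero d = (λ m → m) , (λ m → m)
  mem-periodic (suc q) d = (λ m → subst mem ar (proj₁ (per (q ℕ.* M0 ℕ.+ d)) (proj₁ (mem-periodic q d) m)))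
                 , (λ m → proj₂ (mem-periodic q d) (proj₂ (per (q ℕ.* M0 ℕ.+ d)) (subst mem (sym ar) m)))
    where
    ar : q ℕ.* M0 ℕ.+ d ℕ.+ M0 ≡ suc q ℕ.* M0 ℕ.+ d
    ar = trans (ℕP.+-comm _ M0) (sym (ℕP.+-assoc M0 (q ℕ.* M0) d))

  sumFℤ : ∀ n → (Fin n → ℤ) → ℤ
  sumFℤ zero f = 0ℤ
  sumFℤ (suc n) f = f zero +ℤ sumFℤ n (f ∘ suc)

  sumFℤ-single : ∀ n f i0 → (∀ i → i ≢ i0 → f i ≡ 0ℤ) → sumFℤ n f ≡ f i0
  sumFℤ-single (suc n) f zero z = trans (cong (f zero +ℤ_) (zeroAll n (f ∘ suc) (λ i → z (suc i) (λ ())))) (ℤP.+-identityʳ _)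
    where
    zeroAll : ∀ n f → (∀ i → f i ≡ 0ℤ) → sumFℤ n f ≡ 0ℤ
    zeroAll zero f h = refl
    zeroAll (suc n) f h = trans (cong₂ _+ℤ_ (h zero) (zeroAll n (f ∘ suc) (h ∘ suc))) refl
  sumFℤ-single (suc n) f (suc i0) z = trans (cong (_+ℤ sumFℤ n (f ∘ suc)) (z zero (λ ()))) (trans (ℤP.+-identityˡ _) (sumFℤ-single n (f ∘ suc) i0 (λ i ne → z (suc i) (λ e → ne (FinP.suc-injective e)))))

  module Complement (L : ℕ) .{{nzL : NonZero L}} where

    open import Defs
    open Polynomials
    open ClassSums
    open import Data.List using (List; map; tabulate; allFin)
    open import Data.Nat.DivMod using (_%_; _/_; m≡m%n+[m/n]*n; m%n<n)
    open import Data.Nat.Divisibility using (_∣_; divides; _∣?_; ∣m+n∣m⇒∣n)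

    M : ℕ
    M = L ℕ.* M0

    instance
      nzM : NonZero M
      nzM = ℕP.m*n≢0 L M0 {{nzL}} {{ℕ.>-nonZero M0pos}}

    mem-periodic-M : ∀ q d → (mem d → mem (q ℕ.* M ℕ.+ d)) × (mem (q ℕ.* M ℕ.+ d) → mem d)
    mem-periodic-M q d = (λ m → subst (λ v → mem (v ℕ.+ d)) ar (proj₁ (mem-periodic (q ℕ.* L) d) m)) , (λ m → proj₂ (mem-periodic (q ℕ.* L) d) (subst (λ v → mem (v ℕ.+ d)) (sym ar) m))
      where
      ar : q ℕ.* L ℕ.* M0 ≡ q ℕ.* M
      ar = ℕP.*-assoc q L M0

    χ : ℕ → ℕ
    χ d = ι (C? (pos (x1 ℕ.+ d)))

    -- The mask of one period of C; since A ⊕ C = ℤ, A(x) C0(x) ≡ 1 + x + ⋯ + x^(M - 1) modulo x^M - 1.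
    C0 : Poly
    C0 = fromCoeffs M (λ d → pos (χ d))

    Al : List ℕ
    Al = map a (allFin N)

    lsum-tab : ∀ {A : Set} n (g : A → ℕ) (f : Fin n → A) F → lsum (map g (tabulate f)) F ≡ sumFℤ n (λ i → F (g (f i)))
    lsum-tab zero g f F = refl
    lsum-tab (suc n) g f F = cong (F (g (f zero)) +ℤ_) (lsum-tab n g (f ∘ suc) F)

    term-zero : ∀ d u → ¬ (mem d × M ∣ d ℕ.+ u) → pos (χ d) ℤ.* divIndℤ M (d ℕ.+ u) ≡ 0ℤ
    term-zero d u h with C? (pos (x1 ℕ.+ d)) | M ∣? (d ℕ.+ u)
    ... | yes m | yes dv = ⊥-elim (h (m , dv))
    ... | yes m | no _ = refl
    ... | no _ | _ = ℤP.*-zeroˡ (divIndℤ M (d ℕ.+ u))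

    term-one : ∀ d u → mem d → M ∣ d ℕ.+ u → pos (χ d) ℤ.* divIndℤ M (d ℕ.+ u) ≡ 1ℤ
    term-one d u m dv with C? (pos (x1 ℕ.+ d)) | M ∣? (d ℕ.+ u)
    ... | yes _ | yes _ = refl
    ... | yes _ | no ndv = ⊥-elim (ndv dv)
    ... | no nm | _ = ⊥-elim (nm m)

    ∣+⇒∣%+ : ∀ {x u} → M ∣ x ℕ.+ u → M ∣ x % M ℕ.+ u
    ∣+⇒∣%+ {x} {u} d = ∣m+n∣m⇒∣n (subst (M ∣_) e d) (divides (x / M) refl)
      where
      e : x ℕ.+ u ≡ x / M ℕ.* M ℕ.+ (x % M ℕ.+ u)
      e = trans (cong (ℕ._+ u) (trans (m≡m%n+[m/n]*n x M) (ℕP.+-comm (x % M) _))) (ℕP.+-assoc (x / M ℕ.* M) (x % M) u)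

    module AtShift (s : ℕ) where
      big : ℕ
      big = (s ℕ.+ W) ℕ.* M

      le : ∀ i → a i ℕ.+ s ≤ big
      le i = ℕP.≤-trans (ℕP.<⇒≤ (subst (_< W ℕ.+ s) refl (ℕP.+-monoˡ-< s (a<W i)))) (ℕP.≤-trans (ℕP.≤-reflexive (ℕP.+-comm W s)) (ℕP.m≤m*n (s ℕ.+ W) M))

      Y : Fin N → ℕ
      Y i = big ∸ (a i ℕ.+ s)

      Yeq : ∀ i → Y i ℕ.+ (a i ℕ.+ s) ≡ big
      Yeq i = ℕP.m∸n+n≡m (le i)

      divY : ∀ i → M ∣ Y i ℕ.+ (a i ℕ.+ s)
      divY i = divides (s ℕ.+ W) (Yeq i)

      y : ℤ
      y = pos (x1 ℕ.+ (big ∸ s))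

      yeq : ∀ i → pos (a i) +ℤ pos (x1 ℕ.+ Y i) ≡ y
      yeq i = trans (pos+ (a i) (x1 ℕ.+ Y i)) (cong pos (trans (ℕP.+-comm (a i) _) (trans (ℕP.+-assoc x1 (Y i) (a i)) (cong (x1 ℕ.+_) ar))))
        where
        ar : Y i ℕ.+ a i ≡ big ∸ s
        ar = sym (trans (cong (_∸ s) (trans (sym (Yeq i)) (sym (ℕP.+-assoc (Y i) (a i) s)))) (ℕP.m+n∸n≡m (Y i ℕ.+ a i) s))

      cv = cover y
      i0 : Fin N
      i0 = proj₁ cv
      c : ℤ
      c = proj₁ (proj₂ cv)
      c∈C : C c
      c∈C = proj₁ (proj₂ (proj₂ cv))
      ce : y ≡ pos (a i0) +ℤ c
      ce = proj₂ (proj₂ (proj₂ cv))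

      c≡ : c ≡ pos (x1 ℕ.+ Y i0)
      c≡ = sym (+-cancelˡ (pos (a i0)) (pos (x1 ℕ.+ Y i0)) c (trans (yeq i0) ce))

      memY0 : mem (Y i0)
      memY0 = subst C c≡ c∈C

      Ydec : ∀ i → Y i ≡ Y i / M ℕ.* M ℕ.+ Y i % M
      Ydec i = trans (m≡m%n+[m/n]*n (Y i) M) (ℕP.+-comm (Y i % M) _)

      d0 : ℕ
      d0 = Y i0 % M

      d0<M : d0 < M
      d0<M = m%n<n (Y i0) M

      memd0 : mem d0
      memd0 = proj₂ (mem-periodic-M (Y i0 / M) d0) (subst mem (Ydec i0) memY0)

      divd0 : M ∣ d0 ℕ.+ (a i0 ℕ.+ s)
      divd0 = ∣+⇒∣%+ (divY i0)

      uniqPair : ∀ i d → d < M → mem d → M ∣ d ℕ.+ (a i ℕ.+ s) → i ≡ i0 × d ≡ d0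
      uniqPair i d d<M md dv = ii0 , trans dY (cong (λ j → Y j % M) ii0)
        where
        dY : d ≡ Y i % M
        dY = residue-unique {M} {a i ℕ.+ s} d<M (m%n<n (Y i) M) (subst (M ∣_) (ℕP.+-comm d _) dv) (subst (M ∣_) (ℕP.+-comm (Y i % M) _) (∣+⇒∣%+ (divY i)))
        memYi : mem (Y i)
        memYi = subst mem (sym (Ydec i)) (proj₁ (mem-periodic-M (Y i / M) (Y i % M)) (subst mem dY md))
        ii0 : i ≡ i0
        ii0 = proj₁ (uniq i i0 (pos (x1 ℕ.+ Y i)) c memYi c∈C (trans (yeq i) ce))

    classSum-mask*complement≡1 : ∀ s → classSum M s (maskL Al *ₚ C0) ≡ 1ℤ
    classSum-mask*complement≡1 s = begin
      classSum M s (maskL Al *ₚ C0) ≡⟨ Λ-mul (divIndℤ M) (maskL Al) C0 s ⟩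
      Λ (λ t → Λ (divIndℤ M) C0 t) (maskL Al) s ≡⟨ Λ-mask (λ t → Λ (divIndℤ M) C0 t) Al s ⟩
      lsum Al (λ x → Λ (divIndℤ M) C0 (x ℕ.+ s)) ≡⟨ lsum-tab N a (λ i → i) (λ x → Λ (divIndℤ M) C0 (x ℕ.+ s)) ⟩
      sumFℤ N (λ i → Λ (divIndℤ M) C0 (a i ℕ.+ s)) ≡⟨ sumFℤ-single N _ i0 others ⟩
      Λ (divIndℤ M) C0 (a i0 ℕ.+ s) ≡⟨ Λ-fromCoeffs (divIndℤ M) M (λ d → pos (χ d)) (a i0 ℕ.+ s) ⟩
      sumℤ M (λ d → pos (χ d) ℤ.* divIndℤ M (d ℕ.+ (a i0 ℕ.+ s))) ≡⟨ sumℤ-single M _ d0 d0<M (λ d d<M ne → term-zero d _ (λ { (md , dv) → ne (proj₂ (uniqPair i0 d d<M md dv)) })) ⟩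
      pos (χ d0) ℤ.* divIndℤ M (d0 ℕ.+ (a i0 ℕ.+ s)) ≡⟨ term-one d0 _ memd0 divd0 ⟩
      1ℤ ∎
      where
      open ≡-Reasoning
      open AtShift s
      others : ∀ i → i ≢ i0 → Λ (divIndℤ M) C0 (a i ℕ.+ s) ≡ 0ℤ
      others i ne = trans (Λ-fromCoeffs (divIndℤ M) M (λ d → pos (χ d)) (a i ℕ.+ s)) (sumℤ-zero M (λ d d<M → term-zero d _ (λ { (md , dv) → ne (proj₁ (uniqPair i d d<M md dv)) })))

module Evaluation where

  open import Defs
  open Polynomials
  open FiniteSums
  open ClassSums
  open PolynomialSums
  open import Data.Nat as ℕ using (ℕ; zero; suc; _^_; _∸_)
  import Data.Nat.Properties as ℕP
  open import Data.Nat.Divisibility using (divides; _∣?_)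
  open import Data.Integer using (ℤ; 1ℤ) renaming (+_ to pos; _+_ to _+ℤ_; _*_ to _*ℤ_)
  import Data.Integer.Properties as ℤP
  open import Data.Fin using (Fin; zero; suc)
  open import Data.List using ([]; _∷_; map; tabulate; allFin)
  import Data.List.Properties as LP
  open import Relation.Binary.PropositionalEquality
  open import Function using (_∘_; id)

  ε : Poly → ℤ
  ε u = Λ (λ _ → 1ℤ) u 0

  Λ-const-offset : ∀ c u s → Λ (λ _ → c) u s ≡ Λ (λ _ → c) u 0
  Λ-const-offset c [] s = refl
  Λ-const-offset c (x ∷ u) s = cong (x *ℤ c +ℤ_) (trans (Λ-const-offset c u (suc s)) (sym (Λ-const-offset c u 1)))

  ε-mul : ∀ f g → ε (f *ₚ g) ≡ ε f *ℤ ε g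
  ε-mul f g = begin
    Λ (λ _ → 1ℤ) (f *ₚ g) 0 ≡⟨ Λ-mul (λ _ → 1ℤ) f g 0 ⟩
    Λ (λ t → Λ (λ _ → 1ℤ) g t) f 0 ≡⟨ Λ-Fcong (λ t → trans (Λ-const-offset 1ℤ g t) (sym (ℤP.*-identityʳ (ε g)))) f 0 ⟩
    Λ (λ _ → ε g *ℤ 1ℤ) f 0 ≡⟨ Λ-Fsc (ε g) (λ _ → 1ℤ) f 0 ⟩
    ε g *ℤ ε f ≡⟨ ℤP.*-comm (ε g) (ε f) ⟩
    ε f *ℤ ε g ∎
    where open ≡-Reasoning

  ε-cyclotomic : ∀ q β → ε (cyclotomicPP q β) ≡ pos q
  ε-cyclotomic q β = begin
    ε (cyclotomicPP q β) ≡⟨ cong ε (sumₚ-applyUpTo (λ r → mono (r ℕ.* q ^ (β ∸ 1))) id q) ⟩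
    Λ (λ _ → 1ℤ) (psum q (λ r → mono (r ℕ.* q ^ (β ∸ 1)))) 0 ≡⟨ Λ-psum (λ _ → 1ℤ) q (λ r → mono (r ℕ.* q ^ (β ∸ 1))) 0 ⟩
    sumℤ q (λ r → Λ (λ _ → 1ℤ) (mono (r ℕ.* q ^ (β ∸ 1))) 0) ≡⟨ sumℤ-cong q (λ r _ → Λ-mono (λ _ → 1ℤ) (r ℕ.* q ^ (β ∸ 1)) 0) ⟩
    sumℤ q (λ _ → 1ℤ) ≡⟨ sumℤ-const q 1ℤ ⟩
    pos q *ℤ 1ℤ ≡⟨ ℤP.*-identityʳ (pos q) ⟩
    pos q ∎
    where open ≡-Reasoning

  divInd-1 : ∀ t → divInd 1 t ≡ 1
  divInd-1 t = ι-yes (1 ∣? t) (divides t (sym (ℕP.*-identityʳ t)))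

  classSum-1≡ε : ∀ u → classSum 1 0 u ≡ ε u
  classSum-1≡ε u = Λ-Fcong (λ t → cong pos (divInd-1 t)) u 0

  classCount-1-tabulate : ∀ {A : Set} n (g : A → ℕ) (f : Fin n → A) → classCount 1 0 (map g (tabulate f)) ≡ n
  classCount-1-tabulate zero g f = refl
  classCount-1-tabulate (suc n) g f = cong₂ ℕ._+_ (divInd-1 _) (classCount-1-tabulate n g (f ∘ suc))

  ε-mask : ∀ N (a : Fin N → ℕ) → ε (maskL (map a (allFin N))) ≡ pos N
  ε-mask N a = trans (sym (classSum-1≡ε (maskL (map a (allFin N))))) (trans (classSum-mask 1 0 (map a (allFin N))) (cong pos (classCount-1-tabulate N a (λ i → i))))

  maskPoly≡maskL : ∀ N (a : Fin N → ℕ) → maskPoly a ≡ maskL (map a (allFin N))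
  maskPoly≡maskL N a = cong sumₚ (LP.map-∘ (allFin N))

module TilingBalance (p n : ℕ) (pp : Prime p) (a : Fin (p ^ n) → ℕ) (inj : Injective _≡_ _≡_ a) (til : Tiles a) where

  open import Defs
  open Polynomials
  open FiniteSums
  open ClassSums
  open Sequences
  open Arithmetic
  open Evaluation
  open LevelCounting p pp
  open FrobeniusDifferences using (prime>1)
  open import Data.Nat as ℕ using (ℕ; suc; _≤_; _<_; z≤n; s≤s; NonZero; _^_; _∸_; ∣_-_∣)
  import Data.Nat.Properties as ℕP
  open import Data.Nat.Divisibility using (_∣_; divides; ∣⇒≤)
  open import Data.Integer using (1ℤ) renaming (+_ to pos; _*_ to _*ℤ_)
  import Data.Integer.Properties as ℤP
  open import Data.Fin using (Fin)
  open import Data.List.Membership.Propositional.Properties using (∈-map⁺; ∈-allFin)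
  open import Data.Sum using (_⊎_; inj₁; inj₂)
  open import Data.Empty using (⊥-elim)
  open import Relation.Nullary using (Dec; yes; no; ¬_; does)
  open import Relation.Binary.PropositionalEquality
  open import Function using (id)

  N = p ^ n

  module Til = TilingPeriodicity N a til

  -- Padding the period by p^W makes v_p(M) exceed the valuation of every difference a i - a j < W.
  W = Til.W
  L = p ^ W

  instance
    nzL : NonZero L
    nzL = nzpow W

  module MM = Til.Complement L

  M = MM.M
  C0 = MM.C0
  Al = MM.Al

  open Valuation (valuation p (prime>1 pp) Til.M0 Til.M0pos) renaming (exponent to v; unit to m; decomposition to M0≡p^v*m; unit-coprime to p∤m)

  K = W ℕ.+ v

  M≡p^K*m : M ≡ p ^ K ℕ.* m
  M≡p^K*m = trans (cong (L ℕ.*_) M0≡p^v*m) (trans (sym (ℕP.*-assoc L (p ^ v) m)) (cong (ℕ._* m) (sym (ℕP.^-distribˡ-+-* p W v))))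

  m>0 : 0 < m
  m>0 = ℕP.n≢0⇒n>0 (λ m≡0 → ℕP.<⇒≢ Til.M0pos (sym (trans M0≡p^v*m (trans (cong (p ^ v ℕ.*_) m≡0) (ℕP.*-zeroʳ (p ^ v))))))

  AC = maskL Al *ₚ C0

  product-balanced : ∀ l → l < K → BalancedAt l AC
  product-balanced l l<K s = trans (constant (p ^ l ℕ.+ s)) (sym (constant s))
    where
    q = p ^ (K ∸ suc l) ℕ.* m
    instance
      nzq : NonZero q
      nzq = ℕP.m*n≢0 (p ^ (K ∸ suc l)) m {{nzpow (K ∸ suc l)}} {{ℕ.>-nonZero m>0}}
    q*p^l+1≡M : q ℕ.* p ^ suc l ≡ M
    q*p^l+1≡M = trans (ℕP.*-comm q _) (trans (sym (ℕP.*-assoc (p ^ suc l) (p ^ (K ∸ suc l)) m)) (trans (cong (ℕ._* m) (trans (sym (ℕP.^-distribˡ-+-* p (suc l) (K ∸ suc l))) (cong (p ^_) (ℕP.m+[n∸m]≡n l<K)))) (sym M≡p^K*m)))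
    constant : ∀ t → classSum (p ^ suc l) t AC ≡ pos q *ℤ 1ℤ
    constant t = trans (classSum-refine (p ^ suc l) q {{nzpow (suc l)}} t AC) (trans (sumℤ-cong q (λ j _ → trans (cong (λ z → classSum z (j ℕ.* p ^ suc l ℕ.+ t) AC) q*p^l+1≡M) (MM.classSum-mask*complement≡1 _))) (sumℤ-const q 1ℤ))

  isBalanced : Poly → ℕ → ℕ
  isBalanced u l = bit (does (balanced? l u))

  mask-or-complement-balanced : ∀ l → l < K → 1 ≤ isBalanced (maskL Al) l ℕ.+ isBalanced C0 l
  mask-or-complement-balanced l l<K = bits-cover (balanced? l (maskL Al)) (balanced? l C0) (CyclotomicPrimality.Balanced-product p pp l (maskL Al) C0 (product-balanced l l<K))
    where
    bits-cover : ∀ {P Q : Set} (P? : Dec P) (Q? : Dec Q) → P ⊎ Q → 1 ≤ bit (does P?) ℕ.+ bit (does Q?)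
    bits-cover (yes _) _ _ = s≤s z≤n
    bits-cover (no _) (yes _) _ = s≤s z≤n
    bits-cover (no ¬P) (no _) (inj₁ P) = ⊥-elim (¬P P)
    bits-cover (no _) (no ¬Q) (inj₂ Q) = ⊥-elim (¬Q Q)

  levelsA = levels (maskL Al) 0 K
  levelsC = levels C0 0 K

  K≤levelsA+levelsC : K ≤ levelsA ℕ.+ levelsC
  K≤levelsA+levelsC = begin
    K ≡⟨ sym (trans (sumℕ-const K 1) (ℕP.*-identityʳ K)) ⟩
    sumℕ K (λ _ → 1) ≤⟨ sumℕ-mono K (λ _ → 1) (λ l → isBalanced (maskL Al) l ℕ.+ isBalanced C0 l) mask-or-complement-balanced ⟩
    sumℕ K (λ l → isBalanced (maskL Al) l ℕ.+ isBalanced C0 l) ≡⟨ sumℕ-+ K (isBalanced (maskL Al)) (isBalanced C0) ⟩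
    levelsA ℕ.+ levelsC ∎
    where open ℕP.≤-Reasoning

  -- Evaluating the product at x = 1 in two ways: |A| ε(C0) = M, while p^levelsC divides ε(C0).
  n+levelsC≤K : n ℕ.+ levelsC ≤ K
  n+levelsC≤K = p^a∣p^K*m⇒a≤K pp (n ℕ.+ levelsC) K m p∤m (subst (p ^ (n ℕ.+ levelsC) ∣_) M≡p^K*m (subst (_∣ M) (sym (ℕP.^-distribˡ-+-* p n levelsC)) N*p^levelsC∣M))
    where
    ε-product : pos M ≡ pos N *ℤ ε C0
    ε-product = begin
      pos M ≡⟨ sym (trans (sumℤ-const M 1ℤ) (ℤP.*-identityʳ (pos M))) ⟩
      sumℤ M (λ _ → 1ℤ) ≡⟨ sym (trans (classSum-refine 1 M {{ℕ.>-nonZero (s≤s z≤n)}} 0 AC) (sumℤ-cong M (λ j _ → trans (cong (λ z → classSum z (j ℕ.* 1 ℕ.+ 0) AC) (ℕP.*-identityʳ M)) (MM.classSum-mask*complement≡1 _)))) ⟩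
      classSum 1 0 AC ≡⟨ classSum-1≡ε AC ⟩
      ε AC ≡⟨ ε-mul (maskL Al) C0 ⟩
      ε (maskL Al) *ℤ ε C0 ≡⟨ cong (_*ℤ ε C0) (ε-mask N a) ⟩
      pos N *ℤ ε C0 ∎
      where open ≡-Reasoning
    p^levelsC∣εC0 : pos (p ^ levelsC) ∣z ε C0
    p^levelsC∣εC0 = subst (pos (p ^ levelsC) ∣z_) (classSum-1≡ε C0) (p^levels∣classSum C0 K 0 0)
    N*p^levelsC∣M : N ℕ.* p ^ levelsC ∣ M
    N*p^levelsC∣M = ∣z⇒∣abs (∣z-meq (sym (ℤP.pos-* N (p ^ levelsC))) (∣z-eq (sym ε-product) (∣z-mul (∣z-refl (pos N)) p^levelsC∣εC0)))

  n≤levelsA : n ≤ levelsA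
  n≤levelsA = ℕP.+-cancelʳ-≤ levelsC n levelsA (ℕP.≤-trans n+levelsC≤K K≤levelsA+levelsC)

  difference-exponent⇒balanced : ∀ i j e → ¬ (i ≡ j) → p ^ e ∣ ∣ a i - a j ∣ → ¬ (p ^ suc e ∣ ∣ a i - a j ∣) → BalancedAt e (maskL Al)
  difference-exponent⇒balanced i j e i≢j p^e∣ p^e+1∤ with balanced? e (maskL Al)
  ... | yes bal = bal
  ... | no unbal = ⊥-elim (ℕP.<⇒≱ N<2N 2N≤N)
    where
    ai≢aj : ∣ a i - a j ∣ ≢ 0
    ai≢aj z = i≢j (inj (ℕP.∣m-n∣≡0⇒m≡n z))
    diff<W : ∣ a i - a j ∣ < W
    diff<W with ℕP.∣m-n∣≡[m∸n]∨[n∸m] (a i) (a j)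
    ... | inj₁ e1 = subst (_< W) (sym e1) (ℕP.≤-<-trans (ℕP.m∸n≤m (a i) (a j)) (Til.a<W i))
    ... | inj₂ e2 = subst (_< W) (sym e2) (ℕP.≤-<-trans (ℕP.m∸n≤m (a j) (a i)) (Til.a<W j))
    e<K : e < K
    e<K = ℕP.<-≤-trans (n<p^n p (prime>1 pp) e) (ℕP.≤-trans (∣⇒≤ {{ℕ.≢-nonZero ai≢aj}} p^e∣) (ℕP.≤-trans (ℕP.<⇒≤ diff<W) (ℕP.m≤m+n W v)))
    2p^levelsA≤N : 2 ℕ.* p ^ levelsA ≤ N
    2p^levelsA≤N = ℕP.≤-trans
      (LowerBound.2p^levels≤count Al K 0 e z≤n e<K unbal 0 (a i) (a j) (∈-map⁺ a (∈-allFin i)) (∈-map⁺ a (∈-allFin j))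
        (divides (a i ℕ.+ 0) (sym (ℕP.*-identityʳ _))) (divides (a j ℕ.+ 0) (sym (ℕP.*-identityʳ _))) p^e∣ p^e+1∤)
      (ℕP.≤-reflexive (classCount-1-tabulate N a id))
    2N≤N : 2 ℕ.* N ≤ N
    2N≤N = ℕP.≤-trans (ℕP.*-monoʳ-≤ 2 (ℕP.^-monoʳ-≤ p n≤levelsA)) 2p^levelsA≤N
    N<2N : N < 2 ℕ.* N
    N<2N = subst (N <_) (cong (N ℕ.+_) (sym (ℕP.+-identityʳ N))) (ℕP.m<m+n N (ℕP.n≢0⇒n>0 (ℕ.≢-nonZero⁻¹ N {{nzpow n}})))

module MaskDivisors (p n : ℕ) (pp : Prime p) (a : Fin (p ^ n) → ℕ) where

  open import Defs
  open Polynomials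
  open ClassSums
  open Sequences
  open Arithmetic
  open Evaluation
  open FrobeniusDifferences using (prime>1)
  open import Data.Nat as ℕ using (ℕ; suc; z≤n; s≤s; _^_; ∣_-_∣)
  import Data.Nat.Properties as ℕP
  open import Data.Nat.Divisibility using (_∣_; divides)
  open import Data.Integer using (1ℤ) renaming (+_ to pos; _*_ to _*ℤ_)
  open import Data.Fin as Fin using (Fin)
  open import Data.List using (map; allFin)
  open import Data.List.Membership.Propositional.Properties using (∈-map⁺; ∈-map⁻; ∈-allFin)
  open import Data.Product using (Σ; _×_; _,_; proj₁; proj₂)
  open import Relation.Nullary using (¬_)
  open import Relation.Binary.PropositionalEquality

  Al = map a (allFin (p ^ n))

  DifferenceExponent : ℕ → Set
  DifferenceExponent s = Σ (Fin (p ^ n)) λ i → Σ (Fin (p ^ n)) λ j → Σ ℕ λ e →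
    ¬ (i ≡ j) × (p ^ e ∣ ∣ a i - a j ∣) × ¬ (p ^ suc e ∣ ∣ a i - a j ∣) × s ≡ p ^ suc e

  cyclotomic∣mask⇒q∣size : ∀ q β → cyclotomicPP q β ∣ₚ maskPoly a → q ∣ p ^ n
  cyclotomic∣mask⇒q∣size q β (g , Φg≈A) = ∣z⇒∣abs (ε g , (begin
    pos (p ^ n) ≡⟨ sym (ε-mask (p ^ n) a) ⟩
    ε (maskL Al) ≡⟨ cong ε (sym (maskPoly≡maskL (p ^ n) a)) ⟩
    ε (maskPoly a) ≡⟨ Λ-≋ (λ _ → 1ℤ) {maskPoly a} {cyclotomicPP q β *ₚ g} (≈→≋ (λ k → sym (Φg≈A k))) 0 ⟩
    ε (cyclotomicPP q β *ₚ g) ≡⟨ ε-mul (cyclotomicPP q β) g ⟩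
    ε (cyclotomicPP q β) *ℤ ε g ≡⟨ cong (_*ℤ ε g) (ε-cyclotomic q β) ⟩
    pos q *ℤ ε g ∎))
    where open ≡-Reasoning

  balanced⇒cyclotomic∣mask : ∀ k → LevelCounting.BalancedAt p pp k (maskL Al) → cyclotomicPP p (suc k) ∣ₚ maskPoly a
  balanced⇒cyclotomic∣mask k bal = subst (cyclotomicPP p (suc k) ∣ₚ_) (sym (maskPoly≡maskL (p ^ n) a)) (CyclotomicDivisibility.Balanced⇒cyclotomic∣ p pp k Al bal)

  InS⇒difference-exponent : ∀ s → InS a s → DifferenceExponent s
  InS⇒difference-exponent s (q , suc k , pq , _ , s≡ , Φ∣A) with prime∣p^n⇒≡ pp pq n (cyclotomic∣mask⇒q∣size q (suc k) Φ∣A)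
  ... | refl = j , i0 , k , j≢i0 , p^k∣ , p^k+1∤ , s≡
    where
    i0 : Fin (p ^ n)
    i0 = Fin.fromℕ< (ℕP.m^n>0 p {{ℕ.>-nonZero (ℕP.<-trans (s≤s z≤n) (prime>1 pp))}} n)
    bal = CyclotomicDivisibility.cyclotomic∣⇒Balanced p pp k (maskL Al) (subst (cyclotomicPP p (suc k) ∣ₚ_) (maskPoly≡maskL (p ^ n) a) Φ∣A)
    found = CyclotomicDivisibility.balanced⇒difference-exponent p pp k Al bal (∈-map⁺ a (∈-allFin i0))
    z = proj₁ found
    j : Fin (p ^ n)
    j = proj₁ (∈-map⁻ a (proj₁ (proj₂ found)))
    z≡aj : z ≡ a j
    z≡aj = proj₂ (proj₂ (∈-map⁻ a (proj₁ (proj₂ found))))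
    p^k∣ : p ^ k ∣ ∣ a j - a i0 ∣
    p^k∣ = subst (λ w → p ^ k ∣ ∣ w - a i0 ∣) z≡aj (proj₁ (proj₂ (proj₂ found)))
    p^k+1∤ : ¬ (p ^ suc k ∣ ∣ a j - a i0 ∣)
    p^k+1∤ = subst (λ w → ¬ (p ^ suc k ∣ ∣ w - a i0 ∣)) z≡aj (proj₂ (proj₂ (proj₂ found)))
    j≢i0 : ¬ (j ≡ i0)
    j≢i0 j≡i0 = p^k+1∤ (subst (p ^ suc k ∣_) (sym (ℕP.m≡n⇒∣m-n∣≡0 (cong a j≡i0))) (divides 0 refl))

proposition2p11 : (p n : ℕ) → Prime p → n ≥ 1 →
    (a : Fin (p ^ n) → ℕ) → Injective _≡_ _≡_ a → Tiles a →
    (s : ℕ) → InS a s ⇔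
      (Σ (Fin (p ^ n)) λ i → Σ (Fin (p ^ n)) λ j → Σ ℕ λ e →
         ¬ (i ≡ j) × (p ^ e ∣ ∣ a i - a j ∣) × ¬ (p ^ suc e ∣ ∣ a i - a j ∣)
         × s ≡ p ^ suc e)
proposition2p11 p n pp _ a inj til s = mk⇔ (InS⇒difference-exponent s) difference-exponent⇒InS
  where
  open MaskDivisors p n pp a
  difference-exponent⇒InS : DifferenceExponent s → InS a s
  difference-exponent⇒InS (i , j , e , i≢j , p^e∣ , p^e+1∤ , s≡) =
    p , suc e , pp , s≤s z≤n , s≡ ,
    balanced⇒cyclotomic∣mask e (TilingBalance.difference-exponent⇒balanced p n pp a inj til i j e i≢j p^e∣ p^e+1∤)
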